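{- Let $\Delta:\mathcal{A}\to\mathcal{A}\otimes\mathcal{A}$ be the linear map defined by $\Delta(|)=|\otimes|$ and, for every reduced tree $t\neq|$, $\Delta(t)=\sum_{c\text{ admissible cut of }t}G^c(t)\otimes P^c(t)$; let $\varepsilon:\mathcal{A}\to\mathbb{K}$ be linear with $\varepsilon(|)=1$ and $\varepsilon(\mathcal{A}^+)=0$. Then $(\mathcal{A},*,|,\Delta,\varepsilon)$ is a graded connected bialgebra for the grading $(\mathcal{A}_n)_{n\ge0}$, and $\Delta$ preserves the tridendriform structure: $\Delta(x\ltimes y)=\Delta(x)\ltimes\Delta(y)$ for all $x,y\in\mathcal{A}^+$ and $\ltimes\in\{\prec,\cdot,\succ\}$ (products on $\mathcal{A}\otimes\mathcal{A}$ as in the context). Moreover $\Delta$ is the unique coproduct with $\Delta(|)=|\otimes|$ and $\Delta(Y)=Y\otimes|+|\otimes Y$ preserving the tridendriform structure in this sense.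
   Context: Tridendriform algebra: vector space with bilinear $\prec,\cdot,\succ$ such that, with $*=\prec+\cdot+\succ$: $(a\prec b)\prec c=a\prec(b*c)$, $(a\succ b)\prec c=a\succ(b\prec c)$, $(a*b)\succ c=a\succ(b\succ c)$, $(a\succ b)\cdot c=a\succ(b\cdot c)$, $(a\prec b)\cdot c=a\cdot(b\succ c)$, $(a\cdot b)\prec c=a\cdot(b\prec c)$, $(a\cdot b)\cdot c=a\cdot(b\cdot c)$. A reduced tree is a planar rooted tree (root edge below the root, leaves as top edges) whose internal vertices all have at least two children; $|$ is the tree with one leaf and no internal vertex. $T_n$ = reduced trees with $n+1$ leaves, $\mathcal{A}_n=\mathbb{K}T_n$, $\mathcal{A}=\bigoplus_{n\ge0}\mathcal{A}_n$, $\mathcal{A}^+=\bigoplus_{n\ge1}\mathcal{A}_n$. $x^{(0)}\vee\cdots\vee x^{(k)}$ ($k\ge1$) grafts trees left to right on a new root (multilinear); $Y=|\vee|$. Recursively, for $x=x^{(0)}\vee\cdots\vee x^{(k)}$, $y=y^{(0)}\vee\cdots\vee y^{(l)}$: $x\prec y=x^{(0)}\vee\cdots\vee x^{(k-1)}\vee(x^{(k)}*y)$, $x\cdot y=x^{(0)}\vee\cdots\vee x^{(k-1)}\vee(x^{(k)}*y^{(0)})\vee y^{(1)}\vee\cdots\vee y^{(l)}$, $x\succ y=(x*y^{(0)})\vee y^{(1)}\vee\cdots\vee y^{(l)}$, with $*=\prec+\cdot+\succ$ and $|$ a unit for $*$; $\mathcal{A}^+$ is the free tridendriform algebra on $Y$.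 For $a\in\mathcal{A}^+$: $|\prec a=0$, $a\prec|=a$, $|\succ a=a$, $a\succ|=0$, $|\cdot a=a\cdot|=0$. On $\mathcal{A}\otimes\mathcal{A}$, for trees: $(a\otimes b)\ltimes(c\otimes d)=(a*c)\otimes(b\ltimes d)$ if $b\ne|$ or $d\ne|$, and $(a\otimes|)\ltimes(c\otimes|)=(a\ltimes c)\otimes|$; $(a\otimes b)*(c\otimes d)=(a*c)\otimes(b*d)$. Admissible cuts: an internal edge joins two internal vertices; an admissible cut is a nonempty set $c$ of internal edges with at most one on each root-to-leaf path, or the empty cut, or the total cut. For nonempty non-total $c$ with $m$ edges, removing them leaves $G^c_1(t),\dots,G^c_m(t)$ (left to right; cut edges become root edges) and the root component $P^c(t)$ (cut edges become leaves), and $G^c(t)=G^c_1(t)*\cdots*G^c_m(t)$; empty cut: $P^c(t)=t,G^c(t)=|$; total cut: $P^c(t)=|,G^c(t)=t$. A bialgebra $H$ is graded by $(H_n)$ if $H=\bigoplus H_n$ with $H_n$ finite-dimensional, $H_iH_j\subseteq H_{i+j}$ and $\Delta(H_n)\subseteq\sum_{i+j=n}H_i\otimes H_j$; it is connected if $\dim H_0=1$. -}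

module Defs where

open import Level using (_⊔_)
open import Algebra.Bundles using (CommutativeRing)
open import Data.Nat using (ℕ; zero; suc; _∸_) renaming (_+_ to _+ℕ_)
open import Data.List using (List; []; _∷_; _++_; map; concatMap; foldr)
open import Data.List.Membership.Propositional using (_∈_)
open import Data.Bool using (Bool; true; false; _∧_; _∨_; if_then_else_)
open import Data.Product using (_×_; _,_; ∃; ∃-syntax)
open import Relation.Binary.PropositionalEquality using (_≡_; _≢_)
open import Relation.Nullary using (¬_)

-- Reduced planar rooted trees.
--   leaf            = |  (one leaf, no internal vertex)
--   node t₀ ms tₖ   = t₀ ∨ t₁ ∨ ⋯ ∨ tₖ  where ms = [t₁ , … , t_{k-1}]  (k ≥ 1)
-- i.e. the root has children t₀ ∷ ms ++ [tₖ] (at least two), left to right.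

data Tree : Set where
  leaf : Tree
  node : Tree → List Tree → Tree → Tree

Y : Tree
Y = node leaf [] leaf

leaves  : Tree → ℕ
leavesL : List Tree → ℕ
leaves leaf          = 1
leaves (node a ms b) = leaves a +ℕ leavesL ms +ℕ leaves b
leavesL []       = 0
leavesL (t ∷ ts) = leaves t +ℕ leavesL ts

-- t ∈ T_n  iff  deg t ≡ n  (t has n+1 leaves)
deg : Tree → ℕ
deg t = leaves t ∸ 1

eqT : Tree → Tree → Bool
eqL : List Tree → List Tree → Bool
eqT leaf leaf = true
eqT leaf (node _ _ _) = false
eqT (node _ _ _) leaf = false
eqT (node a ms b) (node c ns d) = eqT a c ∧ eqL ms ns ∧ eqT b d
eqL [] [] = true
eqL [] (_ ∷ _) = false
eqL (_ ∷ _) [] = false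
eqL (s ∷ ss) (t ∷ ts) = eqT s t ∧ eqL ss ts

isLeaf : Tree → Bool
isLeaf leaf = true
isLeaf (node _ _ _) = false

-- An admissible cut which is not the total cut is a set of internal edges
-- (edges between two internal vertices) with at most one on each
-- root-to-leaf path.  `cutsBelow t` lists, for every such set c of internal
-- edges of t (including the empty set), the pair
--   ( [G^c_1(t), … , G^c_m(t)] , P^c(t) ).
-- `childOpts s` lists the possibilities for a child subtree s hanging from
-- an internal vertex: if s is internal, either the edge above s is cut
-- (s goes to the list of cut-off pieces and is replaced by a leaf in the
-- root component), or it is not cut and we choose a cut inside s.

cutsBelow  : Tree → List (List Tree × Tree)
childOpts  : Tree → List (List Tree × Tree)
childOptsL : List Tree → List (List Tree × List Tree)
cutsBelow leaf = ([] , leaf) ∷ []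
cutsBelow (node a ms b) =
  concatMap (λ { (g₁ , p₁) →
    concatMap (λ { (gs , ps) →
      map (λ { (g₂ , p₂) → (g₁ ++ gs ++ g₂ , node p₁ ps p₂) }) (childOpts b) })
      (childOptsL ms) })
    (childOpts a)
childOpts leaf = ([] , leaf) ∷ []
childOpts (node a ms b) = ((node a ms b ∷ []) , leaf) ∷ cutsBelow (node a ms b)
childOptsL [] = ([] , []) ∷ []
childOptsL (t ∷ ts) =
  concatMap (λ { (g , p) → map (λ { (gs , ps) → (g ++ gs , p ∷ ps) }) (childOptsL ts) })
    (childOpts t)

data Op : Set where
  `≺ `· `≻ : Op

-- Linear algebra over a commutative ring R (the field 𝕂).
-- Elements of 𝒜 = 𝕂T are formal finite sums (lists of coefficient/tree
-- pairs), compared by their coefficient functions.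

module TD {c ℓ} (R : CommutativeRing c ℓ) where
  open CommutativeRing R renaming (Carrier to K)

  IsField : Set (c ⊔ ℓ)
  IsField = (¬ (1# ≈ 0#)) × (∀ x → ¬ (x ≈ 0#) → ∃[ y ] (x * y ≈ 1#))

  V : Set c
  V = List (K × Tree)
  V2 : Set c
  V2 = List (K × Tree × Tree)
  V3 : Set c
  V3 = List (K × Tree × Tree × Tree)

  coeff : V → Tree → K
  coeff v t = foldr (λ { (a , s) r → if eqT s t then a + r else r }) 0# v
  coeff2 : V2 → Tree → Tree → K
  coeff2 z t u = foldr (λ { (a , s , s') r → if eqT s t ∧ eqT s' u then a + r else r }) 0# z
  coeff3 : V3 → Tree → Tree → Tree → K
  coeff3 z t u w = foldr (λ { (a , s , s' , s'') r →
                     if eqT s t ∧ eqT s' u ∧ eqT s'' w then a + r else r }) 0# z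

  infix 4 _≈V_ _≈2_ _≈3_
  _≈V_ : V → V → Set ℓ
  x ≈V y = ∀ t → coeff x t ≈ coeff y t
  _≈2_ : V2 → V2 → Set ℓ
  x ≈2 y = ∀ t u → coeff2 x t u ≈ coeff2 y t u
  _≈3_ : V3 → V3 → Set ℓ
  x ≈3 y = ∀ t u w → coeff3 x t u w ≈ coeff3 y t u w

  single : Tree → V
  single t = (1# , t) ∷ []
  single2 : Tree → Tree → V2
  single2 t u = (1# , t , u) ∷ []

  scale : K → V → V
  scale k = map (λ { (a , t) → (k * a , t) })
  scale2 : K → V2 → V2
  scale2 k = map (λ { (a , t , u) → (k * a , t , u) })

  lin : (Tree → V) → V → V
  lin f = concatMap (λ { (a , t) → scale a (f t) })
  lin2 : (Tree → V2) → V → V2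
  lin2 f = concatMap (λ { (a , t) → scale2 a (f t) })

  bilin : (Tree → Tree → V) → V → V → V
  bilin f x y = concatMap (λ { (a , s) → concatMap (λ { (b , t) → scale (a * b) (f s t) }) y }) x

  tens : V → V → V2
  tens x y = concatMap (λ { (a , s) → map (λ { (b , t) → (a * b , s , t) }) y }) x

  choices : List V → List (K × List Tree)
  choices [] = (1# , []) ∷ []
  choices (v ∷ vs) =
    concatMap (λ { (a , t) → map (λ { (b , ts) → (a * b , t ∷ ts) }) (choices vs) }) v

  graft : V → List V → V → V
  graft v₀ vs vₖ =
    concatMap (λ { (a , t₀) →
      concatMap (λ { (b , ts) → map (λ { (d , tₖ) → (a * b * d , node t₀ ts tₖ) }) vₖ })
        (choices vs) }) v₀

  -- Conventions with | as in the context: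
  -- |≺a = 0, a≺| = a, |≻a = a, a≻| = 0, |·a = a·| = 0 (a ≠ |), | unit of *.
  -- The undefined values |≺|, |≻|, |·| are set to 0 (never used).
  prec dot succ star : Tree → Tree → V
  prec leaf _ = []
  prec (node a ms b) leaf = single (node a ms b)
  prec (node a ms b) (node c ns d) = graft (single a) (map single ms) (star b (node c ns d))
  dot leaf _ = []
  dot (node _ _ _) leaf = []
  dot (node a ms b) (node c ns d) =
    graft (single a) (map single ms ++ (star b c ∷ map single ns)) (single d)
  succ leaf leaf = []
  succ leaf (node c ns d) = single (node c ns d)
  succ (node _ _ _) leaf = []
  succ (node a ms b) (node c ns d) = graft (star (node a ms b) c) (map single ns) (single d)
  star leaf y = single y
  star (node a ms b) leaf = single (node a ms b)
  star (node a ms b) (node c ns d) =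
    prec (node a ms b) (node c ns d) ++ dot (node a ms b) (node c ns d)
      ++ succ (node a ms b) (node c ns d)

  opTree : Op → Tree → Tree → V
  opTree `≺ = prec
  opTree `· = dot
  opTree `≻ = succ

  opV : Op → V → V → V
  opV o = bilin (opTree o)
  starV : V → V → V
  starV = bilin star

  opTens : Op → (Tree × Tree) → (Tree × Tree) → V2
  opTens o (a , b) (c , d) =
    if isLeaf b ∧ isLeaf d
      then tens (opTree o a c) (single leaf)
      else tens (star a c) (opTree o b d)
  starTens : (Tree × Tree) → (Tree × Tree) → V2
  starTens (a , b) (c , d) = tens (star a c) (star b d)

  bilin2 : ((Tree × Tree) → (Tree × Tree) → V2) → V2 → V2 → V2
  bilin2 f x y = concatMap (λ { (a , s , s') → concatMap (λ { (b , t , t') →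
                   scale2 (a * b) (f (s , s') (t , t')) }) y }) x

  opT : Op → V2 → V2 → V2
  opT o = bilin2 (opTens o)
  starT : V2 → V2 → V2
  starT = bilin2 starTens

  starFold : List Tree → V
  starFold [] = single leaf
  starFold (g ∷ gs) = starV (single g) (starFold gs)

  -- The coproduct on basis trees:
  --   Δ(|) = |⊗| ,  Δ(t) = t⊗| (total cut) + Σ_{c ≠ total} G^c(t) ⊗ P^c(t)
  Δ : Tree → V2
  Δ leaf = single2 leaf leaf
  Δ (node a ms b) =
    (1# , node a ms b , leaf) ∷
      concatMap (λ { (gs , p) → tens (starFold gs) (single p) }) (cutsBelow (node a ms b))

  ΔV : V → V2
  ΔV = lin2 Δ

  ε : V → K
  ε v = coeff v leaf

  ε⊗id : V2 → V
  ε⊗id = map (λ { (a , s , t) → (a * ε (single s) , t) })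
  id⊗ε : V2 → V
  id⊗ε = map (λ { (a , s , t) → (a * ε (single t) , s) })

  Δ⊗id : V2 → V3
  Δ⊗id = concatMap (λ { (a , s , t) → map (λ { (b , u , w) → (a * b , u , w , t) }) (Δ s) })
  id⊗Δ : V2 → V3
  id⊗Δ = concatMap (λ { (a , s , t) → map (λ { (b , u , w) → (a * b , s , u , w) }) (Δ t) })

  InPlus : V → Set ℓ
  InPlus x = coeff x leaf ≈ 0#
  InDeg : ℕ → V → Set ℓ
  InDeg n x = ∀ t → deg t ≢ n → coeff x t ≈ 0#
  InDeg2 : ℕ → V2 → Set ℓ
  InDeg2 n z = ∀ t u → deg t +ℕ deg u ≢ n → coeff2 z t u ≈ 0#

  PreservesTri : (Tree → V2) → Set (c ⊔ ℓ)
  PreservesTri D = ∀ (o : Op) (x y : V) → InPlus x → InPlus y →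
                   lin2 D (opV o x y) ≈2 opT o (lin2 D x) (lin2 D y)

  record IsGradedConnectedBialgebra : Set (c ⊔ ℓ) where
    field
      ⋆-assoc     : ∀ x y z → starV (starV x y) z ≈V starV x (starV y z)
      ⋆-identityˡ : ∀ x → starV (single leaf) x ≈V x
      ⋆-identityʳ : ∀ x → starV x (single leaf) ≈V x
      Δ-coassoc   : ∀ x → Δ⊗id (ΔV x) ≈3 id⊗Δ (ΔV x)
      ε-counitˡ   : ∀ x → ε⊗id (ΔV x) ≈V x
      ε-counitʳ   : ∀ x → id⊗ε (ΔV x) ≈V x
      Δ-*         : ∀ x y → ΔV (starV x y) ≈2 starT (ΔV x) (ΔV y)
      Δ-unit      : ΔV (single leaf) ≈2 single2 leaf leaf
      ε-*         : ∀ x y → ε (starV x y) ≈ ε x * ε y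
      ε-unit      : ε (single leaf) ≈ 1#
      finiteDim   : ∀ n → ∃[ L ] (∀ t → deg t ≡ n → t ∈ L)
      grade-*     : ∀ i j x y → InDeg i x → InDeg j y → InDeg (i +ℕ j) (starV x y)
      grade-Δ     : ∀ n x → InDeg n x → InDeg2 n (ΔV x)
      connected   : (deg leaf ≡ 0) × (∀ t → deg t ≡ 0 → t ≡ leaf)

-- The non-total admissible cuts of t = t₀ ∨ ⋯ ∨ tₖ are chosen childwise (cut the edge above a
-- child, or cut inside it), so Δ t = t ⊗ | + (Δ t₀ ⊛ ⋯ ⊛ Δ tₖ) with the G-parts multiplied by * and the
-- P-parts regrafted on a new root.  With this recursion and the recursive definitions of ≺, · and ≻,
-- Δ(x ⋈ y) = Δx ⋈ Δy follows for basis trees by induction on x and y: on both sides the terms with a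
-- total cut of the product match, and the others are products of cuts of x and of y meeting in the
-- child where x and y are glued.  Summing the three operations makes Δ multiplicative for *; the same
-- recursion gives coassociativity, counitality and homogeneity, and * is associative by expanding both
-- sides into nine matching terms.  Uniqueness: every tree other than | and Y is x ≺ y, x ≻ y or x · y
-- for smaller trees x, y ≠ |, so a tridendriform coproduct is determined by its value on Y.
-- Everything is proved on basis trees and extended linearly.

module Submission where

open import Defs
open import Algebra.Bundles using (CommutativeRing)
open import Data.Product using (_×_; _,_)
open import Data.List using (_++_)

module TreeSize where

  open import Data.Nat using (suc; _≤_; z≤n; s≤s) renaming (_+_ to _+ℕ_)
  open import Data.Nat.Properties as NP using (≤-trans; m≤m+n; m≤n+m; +-mono-≤; +-monoˡ-≤)
  open import Data.List using ([]; _∷_; _++_; length)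
  open import Relation.Binary.PropositionalEquality as P using (_≡_)
  open import Defs

  leaves≡suc-deg : ∀ t → leaves t ≡ suc (deg t)
  leaves≡suc-deg leaf = P.refl
  leaves≡suc-deg (node a ms b) rewrite leaves≡suc-deg a = P.refl

  leavesL-++ : ∀ xs ys → leavesL (xs ++ ys) ≡ leavesL xs +ℕ leavesL ys
  leavesL-++ [] ys = P.refl
  leavesL-++ (x ∷ xs) ys = P.trans (P.cong (leaves x +ℕ_) (leavesL-++ xs ys)) (P.sym (NP.+-assoc (leaves x) _ _))

  1≤leaves : ∀ t → 1 ≤ leaves t
  1≤leaves t rewrite leaves≡suc-deg t = s≤s z≤n

  2≤leaves-node : ∀ c ns d → 2 ≤ leaves (node c ns d)
  2≤leaves-node c ns d = ≤-trans (+-mono-≤ (1≤leaves c) (1≤leaves d)) (+-monoˡ-≤ (leaves d) (m≤m+n (leaves c) (leavesL ns)))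

  length≤leavesL : ∀ ms → length ms ≤ leavesL ms
  length≤leavesL [] = z≤n
  length≤leavesL (m ∷ ms) rewrite leaves≡suc-deg m = s≤s (≤-trans (length≤leavesL ms) (m≤n+m (leavesL ms) (deg m)))


module FiniteDimension where

  open import Data.Nat using (ℕ; zero; suc; _≤_; s≤s) renaming (_+_ to _+ℕ_)
  open import Data.Nat.Properties as NP using (≤-trans; m≤m+n; m≤n+m)
  open import Data.List using (List; []; _∷_; map; concatMap; length)
  open import Data.List.Relation.Unary.All using (All; []; _∷_)
  open import Data.List.Relation.Unary.Any using (here; there)
  open import Data.List.Membership.Propositional using (_∈_)
  open import Data.List.Membership.Propositional.Properties using (∈-++⁺ˡ; ∈-++⁺ʳ; ∈-map⁺)
  open import Data.Product using (_,_; ∃-syntax)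
  open import Relation.Binary.PropositionalEquality as P using (_≡_)
  open import Defs
  open TreeSize

  ∈-concatMap : ∀ {A B : Set} (f : A → List B) {x xs y} → x ∈ xs → y ∈ f x → y ∈ concatMap f xs
  ∈-concatMap f (here P.refl) hy = ∈-++⁺ˡ hy
  ∈-concatMap f {xs = z ∷ zs} (there hx) hy = ∈-++⁺ʳ (f z) (∈-concatMap f hx hy)

  listsUpTo : {A : Set} → ℕ → List A → List (List A)
  listsUpTo zero xs = [] ∷ []
  listsUpTo (suc k) xs = [] ∷ concatMap (λ x → map (x ∷_) (listsUpTo k xs)) xs

  listsUpTo-complete : ∀ {A : Set} {xs : List A} k l → length l ≤ k → All (_∈ xs) l → l ∈ listsUpTo k xs
  listsUpTo-complete zero [] _ _ = here P.refl
  listsUpTo-complete (suc k) [] _ _ = here P.refl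
  listsUpTo-complete {xs = xs} (suc k) (x ∷ l) (s≤s h) (px ∷ pl) =
    there (∈-concatMap (λ x → map (x ∷_) (listsUpTo k xs)) px (∈-map⁺ (x ∷_) (listsUpTo-complete k l h pl)))

  treesUpTo : ℕ → List Tree
  treesUpTo zero = leaf ∷ []
  treesUpTo (suc k) = leaf ∷ concatMap (λ a → concatMap (λ ms → map (node a ms) (treesUpTo k)) (listsUpTo k (treesUpTo k))) (treesUpTo k)

  All∈treesUpTo : ∀ k → (∀ t → leaves t ≤ suc k → t ∈ treesUpTo k) → ∀ ms → leavesL ms ≤ suc k → All (_∈ treesUpTo k) ms
  All∈treesUpTo k ih [] h = []
  All∈treesUpTo k ih (m ∷ ms) h = ih m (≤-trans (m≤m+n (leaves m) (leavesL ms)) h) ∷ All∈treesUpTo k ih ms (≤-trans (m≤n+m (leavesL ms) (leaves m)) h)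

  treesUpTo-complete : ∀ k t → leaves t ≤ suc k → t ∈ treesUpTo k
  treesUpTo-complete zero leaf h = here P.refl
  treesUpTo-complete (suc k) leaf h = here P.refl
  treesUpTo-complete zero (node a ms b) h rewrite leaves≡suc-deg a | leaves≡suc-deg b | NP.+-suc (deg a +ℕ leavesL ms) (deg b) with h
  ... | s≤s ()
  treesUpTo-complete (suc k) (node a ms b) h =
    there (∈-concatMap (λ a → concatMap (λ ms → map (node a ms) (treesUpTo k)) (listsUpTo k (treesUpTo k))) ha
      (∈-concatMap (λ ms → map (node a ms) (treesUpTo k)) hms (∈-map⁺ (node a ms) hb)))
    where
    X : ℕ
    X = (deg a +ℕ leavesL ms) +ℕ deg b
    hX : X ≤ k
    hX = NP.≤-pred (NP.≤-pred (P.subst (_≤ suc (suc k)) (P.trans (P.cong₂ (λ u v → (u +ℕ leavesL ms) +ℕ v) (leaves≡suc-deg a) (leaves≡suc-deg b)) (P.cong suc (NP.+-suc (deg a +ℕ leavesL ms) (deg b)))) h))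
    ha : a ∈ treesUpTo k
    ha = treesUpTo-complete k a (P.subst (_≤ suc k) (P.sym (leaves≡suc-deg a)) (s≤s (≤-trans (≤-trans (m≤m+n (deg a) (leavesL ms)) (m≤m+n _ (deg b))) hX)))
    hb : b ∈ treesUpTo k
    hb = treesUpTo-complete k b (P.subst (_≤ suc k) (P.sym (leaves≡suc-deg b)) (s≤s (≤-trans (m≤n+m (deg b) _) hX)))
    hL : leavesL ms ≤ k
    hL = ≤-trans (≤-trans (m≤n+m (leavesL ms) (deg a)) (m≤m+n _ (deg b))) hX
    hms : ms ∈ listsUpTo k (treesUpTo k)
    hms = listsUpTo-complete k ms (≤-trans (length≤leavesL ms) hL) (All∈treesUpTo k (treesUpTo-complete k) ms (≤-trans hL (NP.n≤1+n k)))

  treesOfDeg-finite : ∀ n → ∃[ L ] (∀ t → deg t ≡ n → t ∈ L)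
  treesOfDeg-finite n = treesUpTo n , λ t h → treesUpTo-complete n t (P.subst (_≤ suc n) (P.sym (P.trans (leaves≡suc-deg t) (P.cong suc h))) NP.≤-refl)


module FreeModule {c ℓ} (R : CommutativeRing c ℓ) where

  open import Data.Nat using (suc; _≤_; z≤n; s≤s)
  open import Data.Nat.Properties using (≤-trans; n≤1+n; ≤-refl)
  open import Data.List using (List; []; _∷_; _++_; length)
  open import Data.List.Properties using (++-assoc)
  open import Data.Bool using (Bool; true; false; if_then_else_)
  open import Data.Product using (_×_; _,_)
  open import Relation.Binary.PropositionalEquality as P using (_≡_)

  open CommutativeRing R renaming (Carrier to K)
  open import Algebra.Properties.Ring ring using (-1*x≈-x)

  -- Formal linear combinations over a basis A are lists of (coefficient, basis element), compared by
  -- their coefficient functions; as in coeff from Defs, coefficients are read off with a boolean test.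
  record BoolEq (A : Set) : Set where
    field
      eqb : A → A → Bool
      sound : ∀ {x y : A} → eqb x y ≡ true → x ≡ y
      reflb : ∀ x → eqb x x ≡ true
  open BoolEq {{...}} public

  module _ {A : Set} {{E : BoolEq A}} where
    eqb⇒≡ : ∀ (x y : A) → eqb x y ≡ true → x ≡ y
    eqb⇒≡ x y e = sound {x = x} {y = y} e

    eqb-sym : ∀ (x y : A) → eqb x y ≡ eqb y x
    eqb-sym x y with eqb x y in e1 | eqb y x in e2
    ... | true | true = P.refl
    ... | false | false = P.refl
    ... | true | false = lem (sound {x = x} {y = y} e1) e2 where
      lem : x ≡ y → eqb y x ≡ false → true ≡ false
      lem P.refl e = P.trans (P.sym (reflb x)) e
    ... | false | true = lem (sound {x = y} {y = x} e2) e1 where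
      lem : y ≡ x → eqb x y ≡ false → false ≡ true
      lem P.refl e = P.trans (P.sym e) (reflb x)

  Comb : Set → Set c
  Comb A = List (K × A)

  basis : {A : Set} → A → Comb A
  basis s = (1# , s) ∷ []

  smul : {A : Set} → K → Comb A → Comb A
  smul k [] = []
  smul k ((a , s) ∷ v) = (k * a , s) ∷ smul k v

  extend : {A C : Set} → (A → Comb C) → Comb A → Comb C
  extend f [] = []
  extend f ((a , s) ∷ v) = smul a (f s) ++ extend f v

  neg : {A : Set} → Comb A → Comb A
  neg = smul (- 1#)

  open import Relation.Binary.Reasoning.Setoid setoid
  open import Algebra.Properties.CommutativeSemigroup +-commutativeSemigroup using (interchange)

  smul-++ : {A : Set} → ∀ k (u v : Comb A) → smul k (u ++ v) ≡ smul k u ++ smul k v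
  smul-++ k [] v = P.refl
  smul-++ k (x ∷ u) v = P.cong (_ ∷_) (smul-++ k u v)

  module _ {A : Set} {{E : BoolEq A}} where
    coef : Comb A → A → K
    coef [] b = 0#
    coef ((a , s) ∷ v) b = if eqb s b then a + coef v b else coef v b

    infix 4 _≋_
    record _≋_ (u v : Comb A) : Set ℓ where
      constructor mk≋
      field at : ∀ b → coef u b ≈ coef v b
    open _≋_ public

    ≋-refl : ∀ {u} → u ≋ u
    ≋-refl = mk≋ λ b → refl
    ≋-sym : ∀ {u v} → u ≋ v → v ≋ u
    ≋-sym p = mk≋ λ b → sym (at p b)
    ≋-trans : ∀ {u v w} → u ≋ v → v ≋ w → u ≋ w
    ≋-trans p q = mk≋ λ b → trans (at p b) (at q b)
    ≡⇒≋ : ∀ {u v} → u ≡ v → u ≋ v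
    ≡⇒≋ P.refl = ≋-refl

    coef-++ : ∀ u v b → coef (u ++ v) b ≈ coef u b + coef v b
    coef-++ [] v b = sym (+-identityˡ _)
    coef-++ ((a , s) ∷ u) v b with eqb s b
    ... | true = trans (+-congˡ (coef-++ u v b)) (sym (+-assoc _ _ _))
    ... | false = coef-++ u v b

    coef-smul : ∀ k v b → coef (smul k v) b ≈ k * coef v b
    coef-smul k [] b = sym (zeroʳ k)
    coef-smul k ((a , s) ∷ v) b with eqb s b
    ... | true = trans (+-congˡ (coef-smul k v b)) (sym (distribˡ k a _))
    ... | false = coef-smul k v b

    coef-basis : ∀ a (s : A) → coef ((a , s) ∷ []) s ≈ a
    coef-basis a s rewrite reflb s = +-identityʳ a

    ++-cong : ∀ {u u' v v'} → u ≋ u' → v ≋ v' → u ++ v ≋ u' ++ v'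
    ++-cong {u} {u'} {v} {v'} p q = mk≋ λ b → trans (coef-++ u v b) (trans (+-cong (at p b) (at q b)) (sym (coef-++ u' v' b)))

    ++-comm : ∀ u v → u ++ v ≋ v ++ u
    ++-comm u v = mk≋ λ b → trans (coef-++ u v b) (trans (+-comm _ _) (sym (coef-++ v u b)))

    ++-assoc≋ : ∀ u v w → (u ++ v) ++ w ≋ u ++ (v ++ w)
    ++-assoc≋ u v w = ≡⇒≋ (++-assoc u v w)

    ++-identityʳ≋ : ∀ u → u ++ [] ≋ u
    ++-identityʳ≋ u = mk≋ λ b → trans (coef-++ u [] b) (+-identityʳ _)

    ++-interchange : ∀ a b c d → (a ++ b) ++ (c ++ d) ≋ (a ++ c) ++ (b ++ d)
    ++-interchange a b c d = mk≋ λ x → begin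
      coef ((a ++ b) ++ (c ++ d)) x ≈⟨ coef-++ (a ++ b) (c ++ d) x ⟩
      coef (a ++ b) x + coef (c ++ d) x ≈⟨ +-cong (coef-++ a b x) (coef-++ c d x) ⟩
      (coef a x + coef b x) + (coef c x + coef d x) ≈⟨ interchange _ _ _ _ ⟩
      (coef a x + coef c x) + (coef b x + coef d x) ≈⟨ sym (+-cong (coef-++ a c x) (coef-++ b d x)) ⟩
      coef (a ++ c) x + coef (b ++ d) x ≈⟨ sym (coef-++ (a ++ c) (b ++ d) x) ⟩
      coef ((a ++ c) ++ (b ++ d)) x ∎

    smul-cong : ∀ {k k' u u'} → k ≈ k' → u ≋ u' → smul k u ≋ smul k' u'
    smul-cong {k} {k'} {u} {u'} p q = mk≋ λ b → trans (coef-smul k u b) (trans (*-cong p (at q b)) (sym (coef-smul k' u' b)))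

    smul-smul : ∀ k k' u → smul k (smul k' u) ≋ smul (k * k') u
    smul-smul k k' u = mk≋ λ b → trans (coef-smul k (smul k' u) b) (trans (*-congˡ (coef-smul k' u b)) (trans (sym (*-assoc _ _ _)) (sym (coef-smul _ u b))))

    smul-1 : ∀ u → smul 1# u ≋ u
    smul-1 u = mk≋ λ b → trans (coef-smul 1# u b) (*-identityˡ _)

    smul-0 : ∀ u → smul 0# u ≋ []
    smul-0 u = mk≋ λ b → trans (coef-smul 0# u b) (zeroˡ _)

    smul-+ : ∀ k k' u → smul (k + k') u ≋ smul k u ++ smul k' u
    smul-+ k k' u = mk≋ λ b → trans (coef-smul _ u b) (trans (distribʳ _ k k') (sym (trans (coef-++ (smul k u) (smul k' u) b) (+-cong (coef-smul k u b) (coef-smul k' u b)))))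

    ++-neg : ∀ u → u ++ neg u ≋ []
    ++-neg u = mk≋ λ b → trans (coef-++ u (neg u) b) (trans (+-congˡ (trans (coef-smul _ u b) (-1*x≈-x _))) (-‿inverseʳ _))

  module _ {A C : Set} where
    extend-++ : ∀ (f : A → Comb C) u v → extend f (u ++ v) ≡ extend f u ++ extend f v
    extend-++ f [] v = P.refl
    extend-++ f ((a , s) ∷ u) v = P.trans (P.cong (smul a (f s) ++_) (extend-++ f u v)) (P.sym (++-assoc (smul a (f s)) _ _))

  module _ {A C : Set} {{EC : BoolEq C}} where
    extend-smul : ∀ (f : A → Comb C) k u → extend f (smul k u) ≋ smul k (extend f u)
    extend-smul f k [] = ≋-refl
    extend-smul f k ((a , s) ∷ u) = ≋-trans (++-cong (≋-sym (smul-smul k a (f s))) (extend-smul f k u))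
       (≡⇒≋ (P.sym (smul-++ k (smul a (f s)) (extend f u))))

    extend-cong-fun : ∀ {f g : A → Comb C} → (∀ s → f s ≋ g s) → ∀ u → extend f u ≋ extend g u
    extend-cong-fun p [] = ≋-refl
    extend-cong-fun p ((a , s) ∷ u) = ++-cong (smul-cong refl (p s)) (extend-cong-fun p u)

    extend-basis : ∀ (f : A → Comb C) s → extend f (basis s) ≋ f s
    extend-basis f s = ≋-trans (++-identityʳ≋ _) (smul-1 _)

    extend-fun-++ : ∀ (f g : A → Comb C) u → extend (λ s → f s ++ g s) u ≋ extend f u ++ extend g u
    extend-fun-++ f g [] = ≋-refl
    extend-fun-++ f g ((a , s) ∷ u) = ≋-trans (++-cong (≡⇒≋ (smul-++ a (f s) (g s))) (extend-fun-++ f g u))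
                                    (++-interchange (smul a (f s)) _ _ _)

    extend-zero : ∀ u → extend {A} {C} (λ _ → []) u ≋ []
    extend-zero [] = ≋-refl
    extend-zero ((a , s) ∷ u) = extend-zero u

    extend-fun-smul : ∀ (f : A → Comb C) k u → extend (λ s → smul k (f s)) u ≋ smul k (extend f u)
    extend-fun-smul f k [] = ≋-refl
    extend-fun-smul f k ((a , s) ∷ u) = ≋-trans (++-cong (≋-trans (smul-smul a k (f s)) (≋-trans (smul-cong (*-comm a k) ≋-refl) (≋-sym (smul-smul k a (f s))))) (extend-fun-smul f k u))
                                    (≡⇒≋ (P.sym (smul-++ k (smul a (f s)) (extend f u))))

  module _ {A : Set} {{EA : BoolEq A}} where
    extend-basis-id : ∀ u → extend {A} basis u ≋ u
    extend-basis-id [] = ≋-refl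
    extend-basis-id ((a , s) ∷ u) = mk≋ λ b → lem b where
      lem : ∀ b → coef (extend basis ((a , s) ∷ u)) b ≈ coef ((a , s) ∷ u) b
      lem b with eqb s b
      ... | true = +-cong (*-identityʳ a) (at (extend-basis-id u) b)
      ... | false = at (extend-basis-id u) b

  module _ {A C : Set} where
    extend-extend : ∀ (f : A → Comb C) {D : Set} {{ED : BoolEq D}} (g : C → Comb D) u → extend g (extend f u) ≋ extend (λ s → extend g (f s)) u
    extend-extend f g [] = ≋-refl
    extend-extend f g ((a , s) ∷ u) = ≋-trans (≡⇒≋ (extend-++ g (smul a (f s)) (extend f u))) (++-cong (extend-smul g a (f s)) (extend-extend f g u))

  module _ {A C : Set} {{EA : BoolEq A}} {{EC : BoolEq C}} where

    private
      select others : A → Comb A → Comb A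
      select s [] = []
      select s ((a , t) ∷ r) = if eqb s t then (a , t) ∷ select s r else select s r
      others s [] = []
      others s ((a , t) ∷ r) = if eqb s t then others s r else (a , t) ∷ others s r

      others-length : ∀ s r → length (others s r) ≤ length r
      others-length s [] = z≤n
      others-length s ((a , t) ∷ r) with eqb s t
      ... | true = ≤-trans (others-length s r) (n≤1+n _)
      ... | false = s≤s (others-length s r)

      extend-select : ∀ (f : A → Comb C) s r → extend f r ≋ extend f (select s r) ++ extend f (others s r)
      extend-select f s [] = ≋-refl
      extend-select f s ((a , t) ∷ r) with eqb s t
      ... | true = ≋-trans (++-cong ≋-refl (extend-select f s r)) (≡⇒≋ (P.sym (++-assoc (smul a (f t)) _ _)))
      ... | false = ≋-trans (++-cong ≋-refl (extend-select f s r))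
                    (≋-trans (≡⇒≋ (P.sym (++-assoc (smul a (f t)) (extend f (select s r)) (extend f (others s r)))))
                    (≋-trans (++-cong (++-comm (smul a (f t)) (extend f (select s r))) ≋-refl) (≡⇒≋ (++-assoc (extend f (select s r)) (smul a (f t)) (extend f (others s r))))))

      extend-select-coef : ∀ (f : A → Comb C) s r → extend f (select s r) ≋ smul (coef r s) (f s)
      extend-select-coef f s [] = ≋-sym (smul-0 (f s))
      extend-select-coef f s ((a , t) ∷ r) with eqb s t in e
      ... | true with eqb⇒≡ s t e
      ... | P.refl rewrite reflb s = ≋-trans (++-cong ≋-refl (extend-select-coef f s r)) (≋-sym (smul-+ a (coef r s) (f s)))
      extend-select-coef f s ((a , t) ∷ r) | false rewrite eqb-sym t s | e = extend-select-coef f s r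

      coef-others : ∀ s r b → eqb s b ≡ false → coef (others s r) b ≈ coef r b
      coef-others s [] b _ = refl
      coef-others s ((a , t) ∷ r) b h with eqb s t in e
      ... | true with eqb⇒≡ s t e
      ... | P.refl rewrite h = coef-others s r b h
      coef-others s ((a , t) ∷ r) b h | false with eqb t b
      ... | true = +-congˡ (coef-others s r b h)
      ... | false = coef-others s r b h

      coef-others-self : ∀ s r → coef (others s r) s ≈ 0#
      coef-others-self s [] = refl
      coef-others-self s ((a , t) ∷ r) with eqb s t in e
      ... | true = coef-others-self s r
      ... | false rewrite eqb-sym t s | e = coef-others-self s r

      -- Equal coefficients do not make lists equal, so this is the real content of extend-cong: the entries
      -- at the head basis element are collected (their coefficients sum to 0) and the rest is shorter.
      extend-null : ∀ (f : A → Comb C) n u → length u ≤ n → u ≋ [] → extend f u ≋ []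
      extend-null f n [] _ _ = ≋-refl
      extend-null f (suc n) ((a , s) ∷ r) (s≤s h) z =
        ≋-trans (++-cong ≋-refl (extend-select f s r))
        (≋-trans (≡⇒≋ (P.sym (++-assoc (smul a (f s)) _ _)))
        (≋-trans (++-cong (≋-trans (++-cong ≋-refl (extend-select-coef f s r)) (≋-sym (smul-+ a (coef r s) (f s)))) IH)
        (≋-trans (++-identityʳ≋ _) (≋-trans (smul-cong z0 ≋-refl) (smul-0 (f s))))))
        where
        z0 : a + coef r s ≈ 0#
        z0 = P.subst (λ x → (if x then a + coef r s else coef r s) ≈ 0#) (reflb s) (at z s)
        othz : others s r ≋ []
        othz = mk≋ λ b → lem b where
          lem : ∀ b → coef (others s r) b ≈ 0#
          lem b with eqb s b in e
          ... | true with eqb⇒≡ s b e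
          ... | P.refl = coef-others-self s r
          lem b | false = trans (coef-others s r b e) (P.subst (λ x → (if x then a + coef r b else coef r b) ≈ 0#) e (at z b))
        IH : extend f (others s r) ≋ []
        IH = extend-null f n (others s r) (≤-trans (others-length s r) h) othz

    extend-cong : ∀ (f : A → Comb C) {u v} → u ≋ v → extend f u ≋ extend f v
    extend-cong f {u} {v} p =
      ≋-trans (≋-sym (++-identityʳ≋ (extend f u)))
      (≋-trans (++-cong ≋-refl (≋-sym (≋-trans (++-comm (neg (extend f v)) (extend f v)) (++-neg (extend f v)))))
      (≋-trans (≡⇒≋ (P.sym (++-assoc (extend f u) (neg (extend f v)) (extend f v))))
      (≋-trans (++-cong (≋-trans (++-cong ≋-refl (≋-sym (extend-smul f (- 1#) v))) (≋-trans (≡⇒≋ (P.sym (extend-++ f u (neg v)))) (extend-null f _ (u ++ neg v) ≤-refl d0))) ≋-refl)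
      ≋-refl)))
      where
      d0 : u ++ neg v ≋ []
      d0 = ≋-trans (++-cong p ≋-refl) (++-neg v)

  fmap : {A C : Set} → (A → C) → Comb A → Comb C
  fmap h = extend (λ u → basis (h u))

  fmap-extend : ∀ {A B C : Set} {{_ : BoolEq C}} (h : B → C) (F : A → Comb B) a → fmap h (extend F a) ≋ extend (λ x → fmap h (F x)) a
  fmap-extend h F a = extend-extend F (λ u → basis (h u)) a

  module _ {A : Set} {{EA : BoolEq A}} where
    ∷-cong : ∀ {x y} (s : A) {u v} → x ≈ y → u ≋ v → (x , s) ∷ u ≋ (y , s) ∷ v
    ∷-cong {x} {y} s {u} {v} p q = mk≋ λ b → lem b where
      lem : ∀ b → coef ((x , s) ∷ u) b ≈ coef ((y , s) ∷ v) b
      lem b with eqb s b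
      ... | true = +-cong p (at q b)
      ... | false = at q b

  module _ {A C D : Set} {{ED : BoolEq D}} where
    extend-fmap : ∀ (g : C → Comb D) (h : A → C) v → extend g (fmap h v) ≋ extend (λ u → g (h u)) v
    extend-fmap g h v = ≋-trans (extend-extend (λ u → basis (h u)) g v) (extend-cong-fun (λ s → extend-basis g (h s)) v)
    fmap-fmap : ∀ (g : C → D) (h : A → C) v → fmap g (fmap h v) ≋ fmap (λ u → g (h u)) v
    fmap-fmap g h v = extend-fmap (λ u → basis (g u)) h v
    fubini : ∀ (g : A → C → Comb D) u v → extend (λ s → extend (g s) v) u ≋ extend (λ t → extend (λ s → g s t) u) v
    fubini g [] v = ≋-sym (extend-zero v)
    fubini g ((a , s) ∷ u) v = ≋-trans (++-cong (≋-sym (extend-fun-smul (g s) a v)) (fubini g u v))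
                                (≋-sym (extend-fun-++ (λ t → smul a (g s t)) (λ t → extend (λ s₁ → g s₁ t) u) v))

  module _ {A C : Set} {{EA : BoolEq A}} {{EC : BoolEq C}} where
    extend-cong₂ : ∀ {f g : A → Comb C} {u v} → (∀ s → f s ≋ g s) → u ≋ v → extend f u ≋ extend g v
    extend-cong₂ {f} {g} {u} {v} p q = ≋-trans (extend-cong-fun p u) (extend-cong g q)
    fmap-cong : ∀ (h : A → C) {u v} → u ≋ v → fmap h u ≋ fmap h v
    fmap-cong h = extend-cong (λ u → basis (h u))

  fmap-ext : ∀ {A C : Set} {{_ : BoolEq C}} {h h' : A → C} → (∀ u → h u ≡ h' u) → ∀ v → fmap h v ≋ fmap h' v
  fmap-ext e v = extend-cong-fun (λ u → ≡⇒≋ (P.cong basis (e u))) v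

  open import Algebra.Bundles using (CommutativeMonoid)
  module _ {A : Set} {{EA : BoolEq A}} where
    combMonoid : CommutativeMonoid c ℓ
    combMonoid = record
      { Carrier = Comb A ; _≈_ = _≋_ ; _∙_ = _++_ ; ε = []
      ; isCommutativeMonoid = record
        { isMonoid = record
          { isSemigroup = record
            { isMagma = record { isEquivalence = record { refl = ≋-refl ; sym = ≋-sym ; trans = ≋-trans } ; ∙-cong = ++-cong }
            ; assoc = ++-assoc≋ }
          ; identity = (λ u → ≋-refl) , ++-identityʳ≋ }
        ; comm = ++-comm } }


module TreeBasis {c ℓ} (R : CommutativeRing c ℓ) where

  open import Data.List using (List; []; _∷_)
  open import Data.Bool using (true; if_then_else_; _∧_)
  open import Data.Product using (_×_; _,_; proj₁; proj₂)
  open import Relation.Binary.PropositionalEquality as P using (_≡_)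
  open import Defs
  open FreeModule R public
  open CommutativeRing R
  open TD R

  ∧-trueˡ : ∀ {a b} → (a ∧ b) ≡ true → a ≡ true
  ∧-trueˡ {true} _ = P.refl
  ∧-trueʳ : ∀ {a b} → (a ∧ b) ≡ true → b ≡ true
  ∧-trueʳ {true} e = e

  eqT-sound : ∀ {s t} → eqT s t ≡ true → s ≡ t
  eqL-sound : ∀ {s t} → eqL s t ≡ true → s ≡ t
  eqT-sound {leaf} {leaf} e = P.refl
  eqT-sound {node a ms b} {node c ns d} e =
    P.cong₂ (λ x y → node x (proj₁ y) (proj₂ y)) (eqT-sound (∧-trueˡ e))
      (P.cong₂ _,_ (eqL-sound (∧-trueˡ (∧-trueʳ {eqT a c} e))) (eqT-sound (∧-trueʳ {eqL ms ns} (∧-trueʳ {eqT a c} e))))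
  eqL-sound {[]} {[]} e = P.refl
  eqL-sound {s ∷ ss} {t ∷ ts} e = P.cong₂ _∷_ (eqT-sound (∧-trueˡ e)) (eqL-sound (∧-trueʳ {eqT s t} e))

  eqT-refl : ∀ t → eqT t t ≡ true
  eqL-refl : ∀ t → eqL t t ≡ true
  eqT-refl leaf = P.refl
  eqT-refl (node a ms b) rewrite eqT-refl a | eqL-refl ms | eqT-refl b = P.refl
  eqL-refl [] = P.refl
  eqL-refl (t ∷ ts) rewrite eqT-refl t | eqL-refl ts = P.refl

  instance
    eqbTree : BoolEq Tree
    eqbTree = record { eqb = eqT ; sound = eqT-sound ; reflb = eqT-refl }
    eqbTrees : BoolEq (List Tree)
    eqbTrees = record { eqb = eqL ; sound = eqL-sound ; reflb = eqL-refl }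
    eqbPair : {A B : Set} {{_ : BoolEq A}} {{_ : BoolEq B}} → BoolEq (A × B)
    eqbPair = record { eqb = λ p q → eqb (proj₁ p) (proj₁ q) ∧ eqb (proj₂ p) (proj₂ q)
                    ; sound = λ {p} {q} e → P.cong₂ _,_ (sound (∧-trueˡ e)) (sound (∧-trueʳ {eqb (proj₁ p) (proj₁ q)} e))
                    ; reflb = λ p → P.cong₂ _∧_ (reflb (proj₁ p)) (reflb (proj₂ p)) }

  coeff≡coef : ∀ v t → coeff v t ≡ coef v t
  coeff≡coef [] t = P.refl
  coeff≡coef ((a , s) ∷ v) t = P.cong (λ r → if eqT s t then a + r else r) (coeff≡coef v t)

  coeff2≡coef : ∀ v t u → coeff2 v t u ≡ coef v (t , u)
  coeff2≡coef [] t u = P.refl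
  coeff2≡coef ((a , s , s') ∷ v) t u = P.cong (λ r → if eqT s t ∧ eqT s' u then a + r else r) (coeff2≡coef v t u)

  coeff3≡coef : ∀ v t u w → coeff3 v t u w ≡ coef v (t , u , w)
  coeff3≡coef [] t u w = P.refl
  coeff3≡coef ((a , s , s' , s'') ∷ v) t u w = P.cong (λ r → if eqT s t ∧ eqT s' u ∧ eqT s'' w then a + r else r) (coeff3≡coef v t u w)

  ≋⇒≈V : ∀ {x y} → x ≋ y → x ≈V y
  ≋⇒≈V {x} {y} p t = P.subst₂ _≈_ (P.sym (coeff≡coef x t)) (P.sym (coeff≡coef y t)) (at p t)
  ≈2⇒≋ : ∀ {x y} → x ≈2 y → x ≋ y
  ≈2⇒≋ {x} {y} p = mk≋ λ { (t , u) → P.subst₂ _≈_ (coeff2≡coef x t u) (coeff2≡coef y t u) (p t u) }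
  ≋⇒≈2 : ∀ {x y} → x ≋ y → x ≈2 y
  ≋⇒≈2 {x} {y} p t u = P.subst₂ _≈_ (P.sym (coeff2≡coef x t u)) (P.sym (coeff2≡coef y t u)) (at p (t , u))
  ≋⇒≈3 : ∀ {x y} → x ≋ y → x ≈3 y
  ≋⇒≈3 {x} {y} p t u w = P.subst₂ _≈_ (P.sym (coeff3≡coef x t u w)) (P.sym (coeff3≡coef y t u w)) (at p (t , u , w))


module TreeProducts {c ℓ} (R : CommutativeRing c ℓ) where

  open import Data.List using (List; []; _∷_; _++_; map; concatMap)
  open import Data.Product using (_×_; _,_; proj₁; proj₂)
  open import Relation.Binary.PropositionalEquality as P using (_≡_)
  open import Defs
  open TreeBasis R public
  open CommutativeRing R renaming (Carrier to K)
  open TD R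

  module _ {A C : Set} {{EC : BoolEq C}} where
    concatMap≋extend : ∀ (g : K × A → Comb C) (G : A → Comb C) → (∀ b t → g (b , t) ≋ smul b (G t)) → ∀ cs → concatMap g cs ≋ extend G cs
    concatMap≋extend g G p [] = ≋-refl
    concatMap≋extend g G p ((b , t) ∷ cs) = ++-cong (p b t) (concatMap≋extend g G p cs)

    map≋smul-fmap : ∀ (f : K × A → K × C) (k : K) (h : A → C) → (∀ d t → proj₂ (f (d , t)) ≡ h t) → (∀ d t → proj₁ (f (d , t)) ≈ k * d) → ∀ v → map f v ≋ smul k (fmap h v)
    map≋smul-fmap f k h e2 e1 [] = ≋-refl
    map≋smul-fmap f k h e2 e1 ((d , t) ∷ v) =
      ≋-trans (≡⇒≋ (P.cong (λ z → (proj₁ (f (d , t)) , z) ∷ map f v) (e2 d t)))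
              (∷-cong (h t) (trans (e1 d t) (*-congˡ (sym (*-identityʳ d)))) (map≋smul-fmap f k h e2 e1 v))

  scale≡smul : ∀ {A : Set} k (v : List (K × A)) → map (λ { (a , t) → (k * a , t) }) v ≡ smul k v
  scale≡smul k [] = P.refl
  scale≡smul k ((a , t) ∷ v) = P.cong (_ ∷_) (scale≡smul k v)

  lin≡extend : ∀ f v → lin f v ≡ extend f v
  lin≡extend f [] = P.refl
  lin≡extend f ((a , t) ∷ v) = P.cong₂ _++_ (scale≡smul a (f t)) (lin≡extend f v)

  lin2≡extend : ∀ f v → lin2 f v ≡ extend f v
  lin2≡extend f [] = P.refl
  lin2≡extend f ((a , t) ∷ v) = P.cong₂ _++_ (scale≡smul a (f t)) (lin2≡extend f v)

  choices-∷ : ∀ v vs → choices (v ∷ vs) ≋ extend (λ t → fmap (t ∷_) (choices vs)) v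
  choices-∷ v vs = concatMap≋extend _ _ (λ a t → map≋smul-fmap _ a (t ∷_) (λ d ts → P.refl) (λ d ts → refl) (choices vs)) v

  graft≋extend : ∀ v₀ vs vₖ → graft v₀ vs vₖ ≋ extend (λ t₀ → extend (λ ts → fmap (node t₀ ts) vₖ) (choices vs)) v₀
  graft≋extend v₀ vs vₖ = concatMap≋extend _ _ (λ a t₀ →
     ≋-trans (concatMap≋extend _ (λ ts → smul a (fmap (node t₀ ts) vₖ))
               (λ b ts → ≋-trans (map≋smul-fmap _ (a * b) (node t₀ ts) (λ d tk → P.refl) (λ d tk → refl) vₖ)
                         (≋-trans (smul-cong (*-comm a b) ≋-refl) (≋-sym (smul-smul b a _))))
               (choices vs))
     (extend-fun-smul (λ ts → fmap (node t₀ ts) vₖ) a (choices vs))) v₀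

  open import Data.List.Properties using (++-identityʳ)

  choices-basis-++ : ∀ ms rest → choices (map basis ms ++ rest) ≋ fmap (ms ++_) (choices rest)
  choices-basis-++ [] rest = ≋-sym (extend-basis-id (choices rest))
  choices-basis-++ (m ∷ ms) rest =
    ≋-trans (choices-∷ (basis m) (map basis ms ++ rest))
    (≋-trans (extend-basis (λ t → fmap (t ∷_) (choices (map basis ms ++ rest))) m)
    (≋-trans (fmap-cong (m ∷_) (choices-basis-++ ms rest)) (fmap-fmap (m ∷_) (ms ++_) (choices rest))))

  choices-basis : ∀ ms → choices (map basis ms) ≋ basis ms
  choices-basis ms = ≋-trans (≡⇒≋ (P.cong choices (P.sym (++-identityʳ (map basis ms)))))
    (≋-trans (choices-basis-++ ms []) (≋-trans (extend-basis (λ u → basis (ms ++ u)) []) (≡⇒≋ (P.cong basis (++-identityʳ ms)))))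

  graft-basis-middle : ∀ v₀ ms vₖ → graft v₀ (map basis ms) vₖ ≋ extend (λ t₀ → fmap (node t₀ ms) vₖ) v₀
  graft-basis-middle v₀ ms vₖ = ≋-trans (graft≋extend v₀ (map basis ms) vₖ)
    (extend-cong-fun (λ t₀ → ≋-trans (extend-cong (λ ts → fmap (node t₀ ts) vₖ) (choices-basis ms)) (extend-basis (λ ts → fmap (node t₀ ts) vₖ) ms)) v₀)

  withFirst : List Tree → Tree → Tree → Tree
  withFirst ns d u = node u ns d
  withMiddle : Tree → List Tree → List Tree → Tree → Tree → Tree
  withMiddle a ms ns d u = node a (ms ++ u ∷ ns) d

  prec-node : ∀ a ms b c ns d → prec (node a ms b) (node c ns d) ≋ fmap (node a ms) (star b (node c ns d))
  prec-node a ms b c ns d = ≋-trans (graft-basis-middle (basis a) ms _) (extend-basis (λ t₀ → fmap (node t₀ ms) (star b (node c ns d))) a)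

  succ-node : ∀ a ms b c ns d → succ (node a ms b) (node c ns d) ≋ fmap (withFirst ns d) (star (node a ms b) c)
  succ-node a ms b c ns d = ≋-trans (graft-basis-middle (star (node a ms b) c) ns (basis d)) (extend-cong-fun (λ t₀ → extend-basis (λ u → basis (node t₀ ns u)) d) (star (node a ms b) c))

  dot-node : ∀ a ms b c ns d → dot (node a ms b) (node c ns d) ≋ fmap (withMiddle a ms ns d) (star b c)
  dot-node a ms b c ns d =
    ≋-trans (graft≋extend (basis a) (map basis ms ++ (star b c ∷ map basis ns)) (basis d))
    (≋-trans (extend-basis (λ t₀ → extend (λ ts → fmap (node t₀ ts) (basis d)) (choices (map basis ms ++ (star b c ∷ map basis ns)))) a)
    (≋-trans (extend-cong (λ ts → fmap (node a ts) (basis d)) ch)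
    (≋-trans (extend-fmap (λ ts → fmap (node a ts) (basis d)) (λ t → ms ++ t ∷ ns) (star b c))
    (extend-cong-fun (λ t → extend-basis (λ u → basis (node a (ms ++ t ∷ ns) u)) d) (star b c)))))
    where
    ch : choices (map basis ms ++ (star b c ∷ map basis ns)) ≋ fmap (λ t → ms ++ t ∷ ns) (star b c)
    ch = ≋-trans (choices-basis-++ ms (star b c ∷ map basis ns))
         (≋-trans (fmap-cong (ms ++_) (≋-trans (choices-∷ (star b c) (map basis ns))
                     (extend-cong-fun (λ t → ≋-trans (fmap-cong (t ∷_) (choices-basis ns)) (extend-basis (λ u → basis (t ∷ u)) ns)) (star b c))))
         (fmap-fmap (ms ++_) (λ t → t ∷ ns) (star b c)))

  bilin≋extend : ∀ (f : Tree → Tree → V) x y → bilin f x y ≋ extend (λ s → extend (f s) y) x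
  bilin≋extend f x y = concatMap≋extend _ _ (λ a s → ≋-trans (concatMap≋extend _ (λ t → smul a (f s t))
       (λ b t → ≋-trans (≡⇒≋ (scale≡smul (a * b) (f s t))) (≋-trans (smul-cong (*-comm a b) ≋-refl) (≋-sym (smul-smul b a (f s t))))) y)
       (extend-fun-smul (f s) a y)) x

  starC : V → V → V
  starC x y = extend (λ s → extend (star s) y) x

  starV≋starC : ∀ x y → starV x y ≋ starC x y
  starV≋starC = bilin≋extend star

  star-leafʳ : ∀ x → star x leaf ≋ basis x
  star-leafʳ leaf = ≋-refl
  star-leafʳ (node a ms b) = ≋-refl


module StarAssociativity {c ℓ} (R : CommutativeRing c ℓ) where

  open import Data.List using (List; _∷_; _++_)
  open import Data.List.Properties using (++-assoc)
  open import Relation.Binary.PropositionalEquality as P using (_≡_)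
  open import Defs
  open TreeProducts R public
  open TD R
  import Algebra.Solver.CommutativeMonoid as CMS
  module VS = CMS (combMonoid {Tree})

  extend-fun-++₃ : ∀ {A : Set} (f g h : A → Comb Tree) u → extend (λ s → f s ++ g s ++ h s) u ≋ extend f u ++ extend g u ++ extend h u
  extend-fun-++₃ f g h u = ≋-trans (extend-fun-++ f (λ s → g s ++ h s) u) (++-cong ≋-refl (extend-fun-++ g h u))

  extend-++₃ : ∀ {A : Set} (f : A → Comb Tree) a b d → extend f (a ++ b ++ d) ≡ extend f a ++ extend f b ++ extend f d
  extend-++₃ f a b d = P.trans (extend-++ f a (b ++ d)) (P.cong (extend f a ++_) (extend-++ f b d))

  star-node-node : ∀ a ms b c ns d → star (node a ms b) (node c ns d) ≋
     fmap (node a ms) (star b (node c ns d)) ++ fmap (withMiddle a ms ns d) (star b c) ++ fmap (withFirst ns d) (star (node a ms b) c)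
  star-node-node a ms b c ns d = ++-cong (prec-node a ms b c ns d) (++-cong (dot-node a ms b c ns d) (succ-node a ms b c ns d))

  assoc-rearrangement : ∀ (r1 r2 r3 r4 r5 r6 r7 r8 l3 l6 l9 : Comb Tree) →
    ((r1 ++ r4 ++ r7) ++ r8 ++ l3) ++ (r2 ++ r5 ++ l6) ++ (r3 ++ r6 ++ l9) ≋
    (r1 ++ r2 ++ r3) ++ (r4 ++ r5 ++ r6) ++ (r7 ++ r8 ++ (l3 ++ l6 ++ l9))
  assoc-rearrangement = VS.solve 11 (λ r1 r2 r3 r4 r5 r6 r7 r8 l3 l6 l9 →
    ((r1 ⊕ r4 ⊕ r7) ⊕ r8 ⊕ l3) ⊕ (r2 ⊕ r5 ⊕ l6) ⊕ (r3 ⊕ r6 ⊕ l9) ⊜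
    (r1 ⊕ r2 ⊕ r3) ⊕ (r4 ⊕ r5 ⊕ r6) ⊕ (r7 ⊕ r8 ⊕ (l3 ⊕ l6 ⊕ l9))) ≋-refl
    where open VS using (_⊕_; _⊜_)

  -- Expanding both sides twice with star-node-node gives nine terms Lᵢ and Rᵢ on each side.  The terms
  -- in which the product stays inside one child match by the inductive hypotheses (E1–E3); the others
  -- graft two independent products into different children and match by fubini (E4–E7).
  module StarAssocNodes (x0 : Tree) (xs : List Tree) (xk y0 : Tree) (ys : List Tree) (yk z0 : Tree) (zs : List Tree) (zk : Tree)
    (ih1 : extend (λ v → star v (node z0 zs zk)) (star xk (node y0 ys yk)) ≋ extend (star xk) (star (node y0 ys yk) (node z0 zs zk)))
    (ih2 : extend (λ v → star v z0) (star xk (node y0 ys yk)) ≋ extend (star xk) (star (node y0 ys yk) z0))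
    (ih3 : extend (λ v → star v z0) (star (node x0 xs xk) (node y0 ys yk)) ≋ extend (star (node x0 xs xk)) (star (node y0 ys yk) z0))
    where
    Xt Yt Zt : Tree
    Xt = node x0 xs xk
    Yt = node y0 ys yk
    Zt = node z0 zs zk
    sZ : Tree → Comb Tree
    sZ v = star v Zt
    P1 P2 P3 Q1 Q2 Q3 : Comb Tree
    P1 = fmap (node x0 xs) (star xk Yt)
    P2 = fmap (withMiddle x0 xs ys yk) (star xk y0)
    P3 = fmap (withFirst ys yk) (star Xt y0)
    Q1 = fmap (node y0 ys) (star yk Zt)
    Q2 = fmap (withMiddle y0 ys zs zk) (star yk z0)
    Q3 = fmap (withFirst zs zk) (star Yt z0)
    L1 L2 L3 L4 L5 L6 L7 L8 L9 R1 R2 R3 R4 R5 R6 R7 R8 R9 : Comb Tree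
    L1 = extend (λ w → fmap (node x0 xs) (star w Zt)) (star xk Yt)
    L2 = extend (λ w → fmap (withMiddle x0 xs zs zk) (star w z0)) (star xk Yt)
    L3 = extend (λ w → fmap (withFirst zs zk) (star (node x0 xs w) z0)) (star xk Yt)
    L4 = extend (λ w → fmap (node x0 (xs ++ w ∷ ys)) (star yk Zt)) (star xk y0)
    L5 = extend (λ w → fmap (withMiddle x0 (xs ++ w ∷ ys) zs zk) (star yk z0)) (star xk y0)
    L6 = extend (λ w → fmap (withFirst zs zk) (star (withMiddle x0 xs ys yk w) z0)) (star xk y0)
    L7 = extend (λ w → fmap (node w ys) (star yk Zt)) (star Xt y0)
    L8 = extend (λ w → fmap (withMiddle w ys zs zk) (star yk z0)) (star Xt y0)
    L9 = extend (λ w → fmap (withFirst zs zk) (star (withFirst ys yk w) z0)) (star Xt y0)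
    R1 = extend (λ w → fmap (node x0 xs) (star xk (node y0 ys w))) (star yk Zt)
    R2 = extend (λ w → fmap (withMiddle x0 xs ys w) (star xk y0)) (star yk Zt)
    R3 = extend (λ w → fmap (withFirst ys w) (star Xt y0)) (star yk Zt)
    R4 = extend (λ w → fmap (node x0 xs) (star xk (withMiddle y0 ys zs zk w))) (star yk z0)
    R5 = extend (λ w → fmap (withMiddle x0 xs (ys ++ w ∷ zs) zk) (star xk y0)) (star yk z0)
    R6 = extend (λ w → fmap (withFirst (ys ++ w ∷ zs) zk) (star Xt y0)) (star yk z0)
    R7 = extend (λ w → fmap (node x0 xs) (star xk (withFirst zs zk w))) (star Yt z0)
    R8 = extend (λ w → fmap (withMiddle x0 xs zs zk) (star xk w)) (star Yt z0)
    R9 = extend (λ w → fmap (withFirst zs zk) (star Xt w)) (star Yt z0)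

    hL : extend sZ (star Xt Yt) ≋ (L1 ++ L2 ++ L3) ++ (L4 ++ L5 ++ L6) ++ (L7 ++ L8 ++ L9)
    hL = ≋-trans (extend-cong sZ (star-node-node x0 xs xk y0 ys yk)) (≋-trans (≡⇒≋ (extend-++₃ sZ P1 P2 P3))
         (++-cong (≋-trans (extend-fmap sZ (node x0 xs) (star xk Yt)) (≋-trans (extend-cong-fun (λ w → star-node-node x0 xs w z0 zs zk) (star xk Yt)) (extend-fun-++₃ _ _ _ (star xk Yt))))
         (++-cong (≋-trans (extend-fmap sZ (withMiddle x0 xs ys yk) (star xk y0)) (≋-trans (extend-cong-fun (λ w → star-node-node x0 (xs ++ w ∷ ys) yk z0 zs zk) (star xk y0)) (extend-fun-++₃ _ _ _ (star xk y0))))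
                  (≋-trans (extend-fmap sZ (withFirst ys yk) (star Xt y0)) (≋-trans (extend-cong-fun (λ w → star-node-node w ys yk z0 zs zk) (star Xt y0)) (extend-fun-++₃ _ _ _ (star Xt y0)))))))

    hR : extend (star Xt) (star Yt Zt) ≋ (R1 ++ R2 ++ R3) ++ (R4 ++ R5 ++ R6) ++ (R7 ++ R8 ++ R9)
    hR = ≋-trans (extend-cong (star Xt) (star-node-node y0 ys yk z0 zs zk)) (≋-trans (≡⇒≋ (extend-++₃ (star Xt) Q1 Q2 Q3))
         (++-cong (≋-trans (extend-fmap (star Xt) (node y0 ys) (star yk Zt)) (≋-trans (extend-cong-fun (λ w → star-node-node x0 xs xk y0 ys w) (star yk Zt)) (extend-fun-++₃ _ _ _ (star yk Zt))))
         (++-cong (≋-trans (extend-fmap (star Xt) (withMiddle y0 ys zs zk) (star yk z0)) (≋-trans (extend-cong-fun (λ w → star-node-node x0 xs xk y0 (ys ++ w ∷ zs) zk) (star yk z0)) (extend-fun-++₃ _ _ _ (star yk z0))))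
                  (≋-trans (extend-fmap (star Xt) (withFirst zs zk) (star Yt z0)) (≋-trans (extend-cong-fun (λ w → star-node-node x0 xs xk w zs zk) (star Yt z0)) (extend-fun-++₃ _ _ _ (star Yt z0)))))))

    h : Tree → Tree
    h = node x0 xs
    piece : ∀ (g : Tree → Tree) v → fmap h (extend (star xk) (fmap g v)) ≋ extend (λ w → fmap h (star xk (g w))) v
    piece g v = ≋-trans (fmap-cong h (extend-fmap (star xk) g v)) (fmap-extend h (λ w → star xk (g w)) v)

    E1 : L1 ≋ R1 ++ R4 ++ R7
    E1 = ≋-trans (≋-sym (fmap-extend h sZ (star xk Yt)))
         (≋-trans (fmap-cong h ih1)
         (≋-trans (fmap-cong h (extend-cong (star xk) (star-node-node y0 ys yk z0 zs zk)))
         (≋-trans (fmap-cong h (≡⇒≋ (extend-++₃ (star xk) Q1 Q2 Q3)))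
         (≋-trans (≡⇒≋ (extend-++₃ (λ u → basis (h u)) (extend (star xk) Q1) (extend (star xk) Q2) (extend (star xk) Q3)))
         (++-cong (piece (node y0 ys) (star yk Zt)) (++-cong (piece (withMiddle y0 ys zs zk) (star yk z0)) (piece (withFirst zs zk) (star Yt z0))))))))

    E2 : L2 ≋ R8
    E2 = ≋-trans (≋-sym (fmap-extend (withMiddle x0 xs zs zk) (λ v → star v z0) (star xk Yt)))
         (≋-trans (fmap-cong (withMiddle x0 xs zs zk) ih2) (fmap-extend (withMiddle x0 xs zs zk) (star xk) (star Yt z0)))

    F : Tree → Comb Tree
    F v = fmap (withFirst zs zk) (star v z0)
    E3 : L3 ++ L6 ++ L9 ≋ R9
    E3 = ≋-trans (++-cong (≋-sym (extend-fmap F (node x0 xs) (star xk Yt))) (++-cong (≋-sym (extend-fmap F (withMiddle x0 xs ys yk) (star xk y0))) (≋-sym (extend-fmap F (withFirst ys yk) (star Xt y0)))))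
         (≋-trans (≡⇒≋ (P.sym (extend-++₃ F P1 P2 P3)))
         (≋-trans (extend-cong F (≋-sym (star-node-node x0 xs xk y0 ys yk)))
         (≋-trans (≋-sym (fmap-extend (withFirst zs zk) (λ v → star v z0) (star Xt Yt)))
         (≋-trans (fmap-cong (withFirst zs zk) ih3) (fmap-extend (withFirst zs zk) (star Xt) (star Yt z0))))))

    E4 : L4 ≋ R2
    E4 = fubini (λ w v → basis (node x0 (xs ++ w ∷ ys) v)) (star xk y0) (star yk Zt)
    E5 : L5 ≋ R5
    E5 = ≋-trans (fubini (λ w v → basis (node x0 ((xs ++ w ∷ ys) ++ v ∷ zs) zk)) (star xk y0) (star yk z0))
         (extend-cong-fun (λ v → extend-cong-fun (λ w → ≡⇒≋ (P.cong (λ l → basis (node x0 l zk)) (++-assoc xs (w ∷ ys) (v ∷ zs)))) (star xk y0)) (star yk z0))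
    E6 : L7 ≋ R3
    E6 = fubini (λ w v → basis (node w ys v)) (star Xt y0) (star yk Zt)
    E7 : L8 ≋ R6
    E7 = fubini (λ w v → basis (node w (ys ++ v ∷ zs) zk)) (star Xt y0) (star yk z0)

    regroup : (L1 ++ L2 ++ L3) ++ (L4 ++ L5 ++ L6) ++ (L7 ++ L8 ++ L9) ≋ (R1 ++ R2 ++ R3) ++ (R4 ++ R5 ++ R6) ++ (R7 ++ R8 ++ R9)
    regroup = ≋-trans (++-cong (++-cong E1 (++-cong E2 (≋-refl {u = L3}))) (++-cong (++-cong E4 (++-cong E5 (≋-refl {u = L6}))) (++-cong E6 (++-cong E7 (≋-refl {u = L9})))))
           (≋-trans (assoc-rearrangement R1 R2 R3 R4 R5 R6 R7 R8 L3 L6 L9)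
           (++-cong (≋-refl {u = R1 ++ R2 ++ R3}) (++-cong (≋-refl {u = R4 ++ R5 ++ R6}) (++-cong (≋-refl {u = R7}) (++-cong (≋-refl {u = R8}) E3)))))

    star-assoc-nodes : extend (λ v → star v Zt) (star Xt Yt) ≋ extend (star Xt) (star Yt Zt)
    star-assoc-nodes = ≋-trans hL (≋-trans regroup (≋-sym hR))

  star-assoc : ∀ s t u → extend (λ v → star v u) (star s t) ≋ extend (star s) (star t u)
  star-assoc leaf t u = ≋-trans (extend-basis (λ v → star v u) t) (≋-sym (extend-basis-id (star t u)))
  star-assoc s@(node _ _ _) leaf u = ≋-trans (extend-basis (λ v → star v u) s) (≋-sym (extend-basis (star s) u))
  star-assoc s@(node _ _ _) t@(node _ _ _) leaf =
    ≋-trans (extend-cong-fun star-leafʳ (star s t)) (≋-trans (extend-basis-id (star s t)) (≋-sym (extend-basis (star s) t)))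
  star-assoc X@(node x0 xs xk) Y@(node y0 ys yk) Z@(node z0 zs zk) =
    StarAssocNodes.star-assoc-nodes x0 xs xk y0 ys yk z0 zs zk (star-assoc xk Y Z) (star-assoc xk Y z0) (star-assoc X Y z0)


module StarAlgebra {c ℓ} (R : CommutativeRing c ℓ) where

  open import Data.List using (List; []; _∷_; _++_)
  open import Defs
  open StarAssociativity R public
  open TD R

  starC-assoc : ∀ x y z → starC (starC x y) z ≋ starC x (starC y z)
  starC-assoc x y z =
    ≋-trans (extend-extend (λ s → extend (star s) y) (λ v → extend (star v) z) x)
    (≋-trans (extend-cong-fun (λ s → ≋-trans (extend-extend (star s) (λ v → extend (star v) z) y)
                      (extend-cong-fun (λ t → ≋-trans (fubini (λ v u → star v u) (star s t) z)
                                     (extend-cong-fun (λ u → star-assoc s t u) z)) y)) x)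
    (extend-cong-fun (λ s → ≋-sym (≋-trans (extend-cong (star s) (≋-refl {u = extend (λ t → extend (star t) z) y}))
                    (≋-trans (extend-extend (λ t → extend (star t) z) (star s) y)
                     (extend-cong-fun (λ t → extend-extend (star t) (star s) z) y)))) x))

  starC-identityˡ : ∀ x → starC (basis leaf) x ≋ x
  starC-identityˡ x = ≋-trans (extend-basis (λ s → extend (star s) x) leaf) (extend-basis-id x)

  starC-identityʳ : ∀ x → starC x (basis leaf) ≋ x
  starC-identityʳ x = ≋-trans (extend-cong-fun (λ s → ≋-trans (extend-basis (star s) leaf) (star-leafʳ s)) x) (extend-basis-id x)

  starC-cong : ∀ {x x' y y'} → x ≋ x' → y ≋ y' → starC x y ≋ starC x' y'
  starC-cong {x} {x'} {y} {y'} p q = extend-cong₂ (λ s → extend-cong (star s) q) p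

  starFoldC : List Tree → V
  starFoldC [] = basis leaf
  starFoldC (g ∷ gs) = starC (basis g) (starFoldC gs)

  starFold≋starFoldC : ∀ gs → starFold gs ≋ starFoldC gs
  starFold≋starFoldC [] = ≋-refl
  starFold≋starFoldC (g ∷ gs) = ≋-trans (starV≋starC (basis g) (starFold gs)) (starC-cong (≋-refl {u = basis g}) (starFold≋starFoldC gs))

  starFoldC-++ : ∀ l1 l2 → starFoldC (l1 ++ l2) ≋ starC (starFoldC l1) (starFoldC l2)
  starFoldC-++ [] l2 = ≋-sym (starC-identityˡ (starFoldC l2))
  starFoldC-++ (g ∷ l1) l2 = ≋-trans (starC-cong (≋-refl {u = basis g}) (starFoldC-++ l1 l2)) (≋-sym (starC-assoc (basis g) (starFoldC l1) (starFoldC l2)))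

  starFoldC-single : ∀ g → starFoldC (g ∷ []) ≋ basis g
  starFoldC-single g = starC-identityʳ (basis g)


module PairedProduct {c ℓ} (R : CommutativeRing c ℓ) where

  open import Data.Product using (_×_; _,_; proj₁; proj₂)
  open import Defs
  open StarAlgebra R public
  open TD R

  onSnd : {X Y : Set} → (X → Y) → Tree × X → Tree × Y
  onSnd f gx = (proj₁ gx , f (proj₂ gx))

  starPair : {X Y : Set} → Tree × X → Tree × Y → Comb (Tree × (X × Y))
  starPair gx hy = fmap (λ w → (w , (proj₂ gx , proj₂ hy))) (star (proj₁ gx) (proj₁ hy))

  -- u ⊛ v multiplies the Tree components by * and pairs the labels; it combines the G-parts of cuts of
  -- different children while keeping their P-parts apart.
  infixl 7 _⊛_
  _⊛_ : {X Y : Set} → Comb (Tree × X) → Comb (Tree × Y) → Comb (Tree × (X × Y))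
  u ⊛ v = extend (λ gx → extend (starPair gx) v) u

  module _ {X Y : Set} {{EX : BoolEq X}} {{EY : BoolEq Y}} where
    ⊛-cong : ∀ {u u' : Comb (Tree × X)} {v v' : Comb (Tree × Y)} → u ≋ u' → v ≋ v' → u ⊛ v ≋ u' ⊛ v'
    ⊛-cong p q = extend-cong₂ (λ gx → extend-cong (starPair gx) q) p

    ⊛-extendˡ : ∀ {A : Set} (F : A → Comb (Tree × X)) o (v : Comb (Tree × Y)) → extend F o ⊛ v ≋ extend (λ a → F a ⊛ v) o
    ⊛-extendˡ F o v = extend-extend F (λ gx → extend (starPair gx) v) o

    ⊛-extendʳ : ∀ {A : Set} (u : Comb (Tree × X)) (G : A → Comb (Tree × Y)) o → u ⊛ extend G o ≋ extend (λ a → u ⊛ G a) o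
    ⊛-extendʳ u G o = ≋-trans (extend-cong-fun (λ gx → extend-extend G (starPair gx) o) u) (fubini (λ gx a → extend (starPair gx) (G a)) u o)

    ⊛-basisˡ : ∀ (gx : Tree × X) (v : Comb (Tree × Y)) → basis gx ⊛ v ≋ extend (starPair gx) v
    ⊛-basisˡ gx v = extend-basis (λ gx → extend (starPair gx) v) gx

    ⊛-unitˡ : ∀ (x : X) (v : Comb (Tree × Y)) → basis (leaf , x) ⊛ v ≋ fmap (λ hy → (proj₁ hy , (x , proj₂ hy))) v
    ⊛-unitˡ x v = ≋-trans (⊛-basisˡ (leaf , x) v) (extend-cong-fun (λ hy → extend-basis (λ w → basis (w , (x , proj₂ hy))) (proj₁ hy)) v)

    ⊛-tagged : ∀ (A B : V) (x : X) (y : Y) → fmap (λ h → (h , x)) A ⊛ fmap (λ h → (h , y)) B ≋ fmap (λ w → (w , (x , y))) (starC A B)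
    ⊛-tagged A B x y =
      ≋-trans (extend-fmap (λ gx → extend (starPair gx) (fmap (λ h → (h , y)) B)) (λ h → (h , x)) A)
      (≋-trans (extend-cong-fun (λ g → extend-fmap (starPair (g , x)) (λ h → (h , y)) B) A)
      (≋-sym (≋-trans (fmap-extend (λ w → (w , (x , y))) (λ s → extend (star s) B) A)
      (extend-cong-fun (λ s → fmap-extend (λ w → (w , (x , y))) (star s) B) A))))

  module _ {X Y X' Y' : Set} {{EX : BoolEq X}} {{EY : BoolEq Y}} {{EX' : BoolEq X'}} {{EY' : BoolEq Y'}} where
    ⊛-onSnd : ∀ (f : X → X') (f' : Y → Y') u v → fmap (onSnd f) u ⊛ fmap (onSnd f') v ≋ fmap (onSnd (λ xy → (f (proj₁ xy) , f' (proj₂ xy)))) (u ⊛ v)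
    ⊛-onSnd f f' u v =
      ≋-trans (extend-fmap (λ gx → extend (starPair gx) (fmap (onSnd f') v)) (onSnd f) u)
      (≋-trans (extend-cong-fun (λ gx → ≋-trans (extend-fmap (starPair (onSnd f gx)) (onSnd f') v)
                                 (extend-cong-fun (λ hy → ≋-sym (fmap-fmap (onSnd F) (λ w → (w , (proj₂ gx , proj₂ hy))) (star (proj₁ gx) (proj₁ hy)))) v)) u)
      (≋-sym (≋-trans (extend-extend (λ gx → extend (starPair gx) v) (λ u → basis (onSnd F u)) u)
             (extend-cong-fun (λ gx → extend-extend (starPair gx) (λ u → basis (onSnd F u)) v) u))))
      where
      F : X × Y → X' × Y'
      F xy = (f (proj₁ xy) , f' (proj₂ xy))

  module _ {X Y Z : Set} {{EX : BoolEq X}} {{EY : BoolEq Y}} {{EZ : BoolEq Z}} where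
    reassoc : Tree × (X × (Y × Z)) → Tree × ((X × Y) × Z)
    reassoc p = (proj₁ p , ((proj₁ (proj₂ p) , proj₁ (proj₂ (proj₂ p))) , proj₂ (proj₂ (proj₂ p))))

    ⊛-assoc : ∀ (u : Comb (Tree × X)) (v : Comb (Tree × Y)) (w : Comb (Tree × Z)) → (u ⊛ v) ⊛ w ≋ fmap reassoc (u ⊛ (v ⊛ w))
    ⊛-assoc u v w = ≋-trans lhs (≋-sym rhs)
      where
      T : Tree × X → Tree × Y → Tree × Z → Comb (Tree × ((X × Y) × Z))
      T gx hy kz = fmap (λ t → (t , ((proj₂ gx , proj₂ hy) , proj₂ kz))) (extend (star (proj₁ gx)) (star (proj₁ hy) (proj₁ kz)))
      inL : ∀ gx hy → extend (λ p → extend (starPair p) w) (starPair gx hy) ≋ extend (T gx hy) w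
      inL gx hy = ≋-trans (extend-fmap (λ p → extend (starPair p) w) (λ s → (s , (proj₂ gx , proj₂ hy))) (star (proj₁ gx) (proj₁ hy)))
            (≋-trans (fubini (λ s kz → starPair (s , (proj₂ gx , proj₂ hy)) kz) (star (proj₁ gx) (proj₁ hy)) w)
            (extend-cong-fun (λ kz → ≋-trans (≋-sym (extend-extend (λ s → star s (proj₁ kz)) (λ t → basis (t , ((proj₂ gx , proj₂ hy) , proj₂ kz))) (star (proj₁ gx) (proj₁ hy))))
                             (fmap-cong _ (star-assoc (proj₁ gx) (proj₁ hy) (proj₁ kz)))) w))
      lhs : (u ⊛ v) ⊛ w ≋ extend (λ gx → extend (λ hy → extend (T gx hy) w) v) u
      lhs = ≋-trans (extend-extend (λ gx → extend (starPair gx) v) (λ p → extend (starPair p) w) u)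
            (extend-cong-fun (λ gx → ≋-trans (extend-extend (starPair gx) (λ p → extend (starPair p) w) v) (extend-cong-fun (λ hy → inL gx hy) v)) u)
      inR : ∀ gx hy kz → fmap reassoc (extend (starPair gx) (starPair hy kz)) ≋ T gx hy kz
      inR gx hy kz = ≋-trans (fmap-cong reassoc (extend-fmap (starPair gx) (λ t → (t , (proj₂ hy , proj₂ kz))) (star (proj₁ hy) (proj₁ kz))))
          (≋-trans (extend-extend (λ t → starPair gx (t , (proj₂ hy , proj₂ kz))) (λ p → basis (reassoc p)) (star (proj₁ hy) (proj₁ kz)))
          (≋-trans (extend-cong-fun (λ t → fmap-fmap reassoc (λ r → (r , (proj₂ gx , (proj₂ hy , proj₂ kz)))) (star (proj₁ gx) t)) (star (proj₁ hy) (proj₁ kz)))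
          (≋-sym (extend-extend (star (proj₁ gx)) (λ r → basis (r , ((proj₂ gx , proj₂ hy) , proj₂ kz))) (star (proj₁ hy) (proj₁ kz))))))
      rhs : fmap reassoc (u ⊛ (v ⊛ w)) ≋ extend (λ gx → extend (λ hy → extend (T gx hy) w) v) u
      rhs = ≋-trans (extend-extend (λ gx → extend (starPair gx) (v ⊛ w)) (λ p → basis (reassoc p)) u)
            (extend-cong-fun (λ gx → ≋-trans (fmap-cong reassoc (≋-refl {u = extend (starPair gx) (v ⊛ w)}))
               (≋-trans (extend-extend (starPair gx) (λ u → basis (reassoc u)) (v ⊛ w))
               (≋-trans (extend-extend (λ hy → extend (starPair hy) w) (λ q → fmap reassoc (starPair gx q)) v)
               (extend-cong-fun (λ hy → ≋-trans (extend-extend (starPair hy) (λ q → fmap reassoc (starPair gx q)) w)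
                  (extend-cong-fun (λ kz → ≋-trans (≋-sym (extend-extend (starPair gx) (λ u → basis (reassoc u)) (starPair hy kz))) (inR gx hy kz)) w)) v)))) u)

  module _ {X Y X' : Set} {{EX : BoolEq X}} {{EY : BoolEq Y}} {{EX' : BoolEq X'}} where
    ⊛-onSndʳ : ∀ (f : Y → X') (u : Comb (Tree × X)) v → u ⊛ fmap (onSnd f) v ≋ fmap (onSnd (λ xy → (proj₁ xy , f (proj₂ xy)))) (u ⊛ v)
    ⊛-onSndʳ f u v = ≋-trans (⊛-cong (≋-sym (extend-basis-id u)) (≋-refl {u = fmap (onSnd f) v})) (⊛-onSnd (λ x → x) f u v)
    ⊛-onSndˡ : ∀ (f : X → X') u (v : Comb (Tree × Y)) → fmap (onSnd f) u ⊛ v ≋ fmap (onSnd (λ xy → (f (proj₁ xy) , proj₂ xy))) (u ⊛ v)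
    ⊛-onSndˡ f u v = ≋-trans (⊛-cong (≋-refl {u = fmap (onSnd f) u}) (≋-sym (extend-basis-id v))) (⊛-onSnd f (λ x → x) u v)

  module _ {X Y Z : Set} {{EX : BoolEq X}} {{EY : BoolEq Y}} {{EZ : BoolEq Z}} where
    reassoc⁻¹ : Tree × ((X × Y) × Z) → Tree × (X × (Y × Z))
    reassoc⁻¹ p = (proj₁ p , (proj₁ (proj₁ (proj₂ p)) , (proj₂ (proj₁ (proj₂ p)) , proj₂ (proj₂ p))))
    ⊛-reassoc⁻¹ : ∀ (u : Comb (Tree × X)) (v : Comb (Tree × Y)) (w : Comb (Tree × Z)) → u ⊛ (v ⊛ w) ≋ fmap reassoc⁻¹ ((u ⊛ v) ⊛ w)
    ⊛-reassoc⁻¹ u v w = ≋-sym (≋-trans (fmap-cong reassoc⁻¹ (⊛-assoc u v w)) (≋-trans (fmap-fmap reassoc⁻¹ reassoc (u ⊛ (v ⊛ w))) (extend-basis-id (u ⊛ (v ⊛ w)))))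


module CoproductRecursion {c ℓ} (R : CommutativeRing c ℓ) where

  open import Data.List using (List; []; _∷_; _++_; map; concatMap)
  open import Data.List.Properties using (map-++)
  open import Data.Product using (_×_; _,_; proj₁; proj₂)
  open import Relation.Binary.PropositionalEquality as P using (_≡_)
  open import Defs
  open PairedProduct R public
  open CommutativeRing R using (1#; *-identityˡ; refl)
  open TD R

  ones : {A : Set} → List A → Comb A
  ones = map (λ o → (1# , o))

  module _ {A C : Set} {{EC : BoolEq C}} where
    ones-map : ∀ (f : A → C) xs → ones (map f xs) ≋ fmap f (ones xs)
    ones-map f [] = ≋-refl
    ones-map f (x ∷ xs) = ∷-cong (f x) (CommutativeRing.sym R (*-identityˡ 1#)) (ones-map f xs)

    ones-concatMap : ∀ (f : A → List C) xs → ones (concatMap f xs) ≋ extend (λ x → ones (f x)) (ones xs)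
    ones-concatMap f [] = ≋-refl
    ones-concatMap f (x ∷ xs) = ≋-trans (≡⇒≋ (map-++ (λ o → (1# , o)) (f x) (concatMap f xs))) (++-cong (≋-sym (smul-1 (ones (f x)))) (ones-concatMap f xs))

  cutTerm : {X : Set} → List Tree × X → Comb (Tree × X)
  cutTerm o = fmap (λ g → (g , proj₂ o)) (starFoldC (proj₁ o))

  cutSum : {X : Set} → List (List Tree × X) → Comb (Tree × X)
  cutSum opts = extend cutTerm (ones opts)

  tens≋extend : ∀ x y → tens x y ≋ extend (λ s → fmap (λ t → (s , t)) y) x
  tens≋extend x y = concatMap≋extend _ _ (λ a s → map≋smul-fmap _ a (λ t → (s , t)) (λ d t → P.refl) (λ d t → refl) y) x

  concatMap≋cutSum : ∀ (g : List Tree × Tree → V2) → (∀ gs p → g (gs , p) ≋ cutTerm (gs , p)) → ∀ opts → concatMap g opts ≋ cutSum opts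
  concatMap≋cutSum g h [] = ≋-refl
  concatMap≋cutSum g h ((gs , p) ∷ opts) = ++-cong (≋-trans (h gs p) (≋-sym (smul-1 _))) (concatMap≋cutSum g h opts)

  tens≋cutTerm : ∀ gs p → tens (starFold gs) (basis p) ≋ cutTerm (gs , p)
  tens≋cutTerm gs p = ≋-trans (tens≋extend (starFold gs) (basis p)) (≋-trans (extend-cong-fun (λ s → extend-basis (λ t → basis (s , t)) p) (starFold gs))
               (fmap-cong (λ s → (s , p)) (starFold≋starFoldC gs)))

  Δ-cuts : ∀ a ms b → Δ (node a ms b) ≋ basis (node a ms b , leaf) ++ cutSum (cutsBelow (node a ms b))
  Δ-cuts a ms b = ++-cong ≋-refl (concatMap≋cutSum _ tens≋cutTerm (cutsBelow (node a ms b)))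

  consPair : Tree × List Tree → List Tree
  consPair p = proj₁ p ∷ proj₂ p

  -- ΔCuts a ms b is the sum over the non-total cuts of a ∨ ms ∨ b (proved in Δ-node): such a cut chooses
  -- for each child independently the edge above it or a cut inside it, i.e. a term of its coproduct.
  ΔList : List Tree → Comb (Tree × List Tree)
  ΔList [] = basis (leaf , [])
  ΔList (m ∷ ms) = fmap (onSnd consPair) (Δ m ⊛ ΔList ms)

  nodeOf : (Tree × List Tree) × Tree → Tree
  nodeOf q = node (proj₁ (proj₁ q)) (proj₂ (proj₁ q)) (proj₂ q)

  ΔCuts : Tree → List Tree → Tree → V2
  ΔCuts a ms b = fmap (onSnd nodeOf) ((Δ a ⊛ ΔList ms) ⊛ Δ b)

  cutTerm-++ : ∀ {X Y Z : Set} {{_ : BoolEq X}} {{_ : BoolEq Y}} {{_ : BoolEq Z}} (f : X × Y → Z) g1 x g2 y →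
     cutTerm (g1 ++ g2 , f (x , y)) ≋ fmap (onSnd f) (cutTerm (g1 , x) ⊛ cutTerm (g2 , y))
  cutTerm-++ f g1 x g2 y =
    ≋-trans (fmap-cong (λ g → (g , f (x , y))) (starFoldC-++ g1 g2))
    (≋-trans (≋-sym (fmap-fmap (onSnd f) (λ w → (w , (x , y))) (starC (starFoldC g1) (starFoldC g2))))
    (fmap-cong (onSnd f) (≋-sym (⊛-tagged (starFoldC g1) (starFoldC g2) x y))))

  open import Data.List.Properties using (++-assoc)

  cutTerm-++-pair : ∀ {X Y : Set} {{_ : BoolEq X}} {{_ : BoolEq Y}} g1 (x : X) g2 (y : Y) → cutTerm (g1 ++ g2 , (x , y)) ≋ cutTerm (g1 , x) ⊛ cutTerm (g2 , y)
  cutTerm-++-pair g1 x g2 y = ≋-trans (cutTerm-++ (λ q → q) g1 x g2 y) (extend-basis-id _)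

  cutTerm-++₃ : ∀ {X Y Z W : Set} {{_ : BoolEq X}} {{_ : BoolEq Y}} {{_ : BoolEq Z}} {{_ : BoolEq W}} (f : (X × Y) × Z → W) g1 x g2 y g3 z →
     cutTerm (g1 ++ g2 ++ g3 , f ((x , y) , z)) ≋ fmap (onSnd f) ((cutTerm (g1 , x) ⊛ cutTerm (g2 , y)) ⊛ cutTerm (g3 , z))
  cutTerm-++₃ f g1 x g2 y g3 z =
    ≋-trans (≡⇒≋ (P.cong (λ l → cutTerm (l , f ((x , y) , z))) (P.sym (++-assoc g1 g2 g3))))
    (≋-trans (cutTerm-++ f (g1 ++ g2) (x , y) g3 z)
    (fmap-cong (onSnd f) (⊛-cong (cutTerm-++-pair g1 x g2 y) (≋-refl {u = cutTerm (g3 , z)}))))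

  module _ {X Y Z : Set} {{_ : BoolEq X}} {{_ : BoolEq Y}} {{_ : BoolEq Z}} where
    cutSum-concatMap : ∀ (opts1 : List (List Tree × X)) (opts2 : List (List Tree × Y)) (f : X × Y → Z)
      (F : List Tree × X → List (List Tree × Z)) →
      (∀ o → F o ≡ map (λ o' → (proj₁ o ++ proj₁ o' , f (proj₂ o , proj₂ o'))) opts2) →
      cutSum (concatMap F opts1) ≋ fmap (onSnd f) (cutSum opts1 ⊛ cutSum opts2)
    cutSum-concatMap opts1 opts2 f F hF =
      ≋-trans (extend-cong cutTerm (ones-concatMap F opts1))
      (≋-trans (extend-extend (λ o → ones (F o)) cutTerm (ones opts1))
      (≋-trans (extend-cong-fun (λ o → ≋-trans (extend-cong cutTerm (≋-trans (≡⇒≋ (P.cong ones (hF o))) (ones-map _ opts2)))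
                       (≋-trans (extend-fmap cutTerm _ (ones opts2))
                       (extend-cong-fun (λ o' → cutTerm-++ f (proj₁ o) (proj₂ o) (proj₁ o') (proj₂ o')) (ones opts2)))) (ones opts1))
      (≋-sym (≋-trans (fmap-cong (onSnd f) (≋-trans (⊛-extendˡ cutTerm (ones opts1) (cutSum opts2)) (extend-cong-fun (λ o → ⊛-extendʳ (cutTerm o) cutTerm (ones opts2)) (ones opts1))))
             (≋-trans (extend-extend (λ o → extend (λ o' → cutTerm o ⊛ cutTerm o') (ones opts2)) (λ u → basis (onSnd f u)) (ones opts1))
             (extend-cong-fun (λ o → extend-extend (λ o' → cutTerm o ⊛ cutTerm o') (λ u → basis (onSnd f u)) (ones opts2)) (ones opts1)))))))

  module _ {X Y : Set} {{_ : BoolEq X}} {{_ : BoolEq Y}} where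
    ⊛-extend : ∀ {A B : Set} (F : A → Comb (Tree × X)) (G : B → Comb (Tree × Y)) a b → extend F a ⊛ extend G b ≋ extend (λ x → extend (λ y → F x ⊛ G y) b) a
    ⊛-extend F G a b = ≋-trans (⊛-extendˡ F a (extend G b)) (extend-cong-fun (λ x → ⊛-extendʳ (F x) G b) a)

  module _ {X Y Z W : Set} {{_ : BoolEq X}} {{_ : BoolEq Y}} {{_ : BoolEq Z}} {{_ : BoolEq W}} where
    cutSum-concatMap₃ : ∀ (opts1 : List (List Tree × X)) (opts2 : List (List Tree × Y)) (opts3 : List (List Tree × Z)) (f : (X × Y) × Z → W)
      (F : List Tree × X → List (List Tree × W)) (G : List Tree × X → List Tree × Y → List (List Tree × W)) →
      (∀ o → F o ≡ concatMap (G o) opts2) →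
      (∀ o o' → G o o' ≡ map (λ o'' → (proj₁ o ++ proj₁ o' ++ proj₁ o'' , f ((proj₂ o , proj₂ o') , proj₂ o''))) opts3) →
      cutSum (concatMap F opts1) ≋ fmap (onSnd f) ((cutSum opts1 ⊛ cutSum opts2) ⊛ cutSum opts3)
    cutSum-concatMap₃ opts1 opts2 opts3 f F G hF hG = ≋-trans lhs (≋-sym rhs)
      where
      O1 : Comb (List Tree × X)
      O1 = ones opts1
      O2 : Comb (List Tree × Y)
      O2 = ones opts2
      O3 : Comb (List Tree × Z)
      O3 = ones opts3
      T : List Tree × X → List Tree × Y → List Tree × Z → Comb (Tree × W)
      T o o' o'' = fmap (onSnd f) ((cutTerm o ⊛ cutTerm o') ⊛ cutTerm o'')
      lhs : cutSum (concatMap F opts1) ≋ extend (λ o → extend (λ o' → extend (T o o') O3) O2) O1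
      lhs = ≋-trans (extend-cong cutTerm (ones-concatMap F opts1))
        (≋-trans (extend-extend (λ o → ones (F o)) cutTerm O1)
        (extend-cong-fun (λ o → ≋-trans (extend-cong cutTerm (≋-trans (≡⇒≋ (P.cong ones (hF o))) (ones-concatMap (G o) opts2)))
           (≋-trans (extend-extend (λ o' → ones (G o o')) cutTerm O2)
           (extend-cong-fun (λ o' → ≋-trans (extend-cong cutTerm (≋-trans (≡⇒≋ (P.cong ones (hG o o'))) (ones-map _ opts3)))
              (≋-trans (extend-fmap cutTerm _ O3)
              (extend-cong-fun (λ o'' → cutTerm-++₃ f (proj₁ o) (proj₂ o) (proj₁ o') (proj₂ o') (proj₁ o'') (proj₂ o'')) O3))) O2))) O1))
      rhs : fmap (onSnd f) ((cutSum opts1 ⊛ cutSum opts2) ⊛ cutSum opts3) ≋ extend (λ o → extend (λ o' → extend (T o o') O3) O2) O1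
      rhs = ≋-trans (fmap-cong (onSnd f) (⊛-cong (⊛-extend cutTerm cutTerm O1 O2) (≋-refl {u = cutSum opts3})))
        (≋-trans (fmap-cong (onSnd f) (⊛-extend (λ o → extend (λ o' → cutTerm o ⊛ cutTerm o') O2) cutTerm O1 O3))
        (≋-trans (fmap-extend (onSnd f) _ O1)
        (extend-cong-fun (λ o → ≋-trans (fmap-extend (onSnd f) _ O3)
           (≋-trans (extend-cong-fun (λ o'' → ≋-trans (fmap-cong (onSnd f) (⊛-extendˡ (λ o' → cutTerm o ⊛ cutTerm o') O2 (cutTerm o''))) (fmap-extend (onSnd f) _ O2)) O3)
           (fubini (λ o'' o' → T o o' o'') O3 O2))) O1)))

  cutSum-childOpts : ∀ s → cutSum (childOpts s) ≋ Δ s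
  cutSum-childOptsL : ∀ ms → cutSum (childOptsL ms) ≋ ΔList ms
  cutSum-cutsBelow : ∀ a ms b → cutSum (cutsBelow (node a ms b)) ≋ ΔCuts a ms b
  cutSum-childOpts leaf = ≋-trans (≋-trans (++-identityʳ≋ _) (smul-1 _)) (extend-basis (λ g → basis (g , leaf)) leaf)
  cutSum-childOpts (node a ms b) = ≋-trans (++-cong (≋-trans (smul-1 _) (≋-trans (fmap-cong (λ g → (g , leaf)) (starFoldC-single (node a ms b))) (extend-basis (λ g → basis (g , leaf)) (node a ms b)))) (≋-refl {u = cutSum (cutsBelow (node a ms b))}))
                            (≋-sym (Δ-cuts a ms b))
  cutSum-childOptsL [] = ≋-trans (≋-trans (++-identityʳ≋ _) (smul-1 _)) (extend-basis (λ g → basis (g , [])) leaf)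
  cutSum-childOptsL (t ∷ ts) = ≋-trans (cutSum-concatMap (childOpts t) (childOptsL ts) consPair _ (λ o → P.refl))
                   (fmap-cong (onSnd consPair) (⊛-cong (cutSum-childOpts t) (cutSum-childOptsL ts)))
  cutSum-cutsBelow a ms b = ≋-trans (cutSum-concatMap₃ (childOpts a) (childOptsL ms) (childOpts b) nodeOf _ _ (λ o → P.refl) (λ o o' → P.refl))
                 (fmap-cong (onSnd nodeOf) (⊛-cong (⊛-cong (cutSum-childOpts a) (cutSum-childOptsL ms)) (cutSum-childOpts b)))

  Δ-node : ∀ a ms b → Δ (node a ms b) ≋ basis (node a ms b , leaf) ++ ΔCuts a ms b
  Δ-node a ms b = ≋-trans (Δ-cuts a ms b) (++-cong (≋-refl {u = basis (node a ms b , leaf)}) (cutSum-cutsBelow a ms b))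

  appendPair : List Tree × List Tree → List Tree
  appendPair p = proj₁ p ++ proj₂ p

  ΔList-++ : ∀ l1 l2 → ΔList (l1 ++ l2) ≋ fmap (onSnd appendPair) (ΔList l1 ⊛ ΔList l2)
  ΔList-++ [] l2 = ≋-sym (≋-trans (fmap-cong (onSnd appendPair) (⊛-unitˡ [] (ΔList l2))) (≋-trans (fmap-fmap (onSnd appendPair) _ (ΔList l2)) (extend-basis-id (ΔList l2))))
  ΔList-++ (m ∷ l1) l2 =
    ≋-trans (fmap-cong (onSnd consPair) (≋-trans (⊛-cong (≋-refl {u = Δ m}) (ΔList-++ l1 l2)) (⊛-onSndʳ appendPair (Δ m) (ΔList l1 ⊛ ΔList l2))))
    (≋-trans (fmap-fmap (onSnd consPair) _ (Δ m ⊛ (ΔList l1 ⊛ ΔList l2)))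
    (≋-sym (≋-trans (fmap-cong (onSnd appendPair) (≋-trans (⊛-onSndˡ consPair (Δ m ⊛ ΔList l1) (ΔList l2)) (fmap-cong _ (⊛-assoc (Δ m) (ΔList l1) (ΔList l2)))))
           (≋-trans (fmap-fmap (onSnd appendPair) _ (fmap reassoc (Δ m ⊛ (ΔList l1 ⊛ ΔList l2))))
           (fmap-fmap _ reassoc (Δ m ⊛ (ΔList l1 ⊛ ΔList l2)))))))


module TensorProduct {c ℓ} (R : CommutativeRing c ℓ) where

  open import Data.List using (_++_)
  open import Data.Product using (_×_; _,_; proj₁; proj₂)
  open import Defs
  open CoproductRecursion R public
  open TD R

  star⊗ : {Z : Set} → Tree → Tree → Comb Z → Comb (Tree × Z)
  star⊗ g h v = extend (λ w → fmap (λ z → (w , z)) v) (star g h)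

  starWith : {X Y Z : Set} → (X → Y → Comb Z) → Tree × X → Tree × Y → Comb (Tree × Z)
  starWith β gx hy = star⊗ (proj₁ gx) (proj₁ hy) (β (proj₂ gx) (proj₂ hy))

  -- The product of 𝒜 ⊗ X with 𝒜 ⊗ Y: * on the 𝒜 factors and β on the others (⊛ is prodWith basis₂).
  prodWith : {X Y Z : Set} → (X → Y → Comb Z) → Comb (Tree × X) → Comb (Tree × Y) → Comb (Tree × Z)
  prodWith β u v = extend (λ gx → extend (starWith β gx) v) u

  star⊗-cong : ∀ {Z : Set} {{_ : BoolEq Z}} g h {v v' : Comb Z} → v ≋ v' → star⊗ g h v ≋ star⊗ g h v'
  star⊗-cong g h p = extend-cong-fun (λ w → fmap-cong (λ z → (w , z)) p) (star g h)

  module _ {X Y Z : Set} {{EX : BoolEq X}} {{EY : BoolEq Y}} {{EZ : BoolEq Z}} where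
    prodWith-cong : ∀ {β β' : X → Y → Comb Z} {u u' v v'} → (∀ x y → β x y ≋ β' x y) → u ≋ u' → v ≋ v' → prodWith β u v ≋ prodWith β' u' v'
    prodWith-cong {β} {β'} {u} {u'} {v} {v'} pβ pu pv =
      extend-cong₂ (λ gx → extend-cong₂ (λ hy → star⊗-cong (proj₁ gx) (proj₁ hy) (pβ (proj₂ gx) (proj₂ hy))) pv) pu

    prodWith-extendˡ : ∀ {A : Set} (β : X → Y → Comb Z) (F : A → Comb (Tree × X)) o v → prodWith β (extend F o) v ≋ extend (λ a → prodWith β (F a) v) o
    prodWith-extendˡ β F o v = extend-extend F _ o

    prodWith-extendʳ : ∀ {A : Set} (β : X → Y → Comb Z) u (G : A → Comb (Tree × Y)) o → prodWith β u (extend G o) ≋ extend (λ a → prodWith β u (G a)) o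
    prodWith-extendʳ β u G o = ≋-trans (extend-cong-fun (λ gx → extend-extend G _ o) u) (fubini (λ gx a → extend (λ hy → star⊗ (proj₁ gx) (proj₁ hy) (β (proj₂ gx) (proj₂ hy))) (G a)) u o)

    prodWith-++ʳ : ∀ (β : X → Y → Comb Z) u v v' → prodWith β u (v ++ v') ≋ prodWith β u v ++ prodWith β u v'
    prodWith-++ʳ β u v v' = ≋-trans (extend-cong-fun (λ gx → ≡⇒≋ (extend-++ _ v v')) u) (extend-fun-++ _ _ u)

    prodWith-basisˡ : ∀ (β : X → Y → Comb Z) gx v → prodWith β (basis gx) v ≋ extend (λ hy → star⊗ (proj₁ gx) (proj₁ hy) (β (proj₂ gx) (proj₂ hy))) v
    prodWith-basisˡ β gx v = extend-basis (λ gx → extend (starWith β gx) v) gx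

    prodWith-basisʳ : ∀ (β : X → Y → Comb Z) u hy → prodWith β u (basis hy) ≋ extend (λ gx → star⊗ (proj₁ gx) (proj₁ hy) (β (proj₂ gx) (proj₂ hy))) u
    prodWith-basisʳ β u hy = extend-cong-fun (λ gx → extend-basis (starWith β gx) hy) u

  module _ {X Y Z X' : Set} {{EX : BoolEq X}} {{EY : BoolEq Y}} {{EZ : BoolEq Z}} {{EX' : BoolEq X'}} where
    prodWith-fmapˡ : ∀ (β : X → Y → Comb Z) (f : X' → X) u v → prodWith β (fmap (onSnd f) u) v ≋ prodWith (λ x y → β (f x) y) u v
    prodWith-fmapˡ β f u v = extend-fmap _ (onSnd f) u

    prodWith-fmapʳ : ∀ (β : Y → X → Comb Z) (f : X' → X) u v → prodWith β u (fmap (onSnd f) v) ≋ prodWith (λ x y → β x (f y)) u v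
    prodWith-fmapʳ β f u v = extend-cong-fun (λ gx → extend-fmap _ (onSnd f) v) u

  module _ {X Y Z Z' : Set} {{EX : BoolEq X}} {{EY : BoolEq Y}} {{EZ : BoolEq Z}} {{EZ' : BoolEq Z'}} where
    fmap-prodWith : ∀ (β : X → Y → Comb Z) (f : Z → Z') u v → fmap (onSnd f) (prodWith β u v) ≋ prodWith (λ x y → fmap f (β x y)) u v
    fmap-prodWith β f u v = ≋-trans (fmap-extend (onSnd f) _ u) (extend-cong-fun (λ gx → ≋-trans (fmap-extend (onSnd f) _ v)
       (extend-cong-fun (λ hy → ≋-trans (fmap-extend (onSnd f) _ (star (proj₁ gx) (proj₁ hy)))
          (extend-cong-fun (λ w → ≋-trans (fmap-fmap (onSnd f) (λ z → (w , z)) (β (proj₂ gx) (proj₂ hy))) (≋-sym (fmap-fmap (λ z → (w , z)) f (β (proj₂ gx) (proj₂ hy))))) (star (proj₁ gx) (proj₁ hy)))) v)) u)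

  module _ {X Y Z V₁ V₂ W : Set} {{EX : BoolEq X}} {{EY : BoolEq Y}} {{EZ : BoolEq Z}} {{E1 : BoolEq V₁}} {{E2 : BoolEq V₂}} {{EW : BoolEq W}} where
    prodWith-assoc : ∀ (α : X → Y → Comb V₁) (β : V₁ → Z → Comb W) (δ : Y → Z → Comb V₂) (γ : X → V₂ → Comb W) →
      (∀ x y z → extend (λ v → β v z) (α x y) ≋ extend (γ x) (δ y z)) →
      ∀ u v w → prodWith β (prodWith α u v) w ≋ prodWith γ u (prodWith δ v w)
    prodWith-assoc α β δ γ H u v w = ≋-trans lhs (≋-sym rhs)
      where
      Tm : Tree × X → Tree × Y → Tree × Z → Comb (Tree × W)
      Tm gx hy kz = extend (λ t → fmap (λ r → (t , r)) (extend (γ (proj₂ gx)) (δ (proj₂ hy) (proj₂ kz)))) (extend (star (proj₁ gx)) (star (proj₁ hy) (proj₁ kz)))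
      c1 : ∀ gx hy kz → extend (λ p → starWith β p kz) (starWith α gx hy) ≋ Tm gx hy kz
      c1 (g , x) (h , y) (k , z) =
        ≋-trans (extend-extend (λ s → fmap (λ a → (s , a)) (α x y)) (λ p → starWith β p (k , z)) (star g h))
        (≋-trans (extend-cong-fun (λ s → ≋-trans (extend-fmap (λ p → starWith β p (k , z)) (λ a → (s , a)) (α x y))
                    (≋-trans (fubini (λ a t → fmap (λ r → (t , r)) (β a z)) (α x y) (star s k))
                    (extend-cong-fun (λ t → ≋-sym (fmap-extend (λ r → (t , r)) (λ a → β a z) (α x y))) (star s k)))) (star g h))
        (≋-trans (≋-sym (extend-extend (λ s → star s k) (λ t → fmap (λ r → (t , r)) (extend (λ a → β a z) (α x y))) (star g h)))
        (extend-cong₂ (λ t → fmap-cong (λ r → (t , r)) (H x y z)) (star-assoc g h k))))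
      c2 : ∀ gx hy kz → extend (starWith γ gx) (starWith δ hy kz) ≋ Tm gx hy kz
      c2 (g , x) (h , y) (k , z) =
        ≋-trans (extend-extend (λ s → fmap (λ b → (s , b)) (δ y z)) (starWith γ (g , x)) (star h k))
        (≋-trans (extend-cong-fun (λ s → ≋-trans (extend-fmap (starWith γ (g , x)) (λ b → (s , b)) (δ y z))
                    (≋-trans (fubini (λ b t → fmap (λ r → (t , r)) (γ x b)) (δ y z) (star g s))
                    (extend-cong-fun (λ t → ≋-sym (fmap-extend (λ r → (t , r)) (γ x) (δ y z))) (star g s)))) (star h k))
        (≋-sym (extend-extend (star g) (λ t → fmap (λ r → (t , r)) (extend (γ x) (δ y z))) (star h k))))
      lhs : prodWith β (prodWith α u v) w ≋ extend (λ gx → extend (λ hy → extend (Tm gx hy) w) v) u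
      lhs = ≋-trans (extend-extend (λ gx → extend (starWith α gx) v) (λ p → extend (starWith β p) w) u)
            (extend-cong-fun (λ gx → ≋-trans (extend-extend (starWith α gx) (λ p → extend (starWith β p) w) v)
               (extend-cong-fun (λ hy → ≋-trans (fubini (λ p kz → starWith β p kz) (starWith α gx hy) w) (extend-cong-fun (c1 gx hy) w)) v)) u)
      rhs : prodWith γ u (prodWith δ v w) ≋ extend (λ gx → extend (λ hy → extend (Tm gx hy) w) v) u
      rhs = extend-cong-fun (λ gx → ≋-trans (extend-extend (λ hy → extend (starWith δ hy) w) (starWith γ gx) v)
               (extend-cong-fun (λ hy → ≋-trans (extend-extend (starWith δ hy) (starWith γ gx) w) (extend-cong-fun (c2 gx hy) w)) v)) u


module TensorOperations {c ℓ} (R : CommutativeRing c ℓ) where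

  open import Data.List using ([]; _++_)
  open import Data.Product using (_×_; _,_; proj₁; proj₂)
  open import Relation.Binary.PropositionalEquality as P using (_≡_)
  open import Defs
  open TensorProduct R public
  open CommutativeRing R using (_*_; *-comm)
  open TD R

  basis₂ : {X Y : Set} → X → Y → Comb (X × Y)
  basis₂ x y = basis (x , y)

  module _ {X Y : Set} {{EX : BoolEq X}} {{EY : BoolEq Y}} where
    ⊛≋prodWith : ∀ (u : Comb (Tree × X)) (v : Comb (Tree × Y)) → u ⊛ v ≋ prodWith basis₂ u v
    ⊛≋prodWith u v = extend-cong-fun (λ gx → extend-cong-fun (λ hy → ≋-sym (extend-cong-fun (λ w → extend-basis (λ z → basis (w , z)) (proj₂ gx , proj₂ hy)) (star (proj₁ gx) (proj₁ hy)))) v) u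

  tens-star≋star⊗ : ∀ g h v → tens (star g h) v ≋ star⊗ g h v
  tens-star≋star⊗ g h v = tens≋extend (star g h) v

  bilin2≋extend : ∀ (f : Tree × Tree → Tree × Tree → V2) x y → bilin2 f x y ≋ extend (λ p → extend (f p) y) x
  bilin2≋extend f x y = concatMap≋extend _ _ (λ a s → ≋-trans (concatMap≋extend _ (λ t → smul a (f s t))
       (λ b t → ≋-trans (≡⇒≋ (scale≡smul (a * b) (f s t))) (≋-trans (smul-cong (*-comm a b) ≋-refl) (≋-sym (smul-smul b a (f s t))))) y)
       (extend-fun-smul (f s) a y)) x

  opC : Op → V2 → V2 → V2
  opC o z w = extend (λ p → extend (opTens o p) w) z

  opT≋opC : ∀ o z w → opT o z w ≋ opC o z w
  opT≋opC o = bilin2≋extend (opTens o)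

  starT≋prodWith : ∀ z w → starT z w ≋ prodWith star z w
  starT≋prodWith z w = ≋-trans (bilin2≋extend starTens z w) (extend-cong-fun (λ p → extend-cong-fun (λ q → tens-star≋star⊗ (proj₁ p) (proj₁ q) (star (proj₂ p) (proj₂ q))) w) z)

  opC-cong : ∀ o {z z' w w'} → z ≋ z' → w ≋ w' → opC o z w ≋ opC o z' w'
  opC-cong o p q = extend-cong₂ (λ p' → extend-cong (opTens o p') q) p

  opC-++ˡ : ∀ o z z' w → opC o (z ++ z') w ≡ opC o z w ++ opC o z' w
  opC-++ˡ o z z' w = extend-++ _ z z'

  opC-++ʳ : ∀ o z w w' → opC o z (w ++ w') ≋ opC o z w ++ opC o z w'
  opC-++ʳ o z w w' = ≋-trans (extend-cong-fun (λ p → ≡⇒≋ (extend-++ (opTens o p) w w')) z) (extend-fun-++ _ _ z)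

  opC-extendˡ : ∀ {A : Set} o (F : A → V2) a w → opC o (extend F a) w ≋ extend (λ x → opC o (F x) w) a
  opC-extendˡ o F a w = extend-extend F _ a

  opC-extendʳ : ∀ {A : Set} o z (G : A → V2) a → opC o z (extend G a) ≋ extend (λ x → opC o z (G x)) a
  opC-extendʳ o z G a = ≋-trans (extend-cong-fun (λ p → extend-extend G (opTens o p) a) z) (fubini (λ p x → extend (opTens o p) (G x)) z a)

  opC-basis : ∀ o p q → opC o (basis p) (basis q) ≋ opTens o p q
  opC-basis o p q = ≋-trans (extend-basis (λ p → extend (opTens o p) (basis q)) p) (extend-basis (opTens o p) q)

  opC-nodeOfˡ : ∀ o z w → opC o (fmap (onSnd nodeOf) z) w ≋ prodWith (λ q r → opTree o (nodeOf q) r) z w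
  opC-nodeOfˡ o z w = ≋-trans (extend-fmap _ (onSnd nodeOf) z) (extend-cong-fun (λ gq → extend-cong-fun (λ hr → tens-star≋star⊗ (proj₁ gq) (proj₁ hr) _) w) z)

  opTens-nodeOfʳ : ∀ o g p h r → opTens o (g , p) (h , nodeOf r) ≋ tens (star g h) (opTree o p (nodeOf r))
  opTens-nodeOfʳ o g leaf h r = ≋-refl
  opTens-nodeOfʳ o g (node _ _ _) h r = ≋-refl

  opC-nodeOfʳ : ∀ o z w → opC o z (fmap (onSnd nodeOf) w) ≋ prodWith (λ p r → opTree o p (nodeOf r)) z w
  opC-nodeOfʳ o z w = extend-cong-fun (λ gp → ≋-trans (extend-fmap (opTens o gp) (onSnd nodeOf) w)
     (extend-cong-fun (λ hr → ≋-trans (opTens-nodeOfʳ o (proj₁ gp) (proj₂ gp) (proj₁ hr) (proj₂ hr)) (tens-star≋star⊗ (proj₁ gp) (proj₁ hr) _)) w)) z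

  star⊗-basis : ∀ {Z : Set} {{_ : BoolEq Z}} g h (z : Z) → star⊗ g h (basis z) ≋ fmap (λ w → (w , z)) (star g h)
  star⊗-basis g h z = extend-cong-fun (λ w → extend-basis (λ z' → basis (w , z')) z) (star g h)

  star⊗-[] : ∀ {Z : Set} {{_ : BoolEq Z}} g h → star⊗ {Z} g h [] ≋ []
  star⊗-[] g h = extend-zero (star g h)

  opC-leaves : ∀ o a c → opC o (basis (a , leaf)) (basis (c , leaf)) ≋ fmap (λ w → (w , leaf)) (opTree o a c)
  opC-leaves o a c = ≋-trans (opC-basis o (a , leaf) (c , leaf)) (≋-trans (tens≋extend (opTree o a c) (basis leaf)) (extend-cong-fun (λ s → extend-basis (λ t → basis (s , t)) leaf) (opTree o a c)))

  prodWith-cong₂ : ∀ {X Y Z : Set} {{_ : BoolEq X}} {{_ : BoolEq Y}} {{_ : BoolEq Z}} (β : X → Y → Comb Z) {u u' v v'} → u ≋ u' → v ≋ v' → prodWith β u v ≋ prodWith β u' v'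
  prodWith-cong₂ β p q = prodWith-cong {β = β} {β' = β} (λ x y → ≋-refl) p q

  ⊛⊛≋prodWith : ∀ {X Y Z : Set} {{_ : BoolEq X}} {{_ : BoolEq Y}} {{_ : BoolEq Z}} (u : Comb (Tree × X)) (v : Comb (Tree × Y)) (w : Comb (Tree × Z)) →
    (u ⊛ v) ⊛ w ≋ prodWith basis₂ (prodWith basis₂ u v) w
  ⊛⊛≋prodWith u v w = ≋-trans (⊛≋prodWith (u ⊛ v) w) (prodWith-cong₂ basis₂ (⊛≋prodWith u v) (≋-refl {u = w}))


module DeltaPrecSucc {c ℓ} (R : CommutativeRing c ℓ) where

  open import Data.List using (List; _∷_; _++_)
  open import Data.Product using (_×_; _,_; proj₁; proj₂)
  open import Defs
  open TensorOperations R public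
  open TD R

  ΔChildren : Tree → List Tree → Tree → Comb (Tree × ((Tree × List Tree) × Tree))
  ΔChildren a ms b = (Δ a ⊛ ΔList ms) ⊛ Δ b

  prec-nodeOf : ∀ q r → prec (nodeOf q) r ≋ fmap (λ v → nodeOf (proj₁ q , v)) (star (proj₂ q) r)
  prec-nodeOf ((p0 , ps) , p1) leaf = ≋-sym (≋-trans (fmap-cong (node p0 ps) (star-leafʳ p1)) (extend-basis (λ v → basis (node p0 ps v)) p1))
  prec-nodeOf ((p0 , ps) , p1) (node c ns d) = prec-node p0 ps p1 c ns d

  succ-nodeOf : ∀ p r → succ p (nodeOf r) ≋ fmap (λ v → nodeOf ((v , proj₂ (proj₁ r)) , proj₂ r)) (star p (proj₁ (proj₁ r)))
  succ-nodeOf leaf ((r0 , rs) , r1) = ≋-sym (extend-basis (λ v → basis (node v rs r1)) r0)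
  succ-nodeOf (node a ms b) ((r0 , rs) , r1) = succ-node a ms b r0 rs r1

  dot-nodeOf : ∀ q r → dot (nodeOf q) (nodeOf r) ≋ fmap (λ v → node (proj₁ (proj₁ q)) (proj₂ (proj₁ q) ++ v ∷ proj₂ (proj₁ r)) (proj₂ r)) (star (proj₂ q) (proj₁ (proj₁ r)))
  dot-nodeOf ((p0 , ps) , p1) ((r0 , rs) , r1) = dot-node p0 ps p1 r0 rs r1

  fmap-basis₂ : ∀ {X Y Z : Set} {{_ : BoolEq Z}} (f : X × Y → Z) x y → fmap f (basis₂ x y) ≋ basis (f (x , y))
  fmap-basis₂ f x y = extend-basis (λ u → basis (f u)) (x , y)

  -- In each of the three cases both sides are rewritten to TOT ++ MAIN, where TOT collects the terms in
  -- which the cut of the product is total.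
  module PrecCase (x0 : Tree) (xs : List Tree) (xk y0 : Tree) (ys : List Tree) (yk : Tree)
    (ih : extend Δ (star xk (node y0 ys yk)) ≋ prodWith star (Δ xk) (Δ (node y0 ys yk))) where
    x y : Tree
    y = node y0 ys yk
    x = node x0 xs xk
    S' : Comb Tree
    S' = star xk y
    A : Comb (Tree × (Tree × List Tree))
    A = Δ x0 ⊛ ΔList xs
    TOT MAIN : V2
    TOT = fmap (λ w → (node x0 xs w , leaf)) S'
    MAIN = fmap (onSnd nodeOf) (A ⊛ prodWith star (Δ xk) (Δ y))
    lhs : extend Δ (prec x y) ≋ TOT ++ MAIN
    lhs = ≋-trans (extend-cong Δ (prec-node x0 xs xk y0 ys yk))
          (≋-trans (extend-fmap Δ (node x0 xs) S')
          (≋-trans (extend-cong-fun (λ w → Δ-node x0 xs w) S')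
          (≋-trans (extend-fun-++ (λ w → basis (node x0 xs w , leaf)) (λ w → ΔCuts x0 xs w) S')
          (++-cong (≋-refl {u = TOT})
             (≋-trans (≋-sym (fmap-extend (onSnd nodeOf) (λ w → A ⊛ Δ w) S'))
             (fmap-cong (onSnd nodeOf) (≋-trans (≋-sym (⊛-extendʳ A Δ S')) (⊛-cong (≋-refl {u = A}) ih))))))))
    r1 : opC `≺ (basis (x , leaf)) (Δ y) ≋ TOT
    r1 = ≋-trans (opC-cong `≺ (≋-refl {u = basis (x , leaf)}) (Δ-node y0 ys yk))
         (≋-trans (opC-++ʳ `≺ (basis (x , leaf)) (basis (y , leaf)) (ΔCuts y0 ys yk))
         (≋-trans (++-cong (opC-leaves `≺ x y)
                    (≋-trans (opC-nodeOfʳ `≺ (basis (x , leaf)) (ΔChildren y0 ys yk))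
                    (≋-trans (prodWith-basisˡ (λ p r → prec p (nodeOf r)) (x , leaf) (ΔChildren y0 ys yk)) (≋-trans (extend-cong-fun (λ hr → star⊗-[] x (proj₁ hr)) (ΔChildren y0 ys yk)) (extend-zero (ΔChildren y0 ys yk))))))
         (≋-trans (++-identityʳ≋ _) (≋-trans (fmap-cong (λ w → (w , leaf)) (prec-node x0 xs xk y0 ys yk)) (fmap-fmap (λ w → (w , leaf)) (node x0 xs) S')))))
    γ : Tree × List Tree → Tree → Comb Tree
    γ a v = basis (nodeOf (a , v))
    r2 : opC `≺ (ΔCuts x0 xs xk) (Δ y) ≋ MAIN
    r2 = ≋-trans (opC-nodeOfˡ `≺ (ΔChildren x0 xs xk) (Δ y))
         (≋-trans (prodWith-cong {u = ΔChildren x0 xs xk} {v = Δ y} (λ q r → prec-nodeOf q r) (⊛≋prodWith A (Δ xk)) (≋-refl {u = Δ y}))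
         (≋-trans (prodWith-assoc basis₂ (λ q r → fmap (λ v → nodeOf (proj₁ q , v)) (star (proj₂ q) r)) star γ
                     (λ a p1 z → extend-basis (λ q → fmap (λ v → nodeOf (proj₁ q , v)) (star (proj₂ q) z)) (a , p1)) A (Δ xk) (Δ y))
         (≋-trans (prodWith-cong (λ a v → ≋-sym (fmap-basis₂ nodeOf a v)) (≋-refl {u = A}) (≋-refl {u = prodWith star (Δ xk) (Δ y)}))
         (≋-trans (≋-sym (fmap-prodWith basis₂ nodeOf A (prodWith star (Δ xk) (Δ y))))
         (fmap-cong (onSnd nodeOf) (≋-sym (⊛≋prodWith A (prodWith star (Δ xk) (Δ y)))))))))
    rhs : opC `≺ (Δ x) (Δ y) ≋ TOT ++ MAIN
    rhs = ≋-trans (opC-cong `≺ (Δ-node x0 xs xk) (≋-refl {u = Δ y}))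
          (≋-trans (≡⇒≋ (opC-++ˡ `≺ (basis (x , leaf)) (ΔCuts x0 xs xk) (Δ y))) (++-cong r1 r2))

    Δ-prec : extend Δ (prec (node x0 xs xk) (node y0 ys yk)) ≋ opC `≺ (Δ (node x0 xs xk)) (Δ (node y0 ys yk))
    Δ-prec = ≋-trans lhs (≋-sym rhs)

  module SuccCase (x0 : Tree) (xs : List Tree) (xk y0 : Tree) (ys : List Tree) (yk : Tree)
    (ih : extend Δ (star (node x0 xs xk) y0) ≋ prodWith star (Δ (node x0 xs xk)) (Δ y0)) where
    x y : Tree
    y = node y0 ys yk
    x = node x0 xs xk
    V' : Comb Tree
    V' = star x y0
    Dx Q T : V2
    Dx = Δ x
    Q = Δ y0
    S : Comb (Tree × List Tree)
    S = ΔList ys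
    T = Δ yk
    TOT MAIN : V2
    TOT = fmap (λ w → (node w ys yk , leaf)) V'
    MAIN = fmap (onSnd nodeOf) ((prodWith star Dx Q ⊛ S) ⊛ T)
    lhs : extend Δ (succ x y) ≋ TOT ++ MAIN
    lhs = ≋-trans (extend-cong Δ (succ-node x0 xs xk y0 ys yk))
          (≋-trans (extend-fmap Δ (withFirst ys yk) V')
          (≋-trans (extend-cong-fun (λ w → Δ-node w ys yk) V')
          (≋-trans (extend-fun-++ (λ w → basis (node w ys yk , leaf)) (λ w → ΔCuts w ys yk) V')
          (++-cong (≋-refl {u = TOT})
             (≋-trans (≋-sym (fmap-extend (onSnd nodeOf) (λ w → (Δ w ⊛ S) ⊛ T) V'))
             (fmap-cong (onSnd nodeOf) (≋-trans (≋-sym (≋-trans (⊛-extendˡ (λ w → Δ w ⊛ S) V' T) (extend-cong-fun (λ w → ≋-refl {u = (Δ w ⊛ S) ⊛ T}) V')))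
                                   (⊛-cong (≋-trans (≋-sym (⊛-extendˡ Δ V' S)) (⊛-cong ih (≋-refl {u = S}))) (≋-refl {u = T})))))))))
    r1 : opC `≻ Dx (basis (y , leaf)) ≋ TOT
    r1 = ≋-trans (opC-cong `≻ (Δ-node x0 xs xk) (≋-refl {u = basis (y , leaf)}))
         (≋-trans (≡⇒≋ (opC-++ˡ `≻ (basis (x , leaf)) (ΔCuts x0 xs xk) (basis (y , leaf))))
         (≋-trans (++-cong (opC-leaves `≻ x y)
                    (≋-trans (opC-nodeOfˡ `≻ (ΔChildren x0 xs xk) (basis (y , leaf)))
                    (≋-trans (prodWith-basisʳ (λ q r → succ (nodeOf q) r) (ΔChildren x0 xs xk) (y , leaf)) (≋-trans (extend-cong-fun (λ gq → star⊗-[] (proj₁ gq) y) (ΔChildren x0 xs xk)) (extend-zero (ΔChildren x0 xs xk))))))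
         (≋-trans (++-identityʳ≋ _) (≋-trans (fmap-cong (λ w → (w , leaf)) (succ-node x0 xs xk y0 ys yk)) (fmap-fmap (λ w → (w , leaf)) (withFirst ys yk) V')))))
    β1 : Tree → Tree × List Tree → Comb (Tree × List Tree)
    β1 p qs = fmap (λ v → (v , proj₂ qs)) (star p (proj₁ qs))
    β2 : Tree → (Tree × List Tree) × Tree → Comb ((Tree × List Tree) × Tree)
    β2 p qst = fmap (λ v → (v , proj₂ qst)) (β1 p (proj₁ qst))
    r2 : opC `≻ Dx (ΔCuts y0 ys yk) ≋ MAIN
    r2 = ≋-trans (opC-nodeOfʳ `≻ Dx (ΔChildren y0 ys yk))
         (≋-trans (prodWith-cong {u = Dx} {v = ΔChildren y0 ys yk} (λ p r → succ-nodeOf p r) (≋-refl {u = Dx}) (⊛⊛≋prodWith Q S T))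
         (≋-sym (≋-trans (fmap-cong (onSnd nodeOf) (⊛⊛≋prodWith (prodWith star Dx Q) S T))
                (≋-trans (fmap-cong (onSnd nodeOf) (prodWith-cong₂ basis₂ (prodWith-assoc star basis₂ basis₂ β1 (λ p q s → ≋-sym (extend-basis (β1 p) (q , s))) Dx Q S) (≋-refl {u = T})))
                (≋-trans (fmap-cong (onSnd nodeOf) (prodWith-assoc β1 basis₂ basis₂ β2 (λ p qs t → ≋-sym (extend-basis (β2 p) (qs , t))) Dx (prodWith basis₂ Q S) T))
                (≋-trans (fmap-prodWith β2 nodeOf Dx (prodWith basis₂ (prodWith basis₂ Q S) T))
                (prodWith-cong (λ p qst → ≋-trans (fmap-fmap nodeOf (λ v → (v , proj₂ qst)) (β1 p (proj₁ qst))) (fmap-fmap _ (λ v → (v , proj₂ (proj₁ qst))) (star p (proj₁ (proj₁ qst)))))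
                   (≋-refl {u = Dx}) (≋-refl {u = prodWith basis₂ (prodWith basis₂ Q S) T}))))))))
    rhs : opC `≻ Dx (Δ y) ≋ TOT ++ MAIN
    rhs = ≋-trans (opC-cong `≻ (≋-refl {u = Dx}) (Δ-node y0 ys yk))
          (≋-trans (opC-++ʳ `≻ Dx (basis (y , leaf)) (ΔCuts y0 ys yk)) (++-cong r1 r2))

    Δ-succ : extend Δ (succ (node x0 xs xk) (node y0 ys yk)) ≋ opC `≻ (Δ (node x0 xs xk)) (Δ (node y0 ys yk))
    Δ-succ = ≋-trans lhs (≋-sym rhs)


module DeltaDot {c ℓ} (R : CommutativeRing c ℓ) where

  open import Data.List using (List; _∷_; _++_)
  open import Data.Product using (_×_; _,_; proj₁; proj₂)
  import Relation.Binary.PropositionalEquality as P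
  open import Defs
  open DeltaPrecSucc R public
  open TD R

  insertMiddle : List Tree × (Tree × List Tree) → List Tree
  insertMiddle q = proj₁ q ++ proj₁ (proj₂ q) ∷ proj₂ (proj₂ q)

  nodeInsert : (Tree × (List Tree × (Tree × List Tree))) × Tree → Tree
  nodeInsert q = node (proj₁ (proj₁ q)) (insertMiddle (proj₂ (proj₁ q))) (proj₂ q)

  module DotCase (x0 : Tree) (xs : List Tree) (xk y0 : Tree) (ys : List Tree) (yk : Tree)
    (ih : extend Δ (star xk y0) ≋ prodWith star (Δ xk) (Δ y0)) where
    β1 : Tree → Tree × List Tree → Comb (Tree × List Tree)
    β1 p qs = fmap (λ v → (v , proj₂ qs)) (star p (proj₁ qs))
    β3 : List Tree × Tree → Tree × List Tree → Comb (List Tree × (Tree × List Tree))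
    β3 ap z = fmap (λ v → (proj₁ ap , v)) (β1 (proj₂ ap) z)
    β4 : Tree × (List Tree × Tree) → Tree × List Tree → Comb (Tree × (List Tree × (Tree × List Tree)))
    β4 ab z = fmap (λ v → (proj₁ ab , v)) (β3 (proj₂ ab) z)
    ra' : (Tree × List Tree) × Tree → Tree × (List Tree × Tree)
    ra' q = (proj₁ (proj₁ q) , (proj₂ (proj₁ q) , proj₂ q))
    β4' : (Tree × List Tree) × Tree → Tree × List Tree → Comb (Tree × (List Tree × (Tree × List Tree)))
    β4' ap z = β4 (ra' ap) z
    β5 : (Tree × List Tree) × Tree → (Tree × List Tree) × Tree → Comb ((Tree × (List Tree × (Tree × List Tree))) × Tree)
    β5 ap qst = fmap (λ v → (v , proj₂ qst)) (β4' ap (proj₁ qst))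
    βd : (Tree × List Tree) × Tree → (Tree × List Tree) × Tree → Comb Tree
    βd q r = fmap (λ v → node (proj₁ (proj₁ q)) (proj₂ (proj₁ q) ++ v ∷ proj₂ (proj₁ r)) (proj₂ r)) (star (proj₂ q) (proj₁ (proj₁ r)))
    x y : Tree
    y = node y0 ys yk
    x = node x0 xs xk
    V' : Comb Tree
    V' = star xk y0
    P' Q T D0 : V2
    P' = Δ xk
    Q = Δ y0
    S DX : Comb (Tree × List Tree)
    S = ΔList ys
    T = Δ yk
    D0 = Δ x0
    DX = ΔList xs
    A : Comb (Tree × (Tree × List Tree))
    A = D0 ⊛ DX
    QS : Comb (Tree × (Tree × List Tree))
    QS = prodWith basis₂ Q S
    TOT MAIN : V2
    TOT = fmap (λ w → (withMiddle x0 xs ys yk w , leaf)) V'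
    MAIN = prodWith βd (A ⊛ P') ((Q ⊛ S) ⊛ T)
    nw : ∀ w → ΔCuts x0 (xs ++ w ∷ ys) yk ≋ fmap (onSnd nodeInsert) ((D0 ⊛ (DX ⊛ (Δ w ⊛ S))) ⊛ T)
    nw w = ≋-trans (fmap-cong (onSnd nodeOf) (⊛-cong (⊛-cong (≋-refl {u = D0}) dl) (≋-refl {u = T})))
           (≋-trans (fmap-cong (onSnd nodeOf) (⊛-cong (⊛-onSndʳ insertMiddle D0 (DX ⊛ (Δ w ⊛ S))) (≋-refl {u = T})))
           (≋-trans (fmap-cong (onSnd nodeOf) (⊛-onSndˡ _ (D0 ⊛ (DX ⊛ (Δ w ⊛ S))) T))
           (≋-trans (fmap-fmap (onSnd nodeOf) _ ((D0 ⊛ (DX ⊛ (Δ w ⊛ S))) ⊛ T))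
           (fmap-ext (λ u → P.refl) ((D0 ⊛ (DX ⊛ (Δ w ⊛ S))) ⊛ T)))))
      where
      dl : ΔList (xs ++ w ∷ ys) ≋ fmap (onSnd insertMiddle) (DX ⊛ (Δ w ⊛ S))
      dl = ≋-trans (ΔList-++ xs (w ∷ ys)) (≋-trans (fmap-cong (onSnd appendPair) (⊛-onSndʳ consPair DX (Δ w ⊛ S)))
           (≋-trans (fmap-fmap (onSnd appendPair) _ (DX ⊛ (Δ w ⊛ S))) (fmap-ext (λ u → P.refl) (DX ⊛ (Δ w ⊛ S)))))
    linw : extend (λ w → fmap (onSnd nodeInsert) ((D0 ⊛ (DX ⊛ (Δ w ⊛ S))) ⊛ T)) V' ≋ fmap (onSnd nodeInsert) ((D0 ⊛ (DX ⊛ (extend Δ V' ⊛ S))) ⊛ T)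
    linw = ≋-sym (≋-trans (fmap-cong (onSnd nodeInsert) (⊛-cong (⊛-cong (≋-refl {u = D0}) (⊛-cong (≋-refl {u = DX}) (⊛-extendˡ Δ V' S))) (≋-refl {u = T})))
          (≋-trans (fmap-cong (onSnd nodeInsert) (⊛-cong (⊛-cong (≋-refl {u = D0}) (⊛-extendʳ DX (λ w → Δ w ⊛ S) V')) (≋-refl {u = T})))
          (≋-trans (fmap-cong (onSnd nodeInsert) (⊛-cong (⊛-extendʳ D0 (λ w → DX ⊛ (Δ w ⊛ S)) V') (≋-refl {u = T})))
          (≋-trans (fmap-cong (onSnd nodeInsert) (⊛-extendˡ (λ w → D0 ⊛ (DX ⊛ (Δ w ⊛ S))) V' T))
          (fmap-extend (onSnd nodeInsert) (λ w → (D0 ⊛ (DX ⊛ (Δ w ⊛ S))) ⊛ T) V')))))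
    Z1 : V2
    Z1 = prodWith star P' Q
    m1 : Z1 ⊛ S ≋ prodWith β1 P' QS
    m1 = ≋-trans (⊛≋prodWith Z1 S) (prodWith-assoc star basis₂ basis₂ β1 (λ p q s → ≋-sym (extend-basis (β1 p) (q , s))) P' Q S)
    m2 : DX ⊛ prodWith β1 P' QS ≋ prodWith β3 (prodWith basis₂ DX P') QS
    m2 = ≋-trans (⊛≋prodWith DX (prodWith β1 P' QS)) (≋-sym (prodWith-assoc basis₂ β3 β1 basis₂ (λ a p z → extend-basis (λ v → β3 v z) (a , p)) DX P' QS))
    m3 : D0 ⊛ prodWith β3 (prodWith basis₂ DX P') QS ≋ prodWith β4 (prodWith basis₂ D0 (prodWith basis₂ DX P')) QS
    m3 = ≋-trans (⊛≋prodWith D0 (prodWith β3 (prodWith basis₂ DX P') QS)) (≋-sym (prodWith-assoc basis₂ β4 β3 basis₂ (λ a p z → extend-basis (λ v → β4 v z) (a , p)) D0 (prodWith basis₂ DX P') QS))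
    m4 : prodWith basis₂ D0 (prodWith basis₂ DX P') ≋ fmap (onSnd ra') (A ⊛ P')
    m4 = ≋-trans (≋-sym (≋-trans (⊛≋prodWith D0 (DX ⊛ P')) (prodWith-cong₂ basis₂ (≋-refl {u = D0}) (⊛≋prodWith DX P'))))
         (≋-trans (⊛-reassoc⁻¹ D0 DX P') (fmap-ext (λ u → P.refl) ((D0 ⊛ DX) ⊛ P')))
    m5 : prodWith β4' (A ⊛ P') QS ⊛ T ≋ prodWith β5 (A ⊛ P') (prodWith basis₂ QS T)
    m5 = ≋-trans (⊛≋prodWith (prodWith β4' (A ⊛ P') QS) T) (prodWith-assoc β4' basis₂ basis₂ β5 (λ p qs t → ≋-sym (extend-basis (β5 p) (qs , t))) (A ⊛ P') QS T)
    core : fmap (onSnd nodeInsert) ((D0 ⊛ (DX ⊛ (Z1 ⊛ S))) ⊛ T) ≋ MAIN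
    core = ≋-trans (fmap-cong (onSnd nodeInsert) (⊛-cong (≋-trans (⊛-cong (≋-refl {u = D0}) (≋-trans (⊛-cong (≋-refl {u = DX}) m1) m2))
                                                (≋-trans m3 (≋-trans (prodWith-cong₂ β4 m4 (≋-refl {u = QS})) (prodWith-fmapˡ β4 ra' (A ⊛ P') QS))))
                                       (≋-refl {u = T})))
           (≋-trans (fmap-cong (onSnd nodeInsert) m5)
           (≋-trans (fmap-prodWith β5 nodeInsert (A ⊛ P') (prodWith basis₂ QS T))
           (≋-sym (≋-trans (prodWith-cong₂ βd (≋-refl {u = A ⊛ P'}) (⊛⊛≋prodWith Q S T))
                  (prodWith-cong (λ ap qst → ≋-sym (pw ap qst)) (≋-refl {u = A ⊛ P'}) (≋-refl {u = prodWith basis₂ QS T}))))))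
      where
      pw : ∀ ap qst → fmap nodeInsert (β5 ap qst) ≋ βd ap qst
      pw ap qst = ≋-trans (fmap-fmap nodeInsert _ (β4' ap (proj₁ qst)))
                  (≋-trans (fmap-fmap _ _ (β3 (proj₂ (ra' ap)) (proj₁ qst)))
                  (≋-trans (fmap-fmap _ _ (β1 (proj₂ ap) (proj₁ qst)))
                  (≋-trans (fmap-fmap _ _ (star (proj₂ ap) (proj₁ (proj₁ qst))))
                  (fmap-ext (λ u → P.refl) (star (proj₂ ap) (proj₁ (proj₁ qst)))))))
    lhs : extend Δ (dot x y) ≋ TOT ++ MAIN
    lhs = ≋-trans (extend-cong Δ (dot-node x0 xs xk y0 ys yk))
          (≋-trans (extend-fmap Δ (withMiddle x0 xs ys yk) V')
          (≋-trans (extend-cong-fun (λ w → Δ-node x0 (xs ++ w ∷ ys) yk) V')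
          (≋-trans (extend-fun-++ (λ w → basis (withMiddle x0 xs ys yk w , leaf)) (λ w → ΔCuts x0 (xs ++ w ∷ ys) yk) V')
          (++-cong (≋-refl {u = TOT})
            (≋-trans (extend-cong-fun nw V') (≋-trans linw
            (≋-trans (fmap-cong (onSnd nodeInsert) (⊛-cong (⊛-cong (≋-refl {u = D0}) (⊛-cong (≋-refl {u = DX}) (⊛-cong ih (≋-refl {u = S})))) (≋-refl {u = T})))
            core)))))))
    r1 : opC `· (basis (x , leaf)) (Δ y) ≋ TOT
    r1 = ≋-trans (opC-cong `· (≋-refl {u = basis (x , leaf)}) (Δ-node y0 ys yk))
         (≋-trans (opC-++ʳ `· (basis (x , leaf)) (basis (y , leaf)) (ΔCuts y0 ys yk))
         (≋-trans (++-cong (opC-leaves `· x y)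
                    (≋-trans (opC-nodeOfʳ `· (basis (x , leaf)) (ΔChildren y0 ys yk))
                    (≋-trans (prodWith-basisˡ (λ p r → dot p (nodeOf r)) (x , leaf) (ΔChildren y0 ys yk)) (≋-trans (extend-cong-fun (λ hr → star⊗-[] x (proj₁ hr)) (ΔChildren y0 ys yk)) (extend-zero (ΔChildren y0 ys yk))))))
         (≋-trans (++-identityʳ≋ _) (≋-trans (fmap-cong (λ w → (w , leaf)) (dot-node x0 xs xk y0 ys yk)) (fmap-fmap (λ w → (w , leaf)) (withMiddle x0 xs ys yk) V')))))
    r2 : opC `· (ΔCuts x0 xs xk) (Δ y) ≋ MAIN
    r2 = ≋-trans (opC-nodeOfˡ `· (ΔChildren x0 xs xk) (Δ y))
         (≋-trans (prodWith-cong₂ (λ q r → dot (nodeOf q) r) (≋-refl {u = ΔChildren x0 xs xk}) (Δ-node y0 ys yk))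
         (≋-trans (prodWith-++ʳ (λ q r → dot (nodeOf q) r) (ΔChildren x0 xs xk) (basis (y , leaf)) (ΔCuts y0 ys yk))
         (≋-trans (++-cong (≋-trans (prodWith-basisʳ (λ q r → dot (nodeOf q) r) (ΔChildren x0 xs xk) (y , leaf)) (≋-trans (extend-cong-fun (λ gq → star⊗-[] (proj₁ gq) y) (ΔChildren x0 xs xk)) (extend-zero (ΔChildren x0 xs xk))))
                           (prodWith-fmapʳ (λ q r → dot (nodeOf q) r) nodeOf (ΔChildren x0 xs xk) (ΔChildren y0 ys yk)))
         (prodWith-cong (λ q r → dot-nodeOf q r) (≋-refl {u = ΔChildren x0 xs xk}) (≋-refl {u = ΔChildren y0 ys yk})))))
    rhs : opC `· (Δ x) (Δ y) ≋ TOT ++ MAIN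
    rhs = ≋-trans (opC-cong `· (Δ-node x0 xs xk) (≋-refl {u = Δ y}))
          (≋-trans (≡⇒≋ (opC-++ˡ `· (basis (x , leaf)) (ΔCuts x0 xs xk) (Δ y))) (++-cong r1 r2))

    Δ-dot : extend Δ (dot (node x0 xs xk) (node y0 ys yk)) ≋ opC `· (Δ (node x0 xs xk)) (Δ (node y0 ys yk))
    Δ-dot = ≋-trans lhs (≋-sym rhs)


module DeltaProducts {c ℓ} (R : CommutativeRing c ℓ) where

  open import Data.List using ([]; _++_)
  open import Data.Product using (_×_; _,_; proj₁; proj₂)
  open import Data.Bool using (false; _∧_)
  open import Relation.Binary.PropositionalEquality as P using (_≡_)
  open import Defs
  open DeltaDot R public
  open TD R

  extend-Δ-node-cong : ∀ y0 ys yk {F G : Tree × Tree → V2} → F (node y0 ys yk , leaf) ≋ G (node y0 ys yk , leaf) →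
        (∀ h r → F (h , nodeOf r) ≋ G (h , nodeOf r)) → extend F (Δ (node y0 ys yk)) ≋ extend G (Δ (node y0 ys yk))
  extend-Δ-node-cong y0 ys yk {F} {G} p q =
    ≋-trans (extend-cong F (Δ-node y0 ys yk))
    (≋-trans (≡⇒≋ (extend-++ F (basis (node y0 ys yk , leaf)) (ΔCuts y0 ys yk)))
    (≋-trans (++-cong (≋-trans (extend-basis F _) (≋-trans p (≋-sym (extend-basis G _))))
                      (≋-trans (extend-fmap F (onSnd nodeOf) (ΔChildren y0 ys yk)) (≋-trans (extend-cong-fun (λ hr → q (proj₁ hr) (proj₂ hr)) (ΔChildren y0 ys yk)) (≋-sym (extend-fmap G (onSnd nodeOf) (ΔChildren y0 ys yk))))))
    (≋-trans (≡⇒≋ (P.sym (extend-++ G (basis (node y0 ys yk , leaf)) (ΔCuts y0 ys yk)))) (≋-sym (extend-cong G (Δ-node y0 ys yk))))))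

  tens-++ˡ : ∀ u u' v → tens (u ++ u') v ≋ tens u v ++ tens u' v
  tens-++ˡ u u' v = ≋-trans (tens≋extend (u ++ u') v) (≋-trans (≡⇒≋ (extend-++ _ u u')) (++-cong (≋-sym (tens≋extend u v)) (≋-sym (tens≋extend u' v))))

  tens-++ʳ : ∀ u v v' → tens u (v ++ v') ≋ tens u v ++ tens u v'
  tens-++ʳ u v v' = ≋-trans (tens≋extend u (v ++ v')) (≋-trans (extend-cong-fun (λ s → ≡⇒≋ (extend-++ (λ t → basis (s , t)) v v')) u)
     (≋-trans (extend-fun-++ _ _ u) (++-cong (≋-sym (tens≋extend u v)) (≋-sym (tens≋extend u v')))))

  tens-[]ʳ : ∀ u → tens u [] ≋ []
  tens-[]ʳ u = ≋-trans (tens≋extend u []) (extend-zero u)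

  opTensSum : Tree × Tree → Tree × Tree → V2
  opTensSum p q = opTens `≺ p q ++ opTens `· p q ++ opTens `≻ p q

  opTensSum-inner : ∀ g b h d → (isLeaf b ∧ isLeaf d) ≡ false →
         prec b d ++ dot b d ++ succ b d ≋ star b d → opTensSum (g , b) (h , d) ≋ starWith star (g , b) (h , d)
  opTensSum-inner g b h d e s rewrite e =
    ≋-trans (≋-sym (≋-trans (tens-++ʳ (star g h) (prec b d) (dot b d ++ succ b d)) (++-cong (≋-refl {u = tens (star g h) (prec b d)}) (tens-++ʳ (star g h) (dot b d) (succ b d)))))
    (≋-trans (tens≋extend (star g h) _) (≋-trans (extend-cong-fun (λ w → fmap-cong (λ t → (w , t)) s) (star g h)) ≋-refl))

  opTensSum-leaves : ∀ x0 xs xk y0 ys yk → opTensSum (node x0 xs xk , leaf) (node y0 ys yk , leaf) ≋ starWith star (node x0 xs xk , leaf) (node y0 ys yk , leaf)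
  opTensSum-leaves x0 xs xk y0 ys yk = ≋-trans (≋-sym (≋-trans (tens-++ˡ (prec x y) _ (basis leaf)) (++-cong (≋-refl {u = tens (prec x y) (basis leaf)}) (tens-++ˡ (dot x y) (succ x y) (basis leaf)))))
    (tens≋extend (star x y) (basis leaf))
    where
    x y : Tree
    x = node x0 xs xk
    y = node y0 ys yk

  opC-sum : ∀ z w → opC `≺ z w ++ opC `· z w ++ opC `≻ z w ≋ extend (λ p → extend (opTensSum p) w) z
  opC-sum z w = ≋-sym (≋-trans (extend-cong-fun (λ p → ≋-trans (extend-fun-++ (opTens `≺ p) (λ q → opTens `· p q ++ opTens `≻ p q) w)
                                    (++-cong (≋-refl {u = extend (opTens `≺ p) w}) (extend-fun-++ (opTens `· p) (opTens `≻ p) w))) z)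
                    (≋-trans (extend-fun-++ (λ p → extend (opTens `≺ p) w) (λ p → extend (opTens `· p) w ++ extend (opTens `≻ p) w) z)
                    (++-cong (≋-refl {u = opC `≺ z w}) (extend-fun-++ (λ p → extend (opTens `· p) w) (λ p → extend (opTens `≻ p) w) z))))

  opC-sum-node : ∀ x0 xs xk y0 ys yk → let x = node x0 xs xk ; y = node y0 ys yk in
     opC `≺ (Δ x) (Δ y) ++ opC `· (Δ x) (Δ y) ++ opC `≻ (Δ x) (Δ y) ≋ prodWith star (Δ x) (Δ y)
  opC-sum-node x0 xs xk y0 ys yk = ≋-trans (opC-sum (Δ (node x0 xs xk)) (Δ (node y0 ys yk)))
    (extend-Δ-node-cong x0 xs xk
      (extend-Δ-node-cong y0 ys yk (opTensSum-leaves x0 xs xk y0 ys yk) (λ h r → opTensSum-inner (node x0 xs xk) leaf h (nodeOf r) P.refl ≋-refl))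
      (λ g q → extend-Δ-node-cong y0 ys yk (opTensSum-inner g (nodeOf q) (node y0 ys yk) leaf P.refl (++-identityʳ≋ _)) (λ h r → opTensSum-inner g (nodeOf q) h (nodeOf r) P.refl ≋-refl)))

  tens-basis : ∀ g x → tens (basis g) (basis x) ≋ basis (g , x)
  tens-basis g x = ≋-trans (tens≋extend (basis g) (basis x)) (≋-trans (extend-basis (λ s → fmap (λ t → (s , t)) (basis x)) g) (extend-basis (λ t → basis (g , t)) x))

  tens-congˡ : ∀ {u u'} v → u ≋ u' → tens u v ≋ tens u' v
  tens-congˡ {u} {u'} v p = ≋-trans (tens≋extend u v) (≋-trans (extend-cong _ p) (≋-sym (tens≋extend u' v)))

  Δ-star-leafˡ : ∀ t → extend Δ (star leaf t) ≋ prodWith star (Δ leaf) (Δ t)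
  Δ-star-leafˡ t = ≋-trans (extend-basis Δ t) (≋-sym (≋-trans (prodWith-basisˡ star (leaf , leaf) (Δ t))
     (≋-trans (extend-cong-fun (λ hy → ≋-trans (star⊗-basis leaf (proj₁ hy) (proj₂ hy)) (extend-basis (λ w → basis (w , proj₂ hy)) (proj₁ hy))) (Δ t)) (extend-basis-id (Δ t)))))

  Δ-star-leafʳ : ∀ t → extend Δ (star t leaf) ≋ prodWith star (Δ t) (Δ leaf)
  Δ-star-leafʳ t = ≋-trans (extend-cong Δ (star-leafʳ t)) (≋-trans (extend-basis Δ t) (≋-sym (≋-trans (prodWith-basisʳ star (Δ t) (leaf , leaf))
     (≋-trans (extend-cong-fun (λ gx → ≋-trans (star⊗-cong (proj₁ gx) leaf (star-leafʳ (proj₂ gx)))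
                (≋-trans (star⊗-basis (proj₁ gx) leaf (proj₂ gx)) (≋-trans (fmap-cong (λ w → (w , proj₂ gx)) (star-leafʳ (proj₁ gx))) (extend-basis (λ w → basis (w , proj₂ gx)) (proj₁ gx))))) (Δ t))
     (extend-basis-id (Δ t))))))

  Δ-op-leafˡ : ∀ o t → extend Δ (opTree o leaf t) ≋ opC o (Δ leaf) (Δ t)
  Δ-op-leafˡ `≺ leaf = ≋-sym (opC-basis `≺ (leaf , leaf) (leaf , leaf))
  Δ-op-leafˡ `· leaf = ≋-sym (opC-basis `· (leaf , leaf) (leaf , leaf))
  Δ-op-leafˡ `≻ leaf = ≋-sym (opC-basis `≻ (leaf , leaf) (leaf , leaf))
  Δ-op-leafˡ `≺ (node y0 ys yk) = ≋-sym (≋-trans (extend-basis (λ p → extend (opTens `≺ p) (Δ (node y0 ys yk))) (leaf , leaf))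
     (≋-trans (extend-Δ-node-cong y0 ys yk {F = opTens `≺ (leaf , leaf)} {G = λ _ → []} ≋-refl (λ h r → tens-[]ʳ (star leaf h))) (extend-zero (Δ (node y0 ys yk)))))
  Δ-op-leafˡ `· (node y0 ys yk) = ≋-sym (≋-trans (extend-basis (λ p → extend (opTens `· p) (Δ (node y0 ys yk))) (leaf , leaf))
     (≋-trans (extend-Δ-node-cong y0 ys yk {F = opTens `· (leaf , leaf)} {G = λ _ → []} ≋-refl (λ h r → tens-[]ʳ (star leaf h))) (extend-zero (Δ (node y0 ys yk)))))
  Δ-op-leafˡ `≻ (node y0 ys yk) = ≋-trans (extend-basis Δ (node y0 ys yk)) (≋-sym (≋-trans (extend-basis (λ p → extend (opTens `≻ p) (Δ (node y0 ys yk))) (leaf , leaf))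
     (≋-trans (extend-Δ-node-cong y0 ys yk {F = opTens `≻ (leaf , leaf)} {G = basis} (tens-basis (node y0 ys yk) leaf) (λ h r → tens-basis h (nodeOf r))) (extend-basis-id (Δ (node y0 ys yk))))))

  Δ-op-leafʳ : ∀ o x0 xs xk → extend Δ (opTree o (node x0 xs xk) leaf) ≋ opC o (Δ (node x0 xs xk)) (Δ leaf)
  Δ-op-leafʳ `≺ x0 xs xk = ≋-trans (extend-basis Δ x) (≋-sym (≋-trans (extend-cong-fun (λ p → extend-basis (opTens `≺ p) (leaf , leaf)) (Δ x))
     (≋-trans (extend-Δ-node-cong x0 xs xk {F = λ p → opTens `≺ p (leaf , leaf)} {G = basis} (tens-basis x leaf) (λ g q → ≋-trans (tens-congˡ (basis (nodeOf q)) (star-leafʳ g)) (tens-basis g (nodeOf q)))) (extend-basis-id (Δ x)))))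
    where
    x : Tree
    x = node x0 xs xk
  Δ-op-leafʳ `· x0 xs xk = ≋-sym (≋-trans (extend-cong-fun (λ p → extend-basis (opTens `· p) (leaf , leaf)) (Δ x))
     (≋-trans (extend-Δ-node-cong x0 xs xk {F = λ p → opTens `· p (leaf , leaf)} {G = λ _ → []} ≋-refl (λ g q → tens-[]ʳ (star g leaf))) (extend-zero (Δ x))))
    where
    x : Tree
    x = node x0 xs xk
  Δ-op-leafʳ `≻ x0 xs xk = ≋-sym (≋-trans (extend-cong-fun (λ p → extend-basis (opTens `≻ p) (leaf , leaf)) (Δ x))
     (≋-trans (extend-Δ-node-cong x0 xs xk {F = λ p → opTens `≻ p (leaf , leaf)} {G = λ _ → []} ≋-refl (λ g q → tens-[]ʳ (star g leaf))) (extend-zero (Δ x))))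
    where
    x : Tree
    x = node x0 xs xk

  ΔPreservesProducts : Tree → Tree → Set ℓ
  ΔPreservesProducts s t = (∀ o → extend Δ (opTree o s t) ≋ opC o (Δ s) (Δ t)) × (extend Δ (star s t) ≋ prodWith star (Δ s) (Δ t))

  Δ-products-nodes : ∀ x0 xs xk y0 ys yk →
    extend Δ (star xk (node y0 ys yk)) ≋ prodWith star (Δ xk) (Δ (node y0 ys yk)) →
    extend Δ (star xk y0) ≋ prodWith star (Δ xk) (Δ y0) →
    extend Δ (star (node x0 xs xk) y0) ≋ prodWith star (Δ (node x0 xs xk)) (Δ y0) →
    ΔPreservesProducts (node x0 xs xk) (node y0 ys yk)
  Δ-products-nodes x0 xs xk y0 ys yk ih1 ih2 ih3 = ops , st
    where
    ops : ∀ o → extend Δ (opTree o (node x0 xs xk) (node y0 ys yk)) ≋ opC o (Δ (node x0 xs xk)) (Δ (node y0 ys yk))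
    ops `≺ = PrecCase.Δ-prec x0 xs xk y0 ys yk ih1
    ops `· = DotCase.Δ-dot x0 xs xk y0 ys yk ih2
    ops `≻ = SuccCase.Δ-succ x0 xs xk y0 ys yk ih3
    x y : Tree
    x = node x0 xs xk
    y = node y0 ys yk
    st : extend Δ (star x y) ≋ prodWith star (Δ x) (Δ y)
    st = ≋-trans (≡⇒≋ (extend-++ Δ (prec x y) (dot x y ++ succ x y)))
         (≋-trans (++-cong (ops `≺) (≋-trans (≡⇒≋ (extend-++ Δ (dot x y) (succ x y))) (++-cong (ops `·) (ops `≻))))
         (opC-sum-node x0 xs xk y0 ys yk))

  -- The operation cases for x, y use the star case only for strictly smaller pairs, so both are
  -- proved together by one induction.
  Δ-products : ∀ s t → ΔPreservesProducts s t
  Δ-products leaf t = (λ o → Δ-op-leafˡ o t) , Δ-star-leafˡ t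
  Δ-products (node x0 xs xk) leaf = (λ o → Δ-op-leafʳ o x0 xs xk) , Δ-star-leafʳ (node x0 xs xk)
  Δ-products (node x0 xs xk) (node y0 ys yk) =
    Δ-products-nodes x0 xs xk y0 ys yk (proj₂ (Δ-products xk (node y0 ys yk))) (proj₂ (Δ-products xk y0)) (proj₂ (Δ-products (node x0 xs xk) y0))


module Coassociativity {c ℓ} (R : CommutativeRing c ℓ) where

  open import Data.List using (List; []; _∷_; _++_)
  open import Data.Product using (_×_; _,_; proj₁; proj₂)
  open import Defs
  open DeltaProducts R public
  open TD R

  Δ⊗idC : {X : Set} → Comb (Tree × X) → Comb (Tree × (Tree × X))
  Δ⊗idC z = extend (λ gx → fmap (λ uw → (proj₁ uw , (proj₂ uw , proj₂ gx))) (Δ (proj₁ gx))) z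

  id⊗ΔC : {X Y : Set} → (X → Comb (Tree × Y)) → Comb (Tree × X) → Comb (Tree × (Tree × Y))
  id⊗ΔC κ z = extend (λ gx → fmap (λ hy → (proj₁ gx , hy)) (κ (proj₂ gx))) z

  infixl 7 _⊛₃_
  _⊛₃_ : {X Y : Set} → Comb (Tree × (Tree × X)) → Comb (Tree × (Tree × Y)) → Comb (Tree × (Tree × (X × Y)))
  u ⊛₃ v = prodWith starPair u v

  Δ-star : ∀ s t → extend Δ (star s t) ≋ prodWith star (Δ s) (Δ t)
  Δ-star s t = proj₂ (Δ-products s t)

  module _ {X Y : Set} {{EX : BoolEq X}} {{EY : BoolEq Y}} where
    Δ⊗idC-⊛ : ∀ (u : Comb (Tree × X)) (v : Comb (Tree × Y)) → Δ⊗idC (u ⊛ v) ≋ Δ⊗idC u ⊛₃ Δ⊗idC v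
    Δ⊗idC-⊛ u v = ≋-trans lhs (≋-sym rhs)
      where
      Tm : Tree × X → Tree × Y → Comb (Tree × (Tree × (X × Y)))
      Tm gx hy = fmap (onSnd (λ r → (r , (proj₂ gx , proj₂ hy)))) (prodWith star (Δ (proj₁ gx)) (Δ (proj₁ hy)))
      lhs : Δ⊗idC (u ⊛ v) ≋ extend (λ gx → extend (Tm gx) v) u
      lhs = ≋-trans (extend-extend (λ gx → extend (starPair gx) v) _ u)
            (extend-cong-fun (λ gx → ≋-trans (extend-extend (starPair gx) _ v)
               (extend-cong-fun (λ hy → ≋-trans (extend-fmap _ (λ w → (w , (proj₂ gx , proj₂ hy))) (star (proj₁ gx) (proj₁ hy)))
                   (≋-trans (≋-sym (fmap-extend (λ uw → (proj₁ uw , (proj₂ uw , (proj₂ gx , proj₂ hy)))) Δ (star (proj₁ gx) (proj₁ hy))))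
                   (fmap-cong _ (Δ-star (proj₁ gx) (proj₁ hy))))) v)) u)
      rhs : Δ⊗idC u ⊛₃ Δ⊗idC v ≋ extend (λ gx → extend (Tm gx) v) u
      F : Tree × X → Comb (Tree × (Tree × X))
      F gx = fmap (λ uw → (proj₁ uw , (proj₂ uw , proj₂ gx))) (Δ (proj₁ gx))
      G : Tree × Y → Comb (Tree × (Tree × Y))
      G hy = fmap (λ uw → (proj₁ uw , (proj₂ uw , proj₂ hy))) (Δ (proj₁ hy))
      rhs = ≋-trans (prodWith-extendˡ starPair F u (Δ⊗idC v))
            (extend-cong-fun (λ gx → ≋-trans (prodWith-extendʳ starPair (F gx) G v)
               (extend-cong-fun (λ hy → ≋-trans (prodWith-fmapˡ starPair (λ (w : Tree) → (w , proj₂ gx)) (Δ (proj₁ gx)) (fmap (λ uw → (proj₁ uw , (proj₂ uw , proj₂ hy))) (Δ (proj₁ hy))))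
                  (≋-trans (prodWith-fmapʳ (λ (a : Tree) b → starPair (a , proj₂ gx) b) (λ (w : Tree) → (w , proj₂ hy)) (Δ (proj₁ gx)) (Δ (proj₁ hy)))
                  (≋-sym (fmap-prodWith star (λ r → (r , (proj₂ gx , proj₂ hy))) (Δ (proj₁ gx)) (Δ (proj₁ hy)))))) v)) u)

  module _ {X Y X' Y' : Set} {{EX : BoolEq X}} {{EY : BoolEq Y}} {{EX' : BoolEq X'}} {{EY' : BoolEq Y'}} where
    id⊗ΔC-⊛ : ∀ (κ1 : X → Comb (Tree × X')) (κ2 : Y → Comb (Tree × Y')) u v →
      id⊗ΔC κ1 u ⊛₃ id⊗ΔC κ2 v ≋ id⊗ΔC (λ xy → κ1 (proj₁ xy) ⊛ κ2 (proj₂ xy)) (u ⊛ v)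
    id⊗ΔC-⊛ κ1 κ2 u v = ≋-trans lhs (≋-sym rhs)
      where
      Tm : Tree × X → Tree × Y → Comb (Tree × (Tree × (X' × Y')))
      Tm gx hy = extend (λ hx' → extend (λ hy' → extend (λ w → fmap (λ z → (w , z)) (starPair hx' hy')) (star (proj₁ gx) (proj₁ hy))) (κ2 (proj₂ hy))) (κ1 (proj₂ gx))
      F : Tree × X → Comb (Tree × (Tree × X'))
      F gx = fmap (λ hx → (proj₁ gx , hx)) (κ1 (proj₂ gx))
      G : Tree × Y → Comb (Tree × (Tree × Y'))
      G hy = fmap (λ hy' → (proj₁ hy , hy')) (κ2 (proj₂ hy))
      lhs : id⊗ΔC κ1 u ⊛₃ id⊗ΔC κ2 v ≋ extend (λ gx → extend (Tm gx) v) u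
      lhs = ≋-trans (prodWith-extendˡ starPair F u (id⊗ΔC κ2 v))
            (extend-cong-fun (λ gx → ≋-trans (prodWith-extendʳ starPair (F gx) G v)
              (extend-cong-fun (λ hy → ≋-trans (extend-fmap (λ p → extend (starWith starPair p) (G hy)) (λ hx' → (proj₁ gx , hx')) (κ1 (proj₂ gx)))
                  (extend-cong-fun (λ hx' → extend-fmap (starWith starPair (proj₁ gx , hx')) (λ hy' → (proj₁ hy , hy')) (κ2 (proj₂ hy))) (κ1 (proj₂ gx)))) v)) u)
      rhs : id⊗ΔC (λ xy → κ1 (proj₁ xy) ⊛ κ2 (proj₂ xy)) (u ⊛ v) ≋ extend (λ gx → extend (Tm gx) v) u
      rhs = ≋-trans (extend-extend (λ gx → extend (starPair gx) v) _ u)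
            (extend-cong-fun (λ gx → ≋-trans (extend-extend (starPair gx) _ v)
              (extend-cong-fun (λ hy → ≋-trans (extend-fmap _ (λ w → (w , (proj₂ gx , proj₂ hy))) (star (proj₁ gx) (proj₁ hy)))
                 (≋-trans (extend-cong-fun (λ w → ≋-trans (fmap-extend (λ z → (w , z)) _ (κ1 (proj₂ gx))) (extend-cong-fun (λ hx' → fmap-extend (λ z → (w , z)) _ (κ2 (proj₂ hy))) (κ1 (proj₂ gx)))) (star (proj₁ gx) (proj₁ hy)))
                 (≋-trans (fubini _ (star (proj₁ gx) (proj₁ hy)) (κ1 (proj₂ gx)))
                 (extend-cong-fun (λ hx' → fubini _ (star (proj₁ gx) (proj₁ hy)) (κ2 (proj₂ hy))) (κ1 (proj₂ gx)))))) v)) u)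

  module _ {X X' : Set} {{EX : BoolEq X}} {{EX' : BoolEq X'}} where
    Δ⊗idC-fmap : ∀ (f : X → X') z → Δ⊗idC (fmap (onSnd f) z) ≋ fmap (onSnd (onSnd f)) (Δ⊗idC z)
    Δ⊗idC-fmap f z = ≋-trans (extend-fmap _ (onSnd f) z) (≋-sym (≋-trans (fmap-extend (onSnd (onSnd f)) _ z)
       (extend-cong-fun (λ gx → fmap-fmap (onSnd (onSnd f)) (λ uw → (proj₁ uw , (proj₂ uw , proj₂ gx))) (Δ (proj₁ gx))) z)))

  module _ {X Y Y' : Set} {{EX : BoolEq X}} {{EY : BoolEq Y}} {{EY' : BoolEq Y'}} where
    id⊗ΔC-fmap : ∀ (g : Y → Y') (κ : X → Comb (Tree × Y)) z → id⊗ΔC (λ x → fmap (onSnd g) (κ x)) z ≋ fmap (onSnd (onSnd g)) (id⊗ΔC κ z)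
    id⊗ΔC-fmap g κ z = ≋-trans (extend-cong-fun (λ gx → fmap-fmap (λ hy → (proj₁ gx , hy)) (onSnd g) (κ (proj₂ gx))) z)
       (≋-sym (≋-trans (fmap-extend (onSnd (onSnd g)) _ z) (extend-cong-fun (λ gx → fmap-fmap (onSnd (onSnd g)) (λ hy → (proj₁ gx , hy)) (κ (proj₂ gx))) z)))

  module _ {X Y : Set} {{EX : BoolEq X}} {{EY : BoolEq Y}} where
    id⊗ΔC-fun-++ : ∀ (κ1 κ2 : X → Comb (Tree × Y)) z → id⊗ΔC (λ x → κ1 x ++ κ2 x) z ≋ id⊗ΔC κ1 z ++ id⊗ΔC κ2 z
    id⊗ΔC-fun-++ κ1 κ2 z = ≋-trans (extend-cong-fun (λ gx → ≡⇒≋ (extend-++ (λ hy → basis (proj₁ gx , hy)) (κ1 (proj₂ gx)) (κ2 (proj₂ gx)))) z)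
       (extend-fun-++ (λ gx → fmap (λ hy → (proj₁ gx , hy)) (κ1 (proj₂ gx))) (λ gx → fmap (λ hy → (proj₁ gx , hy)) (κ2 (proj₂ gx))) z)
    id⊗ΔC-cong : ∀ {κ κ' : X → Comb (Tree × Y)} {z z'} → (∀ x → κ x ≋ κ' x) → z ≋ z' → id⊗ΔC κ z ≋ id⊗ΔC κ' z'
    id⊗ΔC-cong p q = extend-cong₂ (λ gx → fmap-cong (λ hy → (proj₁ gx , hy)) (p (proj₂ gx))) q

  coassoc-tree : ∀ t → Δ⊗idC (Δ t) ≋ id⊗ΔC Δ (Δ t)
  coassoc-trees : ∀ ms → Δ⊗idC (ΔList ms) ≋ id⊗ΔC ΔList (ΔList ms)
  coassoc-children : ∀ a ms b → Δ⊗idC (ΔChildren a ms b) ≋ id⊗ΔC (λ q → ΔChildren (proj₁ (proj₁ q)) (proj₂ (proj₁ q)) (proj₂ q)) (ΔChildren a ms b)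
  coassoc-tree leaf = ≋-refl
  coassoc-tree (node a ms b) = ≋-trans lhs (≋-sym rhs)
    where
    t : Tree
    t = node a ms b
    fL : Tree × Tree → Comb (Tree × (Tree × Tree))
    fL gx = fmap (λ uw → (proj₁ uw , (proj₂ uw , proj₂ gx))) (Δ (proj₁ gx))
    fR : Tree × Tree → Comb (Tree × (Tree × Tree))
    fR gx = fmap (λ hy → (proj₁ gx , hy)) (Δ (proj₂ gx))
    κΞ : (Tree × List Tree) × Tree → Comb (Tree × ((Tree × List Tree) × Tree))
    κΞ q = ΔChildren (proj₁ (proj₁ q)) (proj₂ (proj₁ q)) (proj₂ q)
    h0 : Tree × Tree → Tree × (Tree × Tree)
    h0 uw = (proj₁ uw , (proj₂ uw , leaf))
    X1 X2 X3 : Comb (Tree × (Tree × Tree))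
    X1 = fmap h0 (basis (t , leaf))
    X2 = fmap h0 (ΔCuts a ms b)
    X3 = fmap (onSnd (onSnd nodeOf)) (Δ⊗idC (ΔChildren a ms b))
    lhs : Δ⊗idC (Δ t) ≋ X1 ++ (X2 ++ X3)
    lhs = ≋-trans (extend-cong fL (Δ-node a ms b))
      (≋-trans (≡⇒≋ (extend-++ fL (basis (t , leaf)) (ΔCuts a ms b)))
      (≋-trans (++-cong (≋-trans (extend-basis fL (t , leaf)) (≋-trans (fmap-cong h0 (Δ-node a ms b)) (≡⇒≋ (extend-++ (λ u → basis (h0 u)) (basis (t , leaf)) (ΔCuts a ms b)))))
                        (Δ⊗idC-fmap nodeOf (ΔChildren a ms b)))
      (++-assoc≋ X1 X2 X3)))
    rhs : id⊗ΔC Δ (Δ t) ≋ X1 ++ (X2 ++ X3)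
    rhs = ≋-trans (extend-cong fR (Δ-node a ms b))
      (≋-trans (≡⇒≋ (extend-++ fR (basis (t , leaf)) (ΔCuts a ms b)))
      (++-cong (≋-trans (extend-basis fR (t , leaf)) (≋-trans (extend-basis (λ hy → basis (t , hy)) (leaf , leaf)) (≋-sym (extend-basis (λ u → basis (h0 u)) (t , leaf)))))
        (≋-trans (extend-fmap fR (onSnd nodeOf) (ΔChildren a ms b))
        (≋-trans (id⊗ΔC-cong {κ' = λ q → basis (nodeOf q , leaf) ++ fmap (onSnd nodeOf) (κΞ q)}
                    (λ q → Δ-node (proj₁ (proj₁ q)) (proj₂ (proj₁ q)) (proj₂ q)) (≋-refl {u = ΔChildren a ms b}))
        (≋-trans (id⊗ΔC-fun-++ (λ q → basis (nodeOf q , leaf)) (λ q → fmap (onSnd nodeOf) (κΞ q)) (ΔChildren a ms b))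
        (++-cong (≋-trans (extend-cong-fun (λ gq → extend-basis (λ hy → basis (proj₁ gq , hy)) (nodeOf (proj₂ gq) , leaf)) (ΔChildren a ms b)) (≋-sym (fmap-fmap h0 (onSnd nodeOf) (ΔChildren a ms b))))
                 (≋-trans (id⊗ΔC-fmap nodeOf κΞ (ΔChildren a ms b)) (fmap-cong (onSnd (onSnd nodeOf)) (≋-sym (coassoc-children a ms b))))))))))

  coassoc-trees [] = ≋-refl
  coassoc-trees (m ∷ ms) =
    ≋-trans (Δ⊗idC-fmap consPair (Δ m ⊛ ΔList ms))
    (≋-trans (fmap-cong (onSnd (onSnd consPair)) (≋-trans (Δ⊗idC-⊛ (Δ m) (ΔList ms)) (≋-trans (prodWith-cong₂ starPair (coassoc-tree m) (coassoc-trees ms)) (id⊗ΔC-⊛ Δ ΔList (Δ m) (ΔList ms)))))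
    (≋-sym (≋-trans (extend-fmap _ (onSnd consPair) (Δ m ⊛ ΔList ms)) (id⊗ΔC-fmap consPair (λ xy → Δ (proj₁ xy) ⊛ ΔList (proj₂ xy)) (Δ m ⊛ ΔList ms)))))
  coassoc-children a ms b =
    ≋-trans (Δ⊗idC-⊛ (Δ a ⊛ ΔList ms) (Δ b))
    (≋-trans (prodWith-cong₂ starPair (≋-trans (Δ⊗idC-⊛ (Δ a) (ΔList ms)) (≋-trans (prodWith-cong₂ starPair (coassoc-tree a) (coassoc-trees ms)) (id⊗ΔC-⊛ Δ ΔList (Δ a) (ΔList ms)))) (coassoc-tree b))
    (id⊗ΔC-⊛ (λ xy → Δ (proj₁ xy) ⊛ ΔList (proj₂ xy)) Δ (Δ a ⊛ ΔList ms) (Δ b)))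


module BialgebraLaws {c ℓ} (R : CommutativeRing c ℓ) where

  open import Data.Product using (_,_; proj₁; proj₂)
  open import Relation.Binary.PropositionalEquality as P using (_≡_)
  open import Defs
  open Coassociativity R public
  open CommutativeRing R using (refl)
  open TD R

  ΔV≡extend : ∀ x → ΔV x ≡ extend Δ x
  ΔV≡extend x = lin2≡extend Δ x

  starV-assoc : ∀ x y z → starV (starV x y) z ≈V starV x (starV y z)
  starV-assoc x y z = ≋⇒≈V (≋-trans (starV≋starC (starV x y) z) (≋-trans (starC-cong (starV≋starC x y) (≋-refl {u = z}))
     (≋-trans (starC-assoc x y z) (≋-sym (≋-trans (starV≋starC x (starV y z)) (starC-cong (≋-refl {u = x}) (starV≋starC y z)))))))

  starV-identityˡ : ∀ x → starV (single leaf) x ≈V x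
  starV-identityˡ x = ≋⇒≈V (≋-trans (starV≋starC (basis leaf) x) (starC-identityˡ x))

  starV-identityʳ : ∀ x → starV x (single leaf) ≈V x
  starV-identityʳ x = ≋⇒≈V (≋-trans (starV≋starC x (basis leaf)) (starC-identityʳ x))

  ΔV-unit : ΔV (single leaf) ≈2 single2 leaf leaf
  ΔV-unit = ≋⇒≈2 (≋-trans (≡⇒≋ (ΔV≡extend (basis leaf))) (extend-basis Δ leaf))

  ΔV-star : ∀ x y → ΔV (starV x y) ≈2 starT (ΔV x) (ΔV y)
  ΔV-star x y = ≋⇒≈2 (≋-trans lhs (≋-sym rhs))
    where
    T : V2
    T = extend (λ s → extend (λ t → prodWith star (Δ s) (Δ t)) y) x
    lhs : ΔV (starV x y) ≋ T
    lhs = ≋-trans (≡⇒≋ (ΔV≡extend (starV x y))) (≋-trans (extend-cong Δ (starV≋starC x y))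
          (≋-trans (extend-extend (λ s → extend (star s) y) Δ x) (extend-cong-fun (λ s → ≋-trans (extend-extend (star s) Δ y) (extend-cong-fun (λ t → Δ-star s t) y)) x)))
    rhs : starT (ΔV x) (ΔV y) ≋ T
    rhs = ≋-trans (starT≋prodWith (ΔV x) (ΔV y)) (≋-trans (≡⇒≋ (P.cong₂ (prodWith star) (ΔV≡extend x) (ΔV≡extend y)))
          (≋-trans (prodWith-extendˡ star Δ x (extend Δ y)) (extend-cong-fun (λ s → prodWith-extendʳ star (Δ s) Δ y) x)))

  Δ-preservesTri : PreservesTri Δ
  Δ-preservesTri o x y _ _ = ≋⇒≈2 (≋-trans lhs (≋-sym rhs))
    where
    T : V2
    T = extend (λ s → extend (λ t → opC o (Δ s) (Δ t)) y) x
    lhs : lin2 Δ (opV o x y) ≋ T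
    lhs = ≋-trans (≡⇒≋ (lin2≡extend Δ (opV o x y))) (≋-trans (extend-cong Δ (bilin≋extend (opTree o) x y))
          (≋-trans (extend-extend (λ s → extend (opTree o s) y) Δ x) (extend-cong-fun (λ s → ≋-trans (extend-extend (opTree o s) Δ y) (extend-cong-fun (λ t → proj₁ (Δ-products s t) o) y)) x)))
    rhs : opT o (lin2 Δ x) (lin2 Δ y) ≋ T
    rhs = ≋-trans (opT≋opC o (lin2 Δ x) (lin2 Δ y)) (≋-trans (≡⇒≋ (P.cong₂ (opC o) (lin2≡extend Δ x) (lin2≡extend Δ y)))
          (≋-trans (opC-extendˡ o Δ x (extend Δ y)) (extend-cong-fun (λ s → opC-extendʳ o (Δ s) Δ y) x)))

  Δ⊗id≋Δ⊗idC : ∀ z → Δ⊗id z ≋ Δ⊗idC z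
  Δ⊗id≋Δ⊗idC z = concatMap≋extend _ _ (λ a st → map≋smul-fmap _ a (λ uw → (proj₁ uw , (proj₂ uw , proj₂ st))) (λ d uw → P.refl) (λ d uw → refl) (Δ (proj₁ st))) z

  id⊗Δ≋id⊗ΔC : ∀ z → id⊗Δ z ≋ id⊗ΔC Δ z
  id⊗Δ≋id⊗ΔC z = concatMap≋extend _ _ (λ a st → map≋smul-fmap _ a (λ uw → (proj₁ st , uw)) (λ d uw → P.refl) (λ d uw → refl) (Δ (proj₂ st))) z

  ΔV-coassoc : ∀ x → Δ⊗id (ΔV x) ≈3 id⊗Δ (ΔV x)
  ΔV-coassoc x = ≋⇒≈3 (≋-trans (Δ⊗id≋Δ⊗idC (ΔV x)) (≋-trans (≡⇒≋ (P.cong Δ⊗idC (ΔV≡extend x)))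
    (≋-trans (extend-extend Δ _ x) (≋-trans (extend-cong-fun coassoc-tree x) (≋-trans (≋-sym (extend-extend Δ _ x)) (≋-trans (≡⇒≋ (P.cong (id⊗ΔC Δ) (P.sym (ΔV≡extend x)))) (≋-sym (id⊗Δ≋id⊗ΔC (ΔV x)))))))))


module Counit {c ℓ} (R : CommutativeRing c ℓ) where

  open import Data.List using ([]; _∷_; _++_; map)
  open import Data.Product using (_×_; _,_; proj₁; proj₂)
  open import Data.Bool using (true; false)
  open import Data.Unit using (⊤; tt)
  open import Relation.Binary.PropositionalEquality as P using (_≡_)
  open import Defs
  open BialgebraLaws R public
  open CommutativeRing R renaming (Carrier to K)
  open TD R

  instance
    eqb⊤ : BoolEq ⊤
    eqb⊤ = record { eqb = λ _ _ → true ; sound = λ _ → P.refl ; reflb = λ _ → P.refl }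

  εT : Tree → K
  εT s = coef (basis s) leaf

  εT-leaf : εT leaf ≈ 1#
  εT-leaf = +-identityʳ 1#

  εTˡ : {X : Set} → Tree × X → Comb X
  εTˡ gx = smul (εT (proj₁ gx)) (basis (proj₂ gx))

  ε⊗idC : {X : Set} → Comb (Tree × X) → Comb X
  ε⊗idC z = extend εTˡ z

  module _ {X : Set} {{EX : BoolEq X}} where
    extend-εT : ∀ (z : X) V → extend (λ w → smul (εT w) (basis z)) V ≋ smul (coef V leaf) (basis z)
    extend-εT z [] = ≋-sym (smul-0 (basis z))
    extend-εT z ((a , w) ∷ V) with eqT w leaf
    ... | true = ≋-trans (++-cong (≋-trans (smul-smul a _ (basis z)) (smul-cong (*-congˡ (+-identityʳ 1#)) ≋-refl)) (extend-εT z V))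
                   (≋-trans (≋-sym (smul-+ (a * 1#) (coef V leaf) (basis z))) (smul-cong (+-congʳ (*-identityʳ a)) ≋-refl))
    ... | false = ≋-trans (++-cong (≋-trans (smul-smul a 0# (basis z)) (≋-trans (smul-cong (zeroʳ a) ≋-refl) (smul-0 (basis z)))) (extend-εT z V)) ≋-refl

  coef-fmap-nonleaf : ∀ (h : Tree → Tree) V → (∀ w → eqT (h w) leaf ≡ false) → coef (fmap h V) leaf ≈ 0#
  coef-fmap-nonleaf h [] p = refl
  coef-fmap-nonleaf h ((a , w) ∷ V) p rewrite p w = coef-fmap-nonleaf h V p

  coef-star-leaf : ∀ g h → coef (star g h) leaf ≈ εT g * εT h
  coef-star-leaf leaf h = sym (trans (*-congʳ εT-leaf) (*-identityˡ (εT h)))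
  coef-star-leaf (node a ms b) leaf = sym (zeroˡ (εT leaf))
  coef-star-leaf (node a ms b) (node c ns d) =
    trans (at (star-node-node a ms b c ns d) leaf)
    (trans (coef-++ (fmap (node a ms) W1) (fmap (withMiddle a ms ns d) W2 ++ fmap (withFirst ns d) W3) leaf)
    (trans (+-cong (coef-fmap-nonleaf (node a ms) W1 (λ w → P.refl))
       (trans (coef-++ (fmap (withMiddle a ms ns d) W2) (fmap (withFirst ns d) W3) leaf) (+-cong (coef-fmap-nonleaf (withMiddle a ms ns d) W2 (λ w → P.refl)) (coef-fmap-nonleaf (withFirst ns d) W3 (λ w → P.refl)))))
    (trans (+-identityˡ _) (trans (+-identityˡ 0#) (sym (zeroˡ 0#))))))
    where
    W1 W2 W3 : V
    W1 = star b (node c ns d)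
    W2 = star b c
    W3 = star (node a ms b) c

  tensC : {X Y : Set} → Comb X → Comb Y → Comb (X × Y)
  tensC u v = extend (λ x → fmap (λ y → (x , y)) v) u

  module _ {X Y : Set} {{EX : BoolEq X}} {{EY : BoolEq Y}} where
    tensC-smul : ∀ a b (x : X) (y : Y) → tensC (smul a (basis x)) (smul b (basis y)) ≋ smul (a * b) (basis (x , y))
    tensC-smul a b x y = ∷-cong (x , y) (trans (*-cong (*-identityʳ a) (trans (*-identityʳ _) (*-identityʳ b))) (sym (*-identityʳ (a * b)))) ≋-refl

    tensC-basis : ∀ (x : X) (y : Y) → tensC (basis x) (basis y) ≋ basis (x , y)
    tensC-basis x y = ≋-trans (extend-basis (λ x' → fmap (λ y' → (x' , y')) (basis y)) x) (extend-basis (λ y' → basis (x , y')) y)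

    tensC-cong : ∀ {u u' : Comb X} {v v' : Comb Y} → u ≋ u' → v ≋ v' → tensC u v ≋ tensC u' v'
    tensC-cong p q = extend-cong₂ (λ x → fmap-cong (λ y → (x , y)) q) p

    ε⊗idC-⊛ : ∀ (u : Comb (Tree × X)) (v : Comb (Tree × Y)) → ε⊗idC (u ⊛ v) ≋ tensC (ε⊗idC u) (ε⊗idC v)
    ε⊗idC-⊛ u v = ≋-trans lhs (≋-sym rhs)
      where
      ε' : {Z : Set} → Tree × Z → Comb Z
      ε' gx = smul (εT (proj₁ gx)) (basis (proj₂ gx))
      T : Comb (X × Y)
      T = extend (λ gx → extend (λ hy → smul (εT (proj₁ gx) * εT (proj₁ hy)) (basis (proj₂ gx , proj₂ hy))) v) u
      lhs : ε⊗idC (u ⊛ v) ≋ T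
      lhs = ≋-trans (extend-extend (λ gx → extend (starPair gx) v) ε' u) (extend-cong-fun (λ gx → ≋-trans (extend-extend (starPair gx) ε' v)
            (extend-cong-fun (λ hy → ≋-trans (extend-fmap ε' (λ w → (w , (proj₂ gx , proj₂ hy))) (star (proj₁ gx) (proj₁ hy)))
               (≋-trans (extend-εT (proj₂ gx , proj₂ hy) (star (proj₁ gx) (proj₁ hy))) (smul-cong (coef-star-leaf (proj₁ gx) (proj₁ hy)) ≋-refl))) v)) u)
      rhs : tensC (ε⊗idC u) (ε⊗idC v) ≋ T
      rhs = ≋-trans (extend-extend ε' (λ x → fmap (λ y → (x , y)) (ε⊗idC v)) u)
            (extend-cong-fun (λ gx → ≋-trans (extend-smul (λ x → fmap (λ y → (x , y)) (ε⊗idC v)) (εT (proj₁ gx)) (basis (proj₂ gx)))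
               (≋-trans (smul-cong refl (≋-trans (extend-basis (λ x → fmap (λ y → (x , y)) (ε⊗idC v)) (proj₂ gx)) (extend-extend ε' (λ y → basis (proj₂ gx , y)) v)))
               (≋-trans (≋-sym (extend-fun-smul (λ hy → fmap (λ y → (proj₂ gx , y)) (ε' hy)) (εT (proj₁ gx)) v))
               (extend-cong-fun (λ hy → ≋-trans (smul-cong refl (≋-trans (extend-smul (λ y → basis (proj₂ gx , y)) (εT (proj₁ hy)) (basis (proj₂ hy))) (smul-cong refl (extend-basis (λ y → basis (proj₂ gx , y)) (proj₂ hy)))))
                                  (smul-smul (εT (proj₁ gx)) (εT (proj₁ hy)) (basis (proj₂ gx , proj₂ hy)))) v)))) u)

  module _ {X X' : Set} {{EX : BoolEq X}} {{EX' : BoolEq X'}} where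
    ε⊗idC-fmap : ∀ (f : X → X') z → ε⊗idC (fmap (onSnd f) z) ≋ fmap f (ε⊗idC z)
    ε⊗idC-fmap f z = ≋-trans (extend-fmap _ (onSnd f) z) (≋-sym (≋-trans (fmap-extend f _ z)
       (extend-cong-fun (λ gx → ≋-trans (extend-smul (λ u → basis (f u)) (εT (proj₁ gx)) (basis (proj₂ gx))) (smul-cong refl (extend-basis (λ u → basis (f u)) (proj₂ gx)))) z)))

  ε⊗idC-Δ : ∀ t → ε⊗idC (Δ t) ≋ basis t
  ε⊗idC-ΔList : ∀ ms → ε⊗idC (ΔList ms) ≋ basis ms
  ε⊗idC-Δ leaf = ≋-trans (++-identityʳ≋ _) (≋-trans (smul-1 _) (≋-trans (smul-cong εT-leaf ≋-refl) (smul-1 _)))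
  ε⊗idC-Δ (node a ms b) = ≋-trans (extend-cong εTˡ (Δ-node a ms b)) (≋-trans (≡⇒≋ (extend-++ εTˡ (basis (node a ms b , leaf)) (ΔCuts a ms b)))
    (≋-trans (++-cong (≋-trans (++-identityʳ≋ _) (≋-trans (smul-1 _) (smul-0 _)))
       (≋-trans (ε⊗idC-fmap nodeOf (ΔChildren a ms b)) (≋-trans (fmap-cong nodeOf (≋-trans (ε⊗idC-⊛ (Δ a ⊛ ΔList ms) (Δ b))
          (≋-trans (tensC-cong (≋-trans (ε⊗idC-⊛ (Δ a) (ΔList ms)) (≋-trans (tensC-cong (ε⊗idC-Δ a) (ε⊗idC-ΔList ms)) (tensC-basis a ms))) (ε⊗idC-Δ b)) (tensC-basis (a , ms) b))))
          (extend-basis (λ u → basis (nodeOf u)) ((a , ms) , b))))) ≋-refl))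
  ε⊗idC-ΔList [] = ≋-trans (++-identityʳ≋ _) (≋-trans (smul-1 _) (≋-trans (smul-cong εT-leaf ≋-refl) (smul-1 _)))
  ε⊗idC-ΔList (m ∷ ms) = ≋-trans (ε⊗idC-fmap consPair (Δ m ⊛ ΔList ms)) (≋-trans (fmap-cong consPair (≋-trans (ε⊗idC-⊛ (Δ m) (ΔList ms)) (≋-trans (tensC-cong (ε⊗idC-Δ m) (ε⊗idC-ΔList ms)) (tensC-basis m ms))))
     (extend-basis (λ u → basis (consPair u)) (m , ms)))

  εTʳ : Tree × Tree → V
  εTʳ p = smul (εT (proj₂ p)) (basis (proj₁ p))

  id⊗εC : V2 → V
  id⊗εC z = extend εTʳ z

  id⊗εC-Δ : ∀ t → id⊗εC (Δ t) ≋ basis t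
  id⊗εC-Δ leaf = ≋-trans (++-identityʳ≋ _) (≋-trans (smul-1 _) (≋-trans (smul-cong εT-leaf ≋-refl) (smul-1 _)))
  id⊗εC-Δ (node a ms b) = ≋-trans (extend-cong εTʳ (Δ-node a ms b)) (≋-trans (≡⇒≋ (extend-++ εTʳ (basis (node a ms b , leaf)) (ΔCuts a ms b)))
    (≋-trans (++-cong (≋-trans (++-identityʳ≋ _) (≋-trans (smul-1 _) (≋-trans (smul-cong εT-leaf ≋-refl) (smul-1 _))))
       (≋-trans (extend-fmap εTʳ (onSnd nodeOf) (ΔChildren a ms b)) (≋-trans (extend-cong-fun (λ gq → smul-0 (basis (proj₁ gq))) (ΔChildren a ms b)) (extend-zero (ΔChildren a ms b)))))
    (++-identityʳ≋ _)))

  ε-single : ∀ s → ε (single s) ≡ εT s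
  ε-single s = coeff≡coef (single s) leaf

  ε⊗id≋ε⊗idC : ∀ (f : K × Tree × Tree → K × Tree) → (∀ a s t → f (a , s , t) ≡ (a * ε (single s) , t)) → ∀ z → map f z ≋ ε⊗idC z
  ε⊗id≋ε⊗idC f h [] = ≋-refl
  ε⊗id≋ε⊗idC f h ((a , s , t) ∷ z) = ≋-trans (≡⇒≋ (P.cong (_∷ map f z) (h a s t)))
    (∷-cong t (*-congˡ (trans (reflexive (ε-single s)) (sym (*-identityʳ _)))) (ε⊗id≋ε⊗idC f h z))

  id⊗ε≋id⊗εC : ∀ (f : K × Tree × Tree → K × Tree) → (∀ a s t → f (a , s , t) ≡ (a * ε (single t) , s)) → ∀ z → map f z ≋ id⊗εC z
  id⊗ε≋id⊗εC f h [] = ≋-refl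
  id⊗ε≋id⊗εC f h ((a , s , t) ∷ z) = ≋-trans (≡⇒≋ (P.cong (_∷ map f z) (h a s t)))
    (∷-cong s (*-congˡ (trans (reflexive (ε-single t)) (sym (*-identityʳ _)))) (id⊗ε≋id⊗εC f h z))

  ΔV-counitˡ : ∀ x → ε⊗id (ΔV x) ≈V x
  ΔV-counitˡ x = ≋⇒≈V (≋-trans (ε⊗id≋ε⊗idC _ (λ a s t → P.refl) (ΔV x)) (≋-trans (≡⇒≋ (P.cong ε⊗idC (ΔV≡extend x)))
     (≋-trans (extend-extend Δ εTˡ x) (≋-trans (extend-cong-fun ε⊗idC-Δ x) (extend-basis-id x)))))

  ΔV-counitʳ : ∀ x → id⊗ε (ΔV x) ≈V x
  ΔV-counitʳ x = ≋⇒≈V (≋-trans (id⊗ε≋id⊗εC _ (λ a s t → P.refl) (ΔV x)) (≋-trans (≡⇒≋ (P.cong id⊗εC (ΔV≡extend x)))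
     (≋-trans (extend-extend Δ εTʳ x) (≋-trans (extend-cong-fun id⊗εC-Δ x) (extend-basis-id x)))))

  ε-unit-leaf : ε (single leaf) ≈ 1#
  ε-unit-leaf = +-identityʳ 1#

  coef-smul-basis : ∀ {X : Set} {{_ : BoolEq X}} k (b : X) → coef (smul k (basis b)) b ≈ k
  coef-smul-basis k b = trans (coef-smul k (basis b) b) (trans (*-congˡ (coef-basis 1# b)) (*-identityʳ k))

  ε-starV : ∀ x y → ε (starV x y) ≈ ε x * ε y
  ε-starV x y = trans (reflexive (coeff≡coef (starV x y) leaf)) (trans (at (starV≋starC x y) leaf)
    (trans (sym (coef-smul-basis (coef (starC x y) leaf) (tt , tt)))
    (trans (at key (tt , tt))
    (trans (coef-smul-basis (coef x leaf * coef y leaf) (tt , tt))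
    (sym (*-cong (reflexive (coeff≡coef x leaf)) (reflexive (coeff≡coef y leaf))))))))
    where
    ux uy : Comb (Tree × ⊤)
    ux = fmap (λ s → (s , tt)) x
    uy = fmap (λ s → (s , tt)) y
    eu : ∀ z → ε⊗idC (fmap (λ s → (s , tt)) z) ≋ smul (coef z leaf) (basis tt)
    eu z = ≋-trans (extend-fmap εTˡ (λ s → (s , tt)) z) (extend-εT tt z)
    key : smul (coef (starC x y) leaf) (basis (tt , tt)) ≋ smul (coef x leaf * coef y leaf) (basis (tt , tt))
    key = ≋-trans (≋-sym (extend-εT (tt , tt) (starC x y)))
          (≋-trans (≋-sym (extend-fmap εTˡ (λ w → (w , (tt , tt))) (starC x y)))
          (≋-trans (extend-cong εTˡ (≋-sym (⊛-tagged x y tt tt)))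
          (≋-trans (ε⊗idC-⊛ ux uy) (≋-trans (tensC-cong (eu x) (eu y)) (tensC-smul (coef x leaf) (coef y leaf) tt tt)))))


module Grading {c ℓ} (R : CommutativeRing c ℓ) where

  open import Data.Nat as ℕ using (ℕ; suc) renaming (_+_ to _+ℕ_)
  open import Data.Nat.Properties as NP using ()
  open import Data.List using (List; []; _∷_; _++_)
  open import Data.List.Relation.Unary.All using (All; []; _∷_)
  open import Data.Product using (_×_; _,_; proj₁; proj₂)
  open import Data.Bool using (true; false)
  open import Relation.Nullary using (¬_; yes; no)
  open import Relation.Unary using (Decidable)
  open import Data.Empty using (⊥-elim)
  open import Relation.Binary.PropositionalEquality as P using (_≡_)
  open import Defs
  open TreeSize
  open Counit R public
  open CommutativeRing R
  open TD R

  module _ {A : Set} {{EA : BoolEq A}} where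
    Supported : (A → Set) → Comb A → Set ℓ
    Supported Pr x = ∀ b → ¬ Pr b → coef x b ≈ 0#

    Supported-≋ : ∀ {Pr x y} → x ≋ y → Supported Pr x → Supported Pr y
    Supported-≋ p h b nb = trans (sym (at p b)) (h b nb)

    Supported-mono : ∀ {Pr Pr' : A → Set} {x} → (∀ b → Pr b → Pr' b) → Supported Pr x → Supported Pr' x
    Supported-mono f h b nb = h b (λ pb → nb (f b pb))

    Supported-++ : ∀ {Pr x y} → Supported Pr x → Supported Pr y → Supported Pr (x ++ y)
    Supported-++ {Pr} {x} {y} hx hy b nb = trans (coef-++ x y b) (trans (+-cong (hx b nb) (hy b nb)) (+-identityʳ 0#))

    Supported-smul : ∀ {Pr x} k → Supported Pr x → Supported Pr (smul k x)
    Supported-smul {Pr} {x} k h b nb = trans (coef-smul k x b) (trans (*-congˡ (h b nb)) (zeroʳ k))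

    Supported-basis : ∀ {Pr : A → Set} s → Pr s → Supported Pr (basis s)
    Supported-basis {Pr} s ps b nb with eqb s b in e
    ... | true = ⊥-elim (nb (P.subst Pr (eqb⇒≡ s b e) ps))
    ... | false = refl

    AllSupported : (A → Set) → Comb A → Set c
    AllSupported Pr v = All (λ q → Pr (proj₂ q)) v

    restrict : ∀ {Pr : A → Set} → Decidable Pr → Comb A → Comb A
    restrict d [] = []
    restrict d ((a , s) ∷ v) with d s
    ... | yes _ = (a , s) ∷ restrict d v
    ... | no _ = restrict d v

    restrict-All : ∀ {Pr : A → Set} (d : Decidable Pr) v → AllSupported Pr (restrict d v)
    restrict-All d [] = []
    restrict-All d ((a , s) ∷ v) with d s
    ... | yes p = p ∷ restrict-All d v
    ... | no _ = restrict-All d v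

    coef-restrict-in : ∀ {Pr : A → Set} (d : Decidable Pr) v b → Pr b → coef (restrict d v) b ≈ coef v b
    coef-restrict-in d [] b pb = refl
    coef-restrict-in {Pr} d ((a , s) ∷ v) b pb with d s
    ... | yes _ with eqb s b
    ... | true = +-congˡ (coef-restrict-in d v b pb)
    ... | false = coef-restrict-in d v b pb
    coef-restrict-in {Pr} d ((a , s) ∷ v) b pb | no ns with eqb s b in e
    ... | true = ⊥-elim (ns (P.subst Pr (P.sym (eqb⇒≡ s b e)) pb))
    ... | false = coef-restrict-in d v b pb

    coef-restrict-out : ∀ {Pr : A → Set} (d : Decidable Pr) v b → ¬ Pr b → coef (restrict d v) b ≈ 0#
    coef-restrict-out d [] b nb = refl
    coef-restrict-out {Pr} d ((a , s) ∷ v) b nb with d s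
    ... | no _ = coef-restrict-out d v b nb
    ... | yes ps with eqb s b in e
    ... | true = ⊥-elim (nb (P.subst Pr (eqb⇒≡ s b e) ps))
    ... | false = coef-restrict-out d v b nb

    restrict-≋ : ∀ {Pr : A → Set} (d : Decidable Pr) v → Supported Pr v → v ≋ restrict d v
    restrict-≋ {Pr} d v h = mk≋ λ b → lem b
      where
      lem : ∀ b → coef v b ≈ coef (restrict d v) b
      lem b with d b
      ... | yes pb = sym (coef-restrict-in d v b pb)
      ... | no nb = trans (h b nb) (sym (coef-restrict-out d v b nb))

  module _ {A C : Set} {{EA : BoolEq A}} {{EC : BoolEq C}} where
    Supported-extend-All : ∀ {Q : A → Set} {Pr : C → Set} (F : A → Comb C) v → AllSupported Q v → (∀ s → Q s → Supported Pr (F s)) → Supported Pr (extend F v)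
    Supported-extend-All F [] [] h = λ b nb → refl
    Supported-extend-All F ((a , s) ∷ v) (q ∷ qs) h = Supported-++ {x = smul a (F s)} {y = extend F v} (Supported-smul {x = F s} a (h s q)) (Supported-extend-All F v qs h)

    Supported-extend : ∀ {Q : A → Set} {Pr : C → Set} → Decidable Q → (F : A → Comb C) → ∀ {v} → Supported Q v → (∀ s → Q s → Supported Pr (F s)) → Supported Pr (extend F v)
    Supported-extend d F {v} hv h = Supported-≋ {x = extend F (restrict d v)} (extend-cong F (≋-sym (restrict-≋ d v hv))) (Supported-extend-All F (restrict d v) (restrict-All d v) h)

    Supported-fmap : ∀ {Q : A → Set} {Pr : C → Set} → Decidable Q → (f : A → C) → ∀ {v} → Supported Q v → (∀ s → Q s → Pr (f s)) → Supported Pr (fmap f v)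
    Supported-fmap d f {v} hv h = Supported-extend d (λ u → basis (f u)) {v} hv (λ s q → Supported-basis (f s) (h s q))

  open import Data.Nat.Solver using (module +-*-Solver)
  open +-*-Solver using (solve; _:=_; _:+_; con)

  leaves-prec : ∀ A lw lxk ly → lw +ℕ 1 ≡ lxk +ℕ ly → (A +ℕ lw) +ℕ 1 ≡ (A +ℕ lxk) +ℕ ly
  leaves-prec A lw lxk ly h = P.trans (NP.+-assoc A lw 1) (P.trans (P.cong (A +ℕ_) h) (P.sym (NP.+-assoc A lxk ly)))

  leaves-dot : ∀ a xsL lw ysL lyk lxk ly0 → lw +ℕ 1 ≡ lxk +ℕ ly0 →
    ((a +ℕ (xsL +ℕ (lw +ℕ ysL))) +ℕ lyk) +ℕ 1 ≡ ((a +ℕ xsL) +ℕ lxk) +ℕ ((ly0 +ℕ ysL) +ℕ lyk)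
  leaves-dot a xsL lw ysL lyk lxk ly0 h =
    P.trans (solve 5 (λ a xsL lw ysL lyk → ((a :+ (xsL :+ (lw :+ ysL))) :+ lyk) :+ con 1 := ((a :+ xsL) :+ (ysL :+ lyk)) :+ (lw :+ con 1)) P.refl a xsL lw ysL lyk)
    (P.trans (P.cong (((a +ℕ xsL) +ℕ (ysL +ℕ lyk)) +ℕ_) h)
    (solve 6 (λ a xsL ysL lyk lxk ly0 → ((a :+ xsL) :+ (ysL :+ lyk)) :+ (lxk :+ ly0) := ((a :+ xsL) :+ lxk) :+ ((ly0 :+ ysL) :+ lyk)) P.refl a xsL ysL lyk lxk ly0))

  leaves-succ : ∀ lw ysL lyk lx ly0 → lw +ℕ 1 ≡ lx +ℕ ly0 → ((lw +ℕ ysL) +ℕ lyk) +ℕ 1 ≡ lx +ℕ ((ly0 +ℕ ysL) +ℕ lyk)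
  leaves-succ lw ysL lyk lx ly0 h =
    P.trans (solve 3 (λ lw ysL lyk → ((lw :+ ysL) :+ lyk) :+ con 1 := (lw :+ con 1) :+ (ysL :+ lyk)) P.refl lw ysL lyk)
    (P.trans (P.cong (_+ℕ (ysL +ℕ lyk)) h)
    (solve 4 (λ lx ly0 ysL lyk → (lx :+ ly0) :+ (ysL :+ lyk) := lx :+ ((ly0 :+ ysL) :+ lyk)) P.refl lx ly0 ysL lyk))

  StarLeaves : Tree → Tree → Tree → Set
  StarLeaves s t w = leaves w +ℕ 1 ≡ leaves s +ℕ leaves t

  starLeaves? : ∀ s t → Decidable (StarLeaves s t)
  starLeaves? s t w = leaves w +ℕ 1 ℕ.≟ leaves s +ℕ leaves t

  star-leaves : ∀ s t → Supported (StarLeaves s t) (star s t)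
  star-leaves leaf t = Supported-basis {Pr = StarLeaves leaf t} t (NP.+-comm (leaves t) 1)
  star-leaves (node a ms b) leaf = Supported-basis {Pr = StarLeaves (node a ms b) leaf} (node a ms b) P.refl
  star-leaves X@(node x0 xs xk) Y@(node y0 ys yk) =
    Supported-≋ {x = fmap (node x0 xs) (star xk Y) ++ fmap (withMiddle x0 xs ys yk) (star xk y0) ++ fmap (withFirst ys yk) (star X y0)} (≋-sym (star-node-node x0 xs xk y0 ys yk))
    (Supported-++ {x = fmap (node x0 xs) (star xk Y)} {y = fmap (withMiddle x0 xs ys yk) (star xk y0) ++ fmap (withFirst ys yk) (star X y0)}
      (Supported-fmap (starLeaves? xk Y) (node x0 xs) {star xk Y} (star-leaves xk Y) (λ w h → leaves-prec (leaves x0 +ℕ leavesL xs) (leaves w) (leaves xk) (leaves Y) h))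
      (Supported-++ {x = fmap (withMiddle x0 xs ys yk) (star xk y0)} {y = fmap (withFirst ys yk) (star X y0)}
        (Supported-fmap (starLeaves? xk y0) (withMiddle x0 xs ys yk) {star xk y0} (star-leaves xk y0)
           (λ w h → P.trans (P.cong (λ z → ((leaves x0 +ℕ z) +ℕ leaves yk) +ℕ 1) (leavesL-++ xs (w ∷ ys)))
                    (leaves-dot (leaves x0) (leavesL xs) (leaves w) (leavesL ys) (leaves yk) (leaves xk) (leaves y0) h)))
        (Supported-fmap (starLeaves? X y0) (withFirst ys yk) {star X y0} (star-leaves X y0) (λ w h → leaves-succ (leaves w) (leavesL ys) (leaves yk) (leaves X) (leaves y0) h))))

  leaves-starPair : ∀ lw lg lh wx wy A B → lw +ℕ 1 ≡ lg +ℕ lh → lg +ℕ wx ≡ A +ℕ 1 → lh +ℕ wy ≡ B +ℕ 1 → lw +ℕ (wx +ℕ wy) ≡ (A +ℕ B) +ℕ 1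
  leaves-starPair lw lg lh wx wy A B h1 h2 h3 = NP.suc-injective (
    P.trans (solve 3 (λ lw wx wy → con 1 :+ (lw :+ (wx :+ wy)) := (lw :+ con 1) :+ (wx :+ wy)) P.refl lw wx wy)
    (P.trans (P.cong (_+ℕ (wx +ℕ wy)) h1)
    (P.trans (solve 4 (λ lg lh wx wy → (lg :+ lh) :+ (wx :+ wy) := (lg :+ wx) :+ (lh :+ wy)) P.refl lg lh wx wy)
    (P.trans (P.cong₂ _+ℕ_ h2 h3)
    (solve 2 (λ A B → (A :+ con 1) :+ (B :+ con 1) := con 1 :+ ((A :+ B) :+ con 1)) P.refl A B)))))

  -- Homogeneity in the form leaves G + leaves P = leaves t + 1 for every term G ⊗ P of Δ t.
  Weight : {X : Set} → (X → ℕ) → ℕ → Tree × X → Set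
  Weight w A gx = leaves (proj₁ gx) +ℕ w (proj₂ gx) ≡ A +ℕ 1

  weight? : {X : Set} → (w : X → ℕ) → ∀ A → Decidable (Weight w A)
  weight? w A gx = leaves (proj₁ gx) +ℕ w (proj₂ gx) ℕ.≟ A +ℕ 1

  module _ {X Y : Set} {{EX : BoolEq X}} {{EY : BoolEq Y}} where
    ⊛-weight : ∀ (wX : X → ℕ) (wY : Y → ℕ) A B u v → Supported (Weight wX A) u → Supported (Weight wY B) v →
      Supported (Weight (λ xy → wX (proj₁ xy) +ℕ wY (proj₂ xy)) (A +ℕ B)) (u ⊛ v)
    ⊛-weight wX wY A B u v hu hv = Supported-extend (weight? wX A) (λ gx → extend (starPair gx) v) {u} hu (λ gx hgx →
      Supported-extend (weight? wY B) (starPair gx) {v} hv (λ hy hhy →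
        Supported-fmap (starLeaves? (proj₁ gx) (proj₁ hy)) (λ w → (w , (proj₂ gx , proj₂ hy))) {star (proj₁ gx) (proj₁ hy)} (star-leaves (proj₁ gx) (proj₁ hy))
          (λ w hw → leaves-starPair (leaves w) (leaves (proj₁ gx)) (leaves (proj₁ hy)) (wX (proj₂ gx)) (wY (proj₂ hy)) A B hw hgx hhy)))

  Δ-weight : ∀ t → Supported (Weight leaves (leaves t)) (Δ t)
  ΔList-weight : ∀ ms → Supported (Weight leavesL (leavesL ms)) (ΔList ms)
  Δ-weight leaf = Supported-basis {Pr = Weight leaves 1} (leaf , leaf) P.refl
  Δ-weight (node a ms b) = Supported-≋ {x = basis (node a ms b , leaf) ++ ΔCuts a ms b} (≋-sym (Δ-node a ms b))
    (Supported-++ {x = basis (node a ms b , leaf)} {y = ΔCuts a ms b} (Supported-basis {Pr = Weight leaves (leaves (node a ms b))} (node a ms b , leaf) P.refl)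
      (Supported-fmap (weight? (λ q → (leaves (proj₁ (proj₁ q)) +ℕ leavesL (proj₂ (proj₁ q))) +ℕ leaves (proj₂ q)) (leaves (node a ms b))) (onSnd nodeOf) {ΔChildren a ms b}
        (⊛-weight (λ q → leaves (proj₁ q) +ℕ leavesL (proj₂ q)) leaves (leaves a +ℕ leavesL ms) (leaves b) (Δ a ⊛ ΔList ms) (Δ b)
          (⊛-weight leaves leavesL (leaves a) (leavesL ms) (Δ a) (ΔList ms) (Δ-weight a) (ΔList-weight ms)) (Δ-weight b))
        (λ q h → h)))
  ΔList-weight [] = Supported-basis {Pr = Weight leavesL 0} (leaf , []) P.refl
  ΔList-weight (m ∷ ms) = Supported-fmap (weight? (λ q → leaves (proj₁ q) +ℕ leavesL (proj₂ q)) (leaves m +ℕ leavesL ms)) (onSnd consPair) {Δ m ⊛ ΔList ms}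
    (⊛-weight leaves leavesL (leaves m) (leavesL ms) (Δ m) (ΔList ms) (Δ-weight m) (ΔList-weight ms)) (λ q h → h)

  OfDeg : ℕ → Tree → Set
  OfDeg n t = deg t ≡ n
  ofDeg? : ∀ n → Decidable (OfDeg n)
  ofDeg? n t = deg t ℕ.≟ n

  InDeg⇒Supported : ∀ {n x} → InDeg n x → Supported (OfDeg n) x
  InDeg⇒Supported {n} {x} h t nt = P.subst (_≈ 0#) (coeff≡coef x t) (h t nt)

  starV-graded : ∀ i j x y → InDeg i x → InDeg j y → InDeg (i +ℕ j) (starV x y)
  starV-graded i j x y hx hy t nt = P.subst (_≈ 0#) (P.sym (coeff≡coef (starV x y) t))
    (trans (at (starV≋starC x y) t) (Supported-extend (ofDeg? i) (λ s → extend (star s) y) {x} (InDeg⇒Supported {x = x} hx) (λ s hs →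
        Supported-extend (ofDeg? j) (star s) {y} (InDeg⇒Supported {x = y} hy) (λ u hu → Supported-mono {x = star s u} (ar s u hs hu) (star-leaves s u))) t nt))
    where
    ar : ∀ s u → deg s ≡ i → deg u ≡ j → ∀ w → StarLeaves s u w → deg w ≡ i +ℕ j
    ar s u hs hu w h = P.trans eq (P.cong₂ _+ℕ_ hs hu)
      where
      h' : suc (deg w) +ℕ 1 ≡ suc (deg s) +ℕ suc (deg u)
      h' = P.trans (P.cong (_+ℕ 1) (P.sym (leaves≡suc-deg w))) (P.trans h (P.cong₂ _+ℕ_ (leaves≡suc-deg s) (leaves≡suc-deg u)))
      eq : deg w ≡ deg s +ℕ deg u
      eq = NP.suc-injective (P.trans (NP.+-comm 1 (deg w)) (P.trans (NP.suc-injective h') (NP.+-suc (deg s) (deg u))))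

  ΔV-graded : ∀ n x → InDeg n x → InDeg2 n (ΔV x)
  ΔV-graded n x hx t u nt = P.subst (_≈ 0#) (P.sym (coeff2≡coef (ΔV x) t u))
    (trans (at (≡⇒≋ (ΔV≡extend x)) (t , u)) (Supported-extend (ofDeg? n) Δ {x} (InDeg⇒Supported {x = x} hx) (λ s hs → Supported-mono {x = Δ s} (ar s hs) (Δ-weight s)) (t , u) nt))
    where
    ar : ∀ s → deg s ≡ n → ∀ gp → Weight leaves (leaves s) gp → deg (proj₁ gp) +ℕ deg (proj₂ gp) ≡ n
    ar s hs (g , p) h = P.trans eq hs
      where
      h' : suc (deg g) +ℕ suc (deg p) ≡ suc (deg s) +ℕ 1
      h' = P.trans (P.sym (P.cong₂ _+ℕ_ (leaves≡suc-deg g) (leaves≡suc-deg p))) (P.trans h (P.cong (_+ℕ 1) (leaves≡suc-deg s)))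
      eq : deg g +ℕ deg p ≡ deg s
      eq = NP.suc-injective (P.trans (P.sym (NP.+-suc (deg g) (deg p))) (P.trans (NP.suc-injective h') (NP.+-comm (deg s) 1)))

  T₀-singleton : (deg leaf ≡ 0) × (∀ t → deg t ≡ 0 → t ≡ leaf)
  T₀-singleton = P.refl , lem
    where
    lem : ∀ t → deg t ≡ 0 → t ≡ leaf
    lem leaf _ = P.refl
    lem (node a ms b) h rewrite leaves≡suc-deg a | leaves≡suc-deg b with NP.m+n≡0⇒n≡0 (deg a +ℕ leavesL ms) h
    ... | ()


module Uniqueness {c ℓ} (R : CommutativeRing c ℓ) where

  open import Data.Nat as ℕ using (zero; suc; _≤_; s≤s) renaming (_+_ to _+ℕ_)
  open import Data.Nat.Properties as NP using (≤-trans; m≤m+n; +-monoˡ-≤; +-monoʳ-≤)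
  open import Data.List using ([]; _∷_; _++_)
  open import Data.Product using (_,_; proj₁)
  import Relation.Binary.PropositionalEquality as P
  open import Defs
  open TreeSize
  open Grading R public
  open CommutativeRing R
  open TD R
  open import Data.Nat.Solver using (module +-*-Solver)
  open +-*-Solver using (solve; _:=_; _:+_; con)

  Δ-Y : Δ Y ≋ single2 Y leaf ++ single2 leaf Y
  Δ-Y = ∷-cong (Y , leaf) refl (∷-cong (leaf , Y) (*-identityˡ 1#) ≋-refl)

  prec-into-last : ∀ a ms c ns d → prec (node a ms leaf) (node c ns d) ≋ basis (node a ms (node c ns d))
  prec-into-last a ms c ns d = let b = node c ns d in
    ≋-trans (graft-basis-middle (basis a) ms (basis b)) (≋-trans (extend-basis (λ t₀ → fmap (node t₀ ms) (basis b)) a) (extend-basis (λ u → basis (node a ms u)) b))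

  succ-into-first : ∀ a0 as ak ms → succ (node a0 as ak) (node leaf ms leaf) ≋ basis (node (node a0 as ak) ms leaf)
  succ-into-first a0 as ak ms = let a = node a0 as ak in
    ≋-trans (graft-basis-middle (basis a) ms (basis leaf)) (≋-trans (extend-basis (λ t₀ → fmap (node t₀ ms) (basis leaf)) a) (extend-basis (λ u → basis (node a ms u)) leaf))

  dot-into-middle : ∀ m ms → dot (node leaf [] m) (node leaf ms leaf) ≋ basis (node leaf (m ∷ ms) leaf)
  dot-into-middle m ms =
    ≋-trans (dot-node leaf [] m leaf ms leaf) (≋-trans (fmap-cong (withMiddle leaf [] ms leaf) (star-leafʳ m)) (extend-basis (λ u → basis (withMiddle leaf [] ms leaf u)) m))

  leaves-prec-left : ∀ a ms c ns d → suc (leaves (node a ms leaf)) ≤ leaves (node a ms (node c ns d))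
  leaves-prec-left a ms c ns d =
    P.subst (_≤ leaves (node a ms (node c ns d))) (solve 2 (λ A B → (A :+ B) :+ con 2 := con 1 :+ ((A :+ B) :+ con 1)) P.refl (leaves a) (leavesL ms))
      (+-monoʳ-≤ (leaves a +ℕ leavesL ms) (2≤leaves-node c ns d))

  leaves-prec-right : ∀ a ms b → suc (leaves b) ≤ leaves (node a ms b)
  leaves-prec-right a ms b = +-monoˡ-≤ (leaves b) (≤-trans (1≤leaves a) (m≤m+n (leaves a) (leavesL ms)))

  leaves-succ-left : ∀ a ms → suc (leaves a) ≤ leaves (node a ms leaf)
  leaves-succ-left a ms = P.subst (_≤ leaves (node a ms leaf)) (NP.+-comm (leaves a) 1) (+-monoˡ-≤ 1 (m≤m+n (leaves a) (leavesL ms)))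

  leaves-succ-right : ∀ a0 as ak ms → suc (leaves (node leaf ms leaf)) ≤ leaves (node (node a0 as ak) ms leaf)
  leaves-succ-right a0 as ak ms =
    P.subst (_≤ leaves (node (node a0 as ak) ms leaf)) (solve 1 (λ B → (con 2 :+ B) :+ con 1 := con 1 :+ ((con 1 :+ B) :+ con 1)) P.refl (leavesL ms))
      (+-monoˡ-≤ 1 (+-monoˡ-≤ (leavesL ms) (2≤leaves-node a0 as ak)))

  leaves-dot-left : ∀ m ms → suc (leaves (node leaf [] m)) ≤ leaves (node leaf (m ∷ ms) leaf)
  leaves-dot-left m ms = ≤-trans (m≤m+n (suc (1 +ℕ leaves m)) (leavesL ms))
    (NP.≤-reflexive (solve 2 (λ M B → (con 1 :+ (con 1 :+ M)) :+ B := (con 1 :+ (M :+ B)) :+ con 1) P.refl (leaves m) (leavesL ms)))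

  leaves-dot-right : ∀ m ms → suc (leaves (node leaf ms leaf)) ≤ leaves (node leaf (m ∷ ms) leaf)
  leaves-dot-right m ms = ≤-trans (NP.≤-reflexive (solve 1 (λ B → con 1 :+ ((con 1 :+ B) :+ con 1) := (con 1 :+ (con 1 :+ B)) :+ con 1) P.refl (leavesL ms)))
    (+-monoˡ-≤ 1 (s≤s (+-monoˡ-≤ (leavesL ms) (1≤leaves m))))

  <-bound : ∀ {x y n} → suc x ≤ y → y ≤ suc n → x ≤ n
  <-bound p h = NP.≤-pred (≤-trans p h)

  -- Every tree other than | and Y is x ≺ y (last child y ≠ |), x ≻ y (first child x ≠ |) or, when both
  -- outer children are |, (| ∨ m) · (| ∨ ⋯ ∨ |), with x and y smaller; so D is determined by D Y.
  module _ (D : Tree → V2) (hl : D leaf ≈2 single2 leaf leaf) (hY : D Y ≈2 (single2 Y leaf ++ single2 leaf Y)) (hP : PreservesTri D) where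

    agree-on-op : ∀ o x y t → opTree o x y ≋ basis t → coef (basis x) leaf ≈ 0# → coef (basis y) leaf ≈ 0# → D x ≋ Δ x → D y ≋ Δ y → D t ≋ Δ t
    agree-on-op o x y t ht hx hy ihx ihy =
      ≋-trans (≋-sym (extend-basis D t))
      (≋-trans (extend-cong D (≋-sym ht))
      (≋-trans (extend-cong D (≋-sym (≋-trans (bilin≋extend (opTree o) (basis x) (basis y)) (≋-trans (extend-basis (λ s → extend (opTree o s) (basis y)) x) (extend-basis (opTree o x) y)))))
      (≋-trans (≡⇒≋ (P.sym (lin2≡extend D (opV o (basis x) (basis y)))))
      (≋-trans (≈2⇒≋ (hP o (basis x) (basis y) (P.subst (_≈ 0#) (P.sym (coeff≡coef (basis x) leaf)) hx) (P.subst (_≈ 0#) (P.sym (coeff≡coef (basis y) leaf)) hy)))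
      (≋-trans (opT≋opC o (lin2 D (basis x)) (lin2 D (basis y)))
      (≋-trans (opC-cong o (≋-trans (≡⇒≋ (lin2≡extend D (basis x))) (≋-trans (extend-basis D x) ihx)) (≋-trans (≡⇒≋ (lin2≡extend D (basis y))) (≋-trans (extend-basis D y) ihy)))
      (≋-trans (≋-sym (proj₁ (Δ-products x y) o))
      (≋-trans (extend-cong Δ ht) (extend-basis Δ t)))))))))

    Δ-unique≤ : ∀ n t → leaves t ≤ n → D t ≋ Δ t
    Δ-unique≤ zero t h with ≤-trans (1≤leaves t) h
    ... | ()
    Δ-unique≤ (suc n) leaf h = ≈2⇒≋ hl
    Δ-unique≤ (suc n) (node a ms b@(node c ns d)) h =
      agree-on-op `≺ (node a ms leaf) b _ (prec-into-last a ms c ns d) refl refl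
        (Δ-unique≤ n _ (<-bound (leaves-prec-left a ms c ns d) h)) (Δ-unique≤ n b (<-bound (leaves-prec-right a ms b) h))
    Δ-unique≤ (suc n) (node a@(node a0 as ak) ms leaf) h =
      agree-on-op `≻ a (node leaf ms leaf) _ (succ-into-first a0 as ak ms) refl refl
        (Δ-unique≤ n a (<-bound (leaves-succ-left a ms) h)) (Δ-unique≤ n _ (<-bound (leaves-succ-right a0 as ak ms) h))
    Δ-unique≤ (suc n) (node leaf [] leaf) h = ≋-trans (≈2⇒≋ hY) (≋-sym Δ-Y)
    Δ-unique≤ (suc n) (node leaf (m ∷ ms) leaf) h =
      agree-on-op `· (node leaf [] m) (node leaf ms leaf) _ (dot-into-middle m ms) refl refl
        (Δ-unique≤ n _ (<-bound (leaves-dot-left m ms) h)) (Δ-unique≤ n _ (<-bound (leaves-dot-right m ms) h))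

  Δ-unique : ∀ (D : Tree → V2) → D leaf ≈2 single2 leaf leaf → D Y ≈2 (single2 Y leaf ++ single2 leaf Y) →
             PreservesTri D → ∀ t → D t ≈2 Δ t
  Δ-unique D hl hY hP t = ≋⇒≈2 (Δ-unique≤ D hl hY hP (leaves t) t NP.≤-refl)

mainTheorem8 : ∀ {c ℓ} (R : CommutativeRing c ℓ) → TD.IsField R →
    let open TD R in
    IsGradedConnectedBialgebra
    × PreservesTri Δ
    × (∀ (D : Tree → V2) →
    D leaf ≈2 single2 leaf leaf →
    D Y ≈2 (single2 Y leaf ++ single2 leaf Y) →
    PreservesTri D →
    ∀ t → D t ≈2 Δ t)
mainTheorem8 R _ = bialgebra , Δ-preservesTri , Δ-unique
  where
  open Uniqueness R
  bialgebra : TD.IsGradedConnectedBialgebra R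
  bialgebra = record
    { ⋆-assoc = starV-assoc
    ; ⋆-identityˡ = starV-identityˡ
    ; ⋆-identityʳ = starV-identityʳ
    ; Δ-coassoc = ΔV-coassoc
    ; ε-counitˡ = ΔV-counitˡ
    ; ε-counitʳ = ΔV-counitʳ
    ; Δ-* = ΔV-star
    ; Δ-unit = ΔV-unit
    ; ε-* = ε-starV
    ; ε-unit = ε-unit-leaf
    ; finiteDim = FiniteDimension.treesOfDeg-finite
    ; grade-* = starV-graded
    ; grade-Δ = ΔV-graded
    ; connected = T₀-singleton
    }
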